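{- For all $r\ge1$, $k_1,\dots,k_r\ge1$ and $d_1,\dots,d_r\ge0$, $$q\frac{d}{dq}G[k_1,\dots,k_r\mid d_1,\dots,d_r]=\sum_{i=1}^rk_i\,G[k_1,\dots,k_i+1,\dots,k_r\mid d_1,\dots,d_i+1,\dots,d_r].$$
   Context: Fixed mould $\beta$: $\beta^{(0)}=1$, $\beta(X_1,\dots,X_r)=\sum_{k_i\ge1}\beta(k_1,\dots,k_r)X_1^{k_1-1}\cdots X_r^{k_r-1}\in\mathbb{Q}[[X_1,\dots,X_r]]$, with: (i) $\beta(X)=-\sum_{k\ge2}\frac{B_k}{2\,k!}X^{k-1}$ ($B_k$ Bernoulli numbers); (ii) $z_{k_1}\cdots z_{k_r}\mapsto\beta(k_1,\dots,k_r)$ is an algebra homomorphism from $\mathbb{Q}\langle z_1,z_2,\dots\rangle$ with the stuffle product to $\mathbb{Q}$; (iii) with $\sum_j\gamma_jT^j=\exp(\sum_{n\ge2}\frac{(-1)^n}{n}\beta(n)T^n)$ and $\beta_\gamma(X_1,\dots,X_r)=\sum_{j=0}^r\gamma_j\beta(X_1+\dots+X_{r-j},\dots,X_1+X_2,X_1)$, the map sending $z_{k_1}\cdots z_{k_r}$ to the coefficient of $X_1^{k_1-1}\cdots X_r^{k_r-1}$ in $\beta_\gamma$ is an algebra homomorphism for the shuffle product. (Quasi-shuffle product for a commutative associative $\diamond$ on $\mathbb{Q}L$: $\mathbf 1\ast w=w\ast\mathbf 1=w$, $aw\ast bv=a(w\ast bv)+b(aw\ast v)+(a\diamond b)(w\ast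 v)$; stuffle: $z_i\diamond z_j=z_{i+j}$; shuffle: $z_i\diamond z_j=0$.) Construction (bimoulds are families of power series $B[X_1,\dots,X_r\mid Y_1,\dots,Y_r]$, depth-0 part $1$): $\mathfrak b[X_1,\dots,X_r\mid Y_1,\dots,Y_r]=\sum_{0\le i\le j\le r}\gamma_i\beta(Y_1+\dots+Y_{j-i},\dots,Y_1+Y_2,Y_1)\beta(X_{j+1},\dots,X_r)$; $\tilde{\mathfrak b}[X_1,\dots,X_r\mid Y_1,\dots,Y_r]=\sum_{i=0}^r\frac{(-1)^i}{2^ii!}\mathfrak b[X_{i+1},\dots,X_r\mid-Y_1,\dots,-Y_{r-i}]$; $L_m[X\mid Y]=\frac{e^{X+mY}q^m}{1-e^Xq^m}$; $\mathfrak L_m[X_1,\dots,X_r\mid Y_1,\dots,Y_r]=\sum_{j=1}^r\mathfrak b[X_1-X_j,\dots,X_{j-1}-X_j\mid Y_1,\dots,Y_{j-1}]L_m[X_j\mid Y_1+\dots+Y_r]\tilde{\mathfrak b}[X_r-X_j,\dots,X_{j+1}-X_j\mid Y_r,\dots,Y_{j+1}]$; $\mathfrak g^*[X_1,\dots,X_r\mid Y_1,\dots,Y_r]=\sum_{j=1}^r\sum_{0=r_0<\dots<r_j=r}\sum_{m_1>\dots>m_j>0}\prod_{i=1}^j\mathfrak L_{m_i}[X_{r_{i-1}+1},\dots,X_{r_i}\mid Y_{r_{i-1}+1},\dots,Y_{r_i}]$; $\mathfrak G[X_1,\dots,X_r\mid Y_1,\dots,Y_r]=\sum_{j=0}^r\mathfrak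 g^*[X_1,\dots,X_j\mid Y_1,\dots,Y_j]\mathfrak b[X_{j+1},\dots,X_r\mid Y_{j+1},\dots,Y_r]$. The combinatorial bi-multiple Eisenstein series $G[k_1,\dots,k_r\mid d_1,\dots,d_r]\in\mathbb{Q}[[q]]$ are defined by $\mathfrak G[X_1,\dots,X_r\mid Y_1,\dots,Y_r]=\sum G[k_1,\dots,k_r\mid d_1,\dots,d_r]X_1^{k_1-1}\cdots X_r^{k_r-1}\frac{Y_1^{d_1}}{d_1!}\cdots\frac{Y_r^{d_r}}{d_r!}$. -}

module Defs where

open import Data.Nat as N using (ℕ; zero; suc; _+_; _*_; _∸_; _≡ᵇ_; _<ᵇ_; _≤ᵇ_; _!; _≤_)
open import Data.Nat.Properties using (_!≢0)
open import Data.Nat.Combinatorics using (_C_)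
open import Data.Integer using (+_)
open import Data.Rational using (ℚ; 0ℚ; 1ℚ; _/_)
  renaming (_+_ to _+ℚ_; _*_ to _*ℚ_; -_ to -ℚ_; _-_ to _-ℚ_)
open import Data.Bool using (Bool; true; false; if_then_else_; _∧_)
open import Data.List as L using (List; []; _∷_; _++_; map; concatMap; upTo)
open import Data.List.Relation.Unary.All as LAll using ()
open import Data.Vec as V using (Vec; []; _∷_)
open import Relation.Binary.PropositionalEquality using (_≡_)

ℕ→ℚ : ℕ → ℚ
ℕ→ℚ n = + n / 1

inv! : ℕ → ℚ
inv! n = (+ 1 / (n !)) {{n !≢0}}

_^ℚ_ : ℚ → ℕ → ℚ
p ^ℚ zero = 1ℚ
p ^ℚ suc n = p *ℚ (p ^ℚ n)

Σℚ : List ℚ → ℚ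
Σℚ = L.foldr _+ℚ_ 0ℚ

Πℚ : List ℚ → ℚ
Πℚ = L.foldr _*ℚ_ 1ℚ

Σ< : ℕ → (ℕ → ℚ) → ℚ
Σ< n f = Σℚ (map f (upTo n))

Σ≤ : ℕ → (ℕ → ℚ) → ℚ
Σ≤ n f = Σ< (suc n) f

[_] : Bool → ℚ
[ b ] = if b then 1ℚ else 0ℚ

lookupℚ : List ℚ → ℕ → ℚ
lookupℚ [] _ = 0ℚ
lookupℚ (x ∷ xs) zero = x
lookupℚ (x ∷ xs) (suc n) = lookupℚ xs n

-- Bernoulli numbers: B_0 = 1, B_m = -(1/(m+1)) Σ_{k<m} C(m+1,k) B_k
-- (convention B_1 = -1/2; only B_k with k ≥ 2 are used)

bernoulliList : ℕ → List ℚ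
bernoulliList zero = 1ℚ ∷ []
bernoulliList (suc n) = bs ++ (next ∷ [])
  where
  bs = bernoulliList n
  next = -ℚ ((+ 1 / suc (suc n)) *ℚ
           Σ< (suc n) (λ k → ℕ→ℚ (suc (suc n) C k) *ℚ lookupℚ bs k))

bernoulli : ℕ → ℚ
bernoulli n = lookupℚ (bernoulliList n) n

-- Formal power series over ℚ in n commuting variables (indexed 0..n-1),
-- given by their coefficient function on exponent vectors.

PS : ℕ → Set
PS n = Vec ℕ n → ℚ

sumV : ∀ {n} → Vec ℕ n → ℕ
sumV = V.sum

below : ∀ {n} → Vec ℕ n → List (Vec ℕ n)
below [] = [] ∷ []
below (x ∷ e) = concatMap (λ i → map (i ∷_) (below e)) (upTo (suc x))

ofDeg : (m d : ℕ) → List (Vec ℕ m)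
ofDeg zero zero = [] ∷ []
ofDeg zero (suc d) = []
ofDeg (suc m) d = concatMap (λ i → map (i ∷_) (ofDeg m (d ∸ i))) (upTo (suc d))

onePS : ∀ {n} → PS n
onePS e = [ sumV e ≡ᵇ 0 ]

_·_ : ∀ {n} → PS n → PS n → PS n
(f · g) e = Σℚ (map (λ a → f a *ℚ g (V.zipWith _∸_ e a)) (below e))

infixl 7 _·_

_•_ : ∀ {n} → ℚ → PS n → PS n
(c • f) e = c *ℚ f e

ΣPS≤ : ∀ {n} → ℕ → (ℕ → PS n) → PS n
ΣPS≤ k F e = Σ≤ k (λ i → F i e)

ΣPS< : ∀ {n} → ℕ → (ℕ → PS n) → PS n
ΣPS< k F e = Σ< k (λ i → F i e)

ΣPSL : ∀ {n} {A : Set} → List A → (A → PS n) → PS n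
ΣPSL xs F e = Σℚ (map (λ x → F x e) xs)

powPS : ∀ {n} → PS n → ℕ → PS n
powPS f zero = onePS
powPS f (suc k) = f · powPS f k

dotV : ∀ {n} → (ℕ → ℚ) → Vec ℕ n → ℚ
dotV c [] = 0ℚ
dotV c (x ∷ e) = (c 0 *ℚ ℕ→ℚ x) +ℚ dotV (λ t → c (suc t)) e

linPS : ∀ {n} → (ℕ → ℚ) → PS n
linPS c e = if sumV e ≡ᵇ 1 then dotV c e else 0ℚ

monoL : ∀ {n} {m} → Vec ℕ m → (ℕ → ℕ → ℚ) → PS n
monoL [] L = onePS
monoL (a ∷ as) L = powPS (linPS (L 0)) a · monoL as (λ i → L (suc i))

-- linear substitution  f(L_0(x), ..., L_{m-1}(x)),  L a v = coefficient
-- of the variable x_v in the a-th argument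
subst : ∀ {n} (m : ℕ) → PS m → (ℕ → ℕ → ℚ) → PS n
subst m f L e = Σℚ (map (λ a → f a *ℚ monoL a L e) (ofDeg m (sumV e)))

-- Quasi-shuffle products of words (words = lists of letter indices k,
-- letter k standing for z_k), returned as the list of words (with
-- multiplicity) whose formal sum is the product.

stuffle : List ℕ → List ℕ → List (List ℕ)
stuffle [] v = v ∷ []
stuffle (a ∷ w) [] = (a ∷ w) ∷ []
stuffle (a ∷ w) (b ∷ v) =
  map (a ∷_) (stuffle w (b ∷ v)) ++
  map (b ∷_) (stuffle (a ∷ w) v) ++
  map ((a + b) ∷_) (stuffle w v)

shuffle : List ℕ → List ℕ → List (List ℕ)
shuffle [] v = v ∷ []
shuffle (a ∷ w) [] = (a ∷ w) ∷ []
shuffle (a ∷ w) (b ∷ v) =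
  map (a ∷_) (shuffle w (b ∷ v)) ++
  map (b ∷_) (shuffle (a ∷ w) v)

IsHom : (List ℕ → List ℕ → List (List ℕ)) → (List ℕ → ℚ) → Set
IsHom prod φ = (φ [] ≡ 1ℚ) ×' ((u v : List ℕ) → LAll.All (1 ≤_) u → LAll.All (1 ≤_) v →
               Σℚ (map φ (prod u v)) ≡ φ u *ℚ φ v)
  where
  open import Data.Product using () renaming (_×_ to _×'_)

-- Moulds.  A mould β is given by its coefficients β(k_1,...,k_r)
-- (a function on words k_1...k_r); β(X_1..X_r) is the power series
-- Σ β(k_1..k_r) X_1^{k_1-1} ... X_r^{k_r-1}.

Mould : Set
Mould = List ℕ → ℚ

compsF : ℕ → ℕ → List (List ℕ)
compsF fuel zero = [] ∷ []
compsF zero (suc n) = []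
compsF (suc f) (suc n) =
  concatMap (λ p → map (suc p ∷_) (compsF f (n ∸ p))) (upTo (suc n))

comps : ℕ → List (List ℕ)
comps r = compsF r r

chains : ℕ → ℕ → List (List ℕ)
chains zero M = [] ∷ []
chains (suc j) M = concatMap (λ i → map (suc i ∷_) (chains j i)) (upTo M)

module _ (β : Mould) where

  βps : (r : ℕ) → PS r
  βps r e = β (map suc (V.toList e))

  hser : ℕ → ℚ
  hser zero = 0ℚ
  hser (suc zero) = 0ℚ
  hser (suc (suc m)) =
    ((-ℚ 1ℚ) ^ℚ suc (suc m)) *ℚ ((+ 1 / suc (suc m)) *ℚ β (suc (suc m) ∷ []))

  mul1 : (ℕ → ℚ) → (ℕ → ℚ) → ℕ → ℚ
  mul1 f g n = Σ≤ n (λ a → f a *ℚ g (n ∸ a))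

  pow1 : (ℕ → ℚ) → ℕ → ℕ → ℚ
  pow1 f zero n = [ n ≡ᵇ 0 ]
  pow1 f (suc k) = mul1 f (pow1 f k)

  γ : ℕ → ℚ
  γ j = Σ≤ j (λ k → inv! k *ℚ pow1 hser k j)

  -- β_γ(X_1,...,X_r) = Σ_j γ_j β(X_1+...+X_{r-j}, ..., X_1+X_2, X_1)
  βγps : (r : ℕ) → PS r
  βγps r = ΣPS≤ r (λ j → γ j • subst (r ∸ j) (βps (r ∸ j))
                                   (λ t v → [ v <ᵇ (r ∸ j ∸ t) ]))

  -- coefficient of X_1^{k_1-1}...X_r^{k_r-1} in β_γ
  βγ : Mould
  βγ ks = βγps _ (V.fromList (map (_∸ 1) ks))

  -- Bimoulds of depth r: power series in X_1..X_r, Y_1..Y_r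
  -- (variable t = X_{t+1} for t < r, variable r+t = Y_{t+1}).

  𝔟 : (r : ℕ) → PS (r + r)
  𝔟 r = ΣPS≤ r (λ j → ΣPS≤ j (λ i → γ i •
          ( subst (j ∸ i) (βps (j ∸ i))
              (λ t v → [ (r ≤ᵇ v) ∧ ((v ∸ r) <ᵇ (j ∸ i ∸ t)) ])
          · subst (r ∸ j) (βps (r ∸ j)) (λ t v → [ v ≡ᵇ j + t ]))))

  𝔟~ : (r : ℕ) → PS (r + r)
  𝔟~ r = ΣPS≤ r (λ i →
           ((((-ℚ 1ℚ) ^ℚ i) *ℚ ((+ 1 / 2) ^ℚ i)) *ℚ inv! i) •
           subst ((r ∸ i) + (r ∸ i)) (𝔟 (r ∸ i))
             (λ a v → if a <ᵇ (r ∸ i) then [ v ≡ᵇ i + a ]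
                      else -ℚ [ v ≡ᵇ r + (a ∸ (r ∸ i)) ]))

  -- L_m[X|Y] = e^{X+mY} q^m / (1 - e^X q^m) = Σ_{n≥1} e^{nX+mY} q^{mn},
  -- as a power series in the variables (q, X, Y)
  Lm : ℕ → PS 3
  Lm m (a ∷ b ∷ c ∷ []) =
    Σ≤ a (λ n → [ (1 ≤ᵇ n) ∧ (m * n ≡ᵇ a) ] *ℚ
                ((ℕ→ℚ n ^ℚ b) *ℚ ((ℕ→ℚ m ^ℚ c) *ℚ (inv! b *ℚ inv! c))))

  -- Depth-s series involving q: variables q (index 0), X_{t+1} (index
  -- 1+t), Y_{t+1} (index 1+s+t).

  𝔏 : (m s : ℕ) → PS (suc (s + s))
  𝔏 m s = ΣPS< s (λ j →
      subst (j + j) (𝔟 j)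
        (λ a v → if a <ᵇ j then [ v ≡ᵇ 1 + a ] -ℚ [ v ≡ᵇ 1 + j ]
                 else [ v ≡ᵇ 1 + s + (a ∸ j) ])
    · subst 3 (Lm m)
        (λ a v → if a ≡ᵇ 0 then [ v ≡ᵇ 0 ]
                 else if a ≡ᵇ 1 then [ v ≡ᵇ 1 + j ]
                 else [ (1 + s ≤ᵇ v) ∧ (v <ᵇ 1 + s + s) ])
    · subst ((s ∸ suc j) + (s ∸ suc j)) (𝔟~ (s ∸ suc j))
        (λ a v → if a <ᵇ (s ∸ suc j)
                 then [ v ≡ᵇ 1 + (s ∸ suc a) ] -ℚ [ v ≡ᵇ 1 + j ]
                 else [ v ≡ᵇ 1 + s + (s ∸ suc (a ∸ (s ∸ suc j))) ]))

  -- Π_i 𝔏_{m_i}[block i], blocks of sizes ss starting at offset o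
  blockProd : (r : ℕ) → List ℕ → List ℕ → ℕ → PS (suc (r + r))
  blockProd r (s ∷ ss) (m ∷ ms) o =
    subst (suc (s + s)) (𝔏 m s)
      (λ a v → if a ≡ᵇ 0 then [ v ≡ᵇ 0 ]
               else if a ≤ᵇ s then [ v ≡ᵇ o + a ]
               else [ v ≡ᵇ 1 + r + o + (a ∸ suc s) ])
    · blockProd r ss ms (o + s)
  blockProd r _ _ o = onePS

  -- 𝔤*, with the sum over m_1 > ... > m_j > 0 truncated to m_1 ≤ M
  -- (exact for all q-coefficients of order ≤ M, since the term has
  -- q-order ≥ m_1)
  𝔤* : (M r : ℕ) → PS (suc (r + r))
  𝔤* M r = ΣPSL (comps r) (λ c → ΣPSL (chains (L.length c) M)
                                  (λ ms → blockProd r c ms 0))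

  𝔊 : (M r : ℕ) → PS (suc (r + r))
  𝔊 M r = ΣPS≤ r (λ j →
      subst (suc (j + j)) (𝔤* M j)
        (λ a v → if a ≡ᵇ 0 then [ v ≡ᵇ 0 ]
                 else if a ≤ᵇ j then [ v ≡ᵇ a ]
                 else [ v ≡ᵇ 1 + r + (a ∸ suc j) ])
    · subst ((r ∸ j) + (r ∸ j)) (𝔟 (r ∸ j))
        (λ a v → if a <ᵇ (r ∸ j) then [ v ≡ᵇ 1 + j + a ]
                 else [ v ≡ᵇ 1 + r + j + (a ∸ (r ∸ j)) ]))

  -- G[k_1..k_r | d_1..d_r] ∈ ℚ[[q]], as its sequence of q-coefficients:
  -- d_1!...d_r! times the coefficient of q^N X^{k-1} Y^d in 𝔊.
  G : ∀ {r} → Vec ℕ r → Vec ℕ r → ℕ → ℚ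
  G {r} ks ds N =
    Πℚ (map (λ d → ℕ→ℚ (d !)) (V.toList ds)) *ℚ
    𝔊 N r (N ∷ (V.map (_∸ 1) ks V.++ ds))

-- coefficient of X^e in -Σ_{k≥2} B_k/(2 k!) X^{k-1}
βdepth1 : ℕ → ℚ
βdepth1 zero = 0ℚ
βdepth1 (suc e) = -ℚ (bernoulli (suc (suc e)) *ℚ ((+ 1 / 2) *ℚ inv! (suc (suc e))))

record IsFixedMould (β : Mould) : Set where
  field
    depth0     : β [] ≡ 1ℚ
    depth1     : (e : ℕ) → β (suc e ∷ []) ≡ βdepth1 e
    stuffleHom : IsHom stuffle β
    shuffleHom : IsHom shuffle (βγ β)

qddq : (ℕ → ℚ) → ℕ → ℚ
qddq f N = ℕ→ℚ N *ℚ f N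

module Submission where

-- In terms of the generating series 𝔊, the claim is the heat equation q∂_q 𝔊 = Σ_t ∂_{X_t} ∂_{Y_t} 𝔊,
-- read off coefficientwise.  It holds termwise for L_m.  The mould factors 𝔟 and 𝔟~ do not involve q
-- and are killed by ∂_{X_α} ∂_{Y_β} whenever α ≤ β; inside 𝔏_m they are evaluated at differences
-- X_a − X_j, which Σ_t ∂_{X_t} kills as well, so the equation passes from L_m to 𝔏_m.  Sums,
-- products of blocks in disjoint variables, and the linear substitutions placing a block among the
-- variables of 𝔊 preserve the equation; this gives it for 𝔤* and then for 𝔊.

open import Defs
open import Data.Nat using (ℕ; suc; _≤_)
open import Data.Fin using (Fin)
open import Data.Vec using (Vec; lookup; _[_]%=_)
open import Data.Vec.Relation.Unary.All using (All)
open import Data.List using (map)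
open import Data.List.Base using (allFin)
open import Data.Rational using (ℚ) renaming (_*_ to _*ℚ_)
open import Relation.Binary.PropositionalEquality using (_≡_)

open import Data.Nat as N using (zero; _+_; _*_; _∸_; _!; _≡ᵇ_; _<ᵇ_; _≤ᵇ_; NonZero)
import Data.Nat.Properties as NP
open import Data.Nat.Properties using (_!≢0)
open import Data.Nat.ListAction using (sum)
import Data.Nat.Tactic.RingSolver as ℕ-Solver
import Data.Integer as Z
import Data.Integer.Properties as ZP
open import Data.Rational using (0ℚ; 1ℚ; toℚᵘ; _/_) renaming (_+_ to _+ℚ_; -_ to -ℚ_; _-_ to _-ℚ_)
import Data.Rational.Properties as Q
open import Data.Rational.Unnormalised as U using (mkℚᵘ; *≡*)
import Data.Rational.Unnormalised.Properties as UP
open import Data.List as L using (List; []; _∷_; upTo; applyUpTo)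
import Data.List.Properties as LP
import Data.List.Relation.Unary.All as AllL
import Data.List.Relation.Unary.All.Properties as AllLP
open import Data.Vec as V using ([]; _∷_)
import Data.Vec.Properties as VP
import Data.Vec.Relation.Unary.All.Properties as AllVP
open import Data.Fin using (toℕ) renaming (zero to fz; suc to fs)
open import Data.Bool as Bool using (Bool; true; false; if_then_else_; _∧_)
import Data.Bool.Properties as BP
open import Data.Empty using (⊥-elim)
open import Data.Sum using (_⊎_; inj₁; inj₂)
open import Data.Maybe using (Maybe; nothing; just)
open import Relation.Nullary using (¬_; yes; no)
open import Relation.Binary.PropositionalEquality hiding ([_]; subst)
import Relation.Binary.PropositionalEquality as ≡
open ≡-Reasoning
open import Tactic.RingSolver using (solve-∀)
open import Tactic.RingSolver.Core.AlmostCommutativeRing using (AlmostCommutativeRing; fromCommutativeRing)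

ℚ-ring : AlmostCommutativeRing _ _
ℚ-ring = fromCommutativeRing Q.+-*-commutativeRing isZero
  where
  isZero : (x : ℚ) → Maybe (0ℚ ≡ x)
  isZero x with 0ℚ Q.≟ x
  ... | yes p = just p
  ... | no _ = nothing

ℤ-ring : AlmostCommutativeRing _ _
ℤ-ring = fromCommutativeRing ZP.+-*-commutativeRing (λ _ → nothing)

*-leftComm : ∀ a b c → a *ℚ (b *ℚ c) ≡ b *ℚ (a *ℚ c)
*-leftComm = solve-∀ ℚ-ring

-- ℕ→ℚ n is the normalisation of n/1; comparing unnormalised representatives
-- reduces its arithmetic to identities between integers.
toℚᵘ-ℕ→ℚ : ∀ k → toℚᵘ (ℕ→ℚ k) U.≃ mkℚᵘ (Z.+ k) 0
toℚᵘ-ℕ→ℚ k = Q.toℚᵘ-fromℚᵘ (mkℚᵘ (Z.+ k) 0)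

ℕ→ℚ-+ : ∀ a b → ℕ→ℚ (a + b) ≡ ℕ→ℚ a +ℚ ℕ→ℚ b
ℕ→ℚ-+ a b = Q.toℚᵘ-injective (UP.≃-trans (toℚᵘ-ℕ→ℚ (a + b)) (UP.≃-trans (*≡* (integral (Z.+ a) (Z.+ b)))
  (UP.≃-sym (UP.≃-trans (Q.toℚᵘ-homo-+ (ℕ→ℚ a) (ℕ→ℚ b)) (UP.+-cong (toℚᵘ-ℕ→ℚ a) (toℚᵘ-ℕ→ℚ b))))))
  where
  integral : ∀ x y → (x Z.+ y) Z.* Z.+ 1 ≡ (x Z.* Z.+ 1 Z.+ y Z.* Z.+ 1) Z.* Z.+ 1
  integral = solve-∀ ℤ-ring

ℕ→ℚ-* : ∀ a b → ℕ→ℚ (a * b) ≡ ℕ→ℚ a *ℚ ℕ→ℚ b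
ℕ→ℚ-* a b = Q.toℚᵘ-injective (UP.≃-trans (toℚᵘ-ℕ→ℚ (a * b)) (UP.≃-trans (*≡* (cong (Z._* Z.+ 1) (ZP.pos-* a b)))
  (UP.≃-sym (UP.≃-trans (Q.toℚᵘ-homo-* (ℕ→ℚ a) (ℕ→ℚ b)) (UP.*-cong (toℚᵘ-ℕ→ℚ a) (toℚᵘ-ℕ→ℚ b))))))

ℕ→ℚ-suc : ∀ a → ℕ→ℚ (suc a) ≡ 1ℚ +ℚ ℕ→ℚ a
ℕ→ℚ-suc a = ℕ→ℚ-+ 1 a

*-1/suc* : ∀ b x → ℕ→ℚ (suc b) *ℚ (Z.+ 1 / (suc b * suc x)) ≡ Z.+ 1 / suc x
*-1/suc* b x = Q.toℚᵘ-injective (UP.≃-trans (Q.toℚᵘ-homo-* (ℕ→ℚ (suc b)) (Z.+ 1 / (suc b * suc x)))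
  (UP.≃-trans (UP.*-cong (toℚᵘ-ℕ→ℚ (suc b)) (Q.toℚᵘ-fromℚᵘ (mkℚᵘ (Z.+ 1) (x + b * suc x))))
  (UP.≃-trans (*≡* integral) (UP.≃-sym (Q.toℚᵘ-fromℚᵘ (mkℚᵘ (Z.+ 1) x))))))
  where
  natural : ∀ m n → suc m * 1 * suc n ≡ 1 * (1 * suc (n + m * suc n))
  natural = ℕ-Solver.solve-∀
  integral : Z.+ suc b Z.* Z.+ 1 Z.* Z.+ suc x ≡ Z.+ 1 Z.* (Z.+ 1 Z.* Z.+ suc (x + b * suc x))
  integral = begin
    Z.+ suc b Z.* Z.+ 1 Z.* Z.+ suc x          ≡⟨ cong (Z._* Z.+ suc x) (ZP.pos-* (suc b) 1) ⟨
    Z.+ (suc b * 1) Z.* Z.+ suc x              ≡⟨ ZP.pos-* (suc b * 1) (suc x) ⟨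
    Z.+ (suc b * 1 * suc x)                    ≡⟨ cong Z.+_ (natural b x) ⟩
    Z.+ (1 * (1 * suc (x + b * suc x)))        ≡⟨ ZP.pos-* 1 (1 * suc (x + b * suc x)) ⟩
    Z.+ 1 Z.* Z.+ (1 * suc (x + b * suc x))    ≡⟨ cong (Z.+ 1 Z.*_) (ZP.pos-* 1 (suc (x + b * suc x))) ⟩
    Z.+ 1 Z.* (Z.+ 1 Z.* Z.+ suc (x + b * suc x)) ∎

*-inv!-suc : ∀ b → ℕ→ℚ (suc b) *ℚ inv! (suc b) ≡ inv! b
*-inv!-suc b = go (b !) {{b !≢0}}
  where
  go : ∀ d .{{_ : NonZero d}} → ℕ→ℚ (suc b) *ℚ (Z.+ 1 / (suc b * d)) {{NP.m*n≢0 (suc b) d}} ≡ Z.+ 1 / d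
  go (suc x) = *-1/suc* b x

T⇒≡true : ∀ {b} → Bool.T b → b ≡ true
T⇒≡true {true} _ = refl

¬T⇒≡false : ∀ {b} → ¬ Bool.T b → b ≡ false
¬T⇒≡false {true} p = ⊥-elim (p _)
¬T⇒≡false {false} _ = refl

≡true⇒T : ∀ {b} → b ≡ true → Bool.T b
≡true⇒T refl = _

≡ᵇ-true : ∀ {m n} → m ≡ n → (m ≡ᵇ n) ≡ true
≡ᵇ-true {m} {n} p = T⇒≡true (NP.≡⇒≡ᵇ m n p)

≡ᵇ-false : ∀ {m n} → ¬ m ≡ n → (m ≡ᵇ n) ≡ false
≡ᵇ-false {m} {n} p = ¬T⇒≡false (λ t → p (NP.≡ᵇ⇒≡ m n t))

≡ᵇ-true⇒≡ : ∀ {m n} → (m ≡ᵇ n) ≡ true → m ≡ n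
≡ᵇ-true⇒≡ {m} {n} p = NP.≡ᵇ⇒≡ m n (≡true⇒T p)

<ᵇ-true : ∀ {m n} → m N.< n → (m <ᵇ n) ≡ true
<ᵇ-true p = T⇒≡true (NP.<⇒<ᵇ p)

<ᵇ-false : ∀ {m n} → ¬ m N.< n → (m <ᵇ n) ≡ false
<ᵇ-false {m} {n} p = ¬T⇒≡false (λ t → p (NP.<ᵇ⇒< m n t))

≤ᵇ-true : ∀ {m n} → m N.≤ n → (m ≤ᵇ n) ≡ true
≤ᵇ-true p = T⇒≡true (NP.≤⇒≤ᵇ p)

≤ᵇ-false : ∀ {m n} → ¬ m N.≤ n → (m ≤ᵇ n) ≡ false
≤ᵇ-false {m} {n} p = ¬T⇒≡false (λ t → p (NP.≤ᵇ⇒≤ m n t))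

≡ᵇ-cong : ∀ {x y x′ y′} → (x ≡ y → x′ ≡ y′) → (x′ ≡ y′ → x ≡ y) → (x ≡ᵇ y) ≡ (x′ ≡ᵇ y′)
≡ᵇ-cong {x} {y} p q with x N.≟ y
... | yes e = trans (≡ᵇ-true e) (sym (≡ᵇ-true (p e)))
... | no ne = trans (≡ᵇ-false ne) (sym (≡ᵇ-false (λ e → ne (q e))))

[]≡1 : ∀ {b} → b ≡ true → [ b ] ≡ 1ℚ
[]≡1 refl = refl

[]≡0 : ∀ {b} → b ≡ false → [ b ] ≡ 0ℚ
[]≡0 refl = refl

if-true : ∀ {A : Set} {b} {x y : A} → b ≡ true → (if b then x else y) ≡ x
if-true refl = refl

if-false : ∀ {A : Set} {b} {x y : A} → b ≡ false → (if b then x else y) ≡ y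
if-false refl = refl

if-same : ∀ {A : Set} (b : Bool) (x : A) → (if b then x else x) ≡ x
if-same true x = refl
if-same false x = refl

<∸⇒+< : ∀ i a r → a N.< r ∸ i → i + a N.< r
<∸⇒+< i a r h with i N.≤? r
... | yes i≤r = NP.<-≤-trans (NP.+-monoʳ-< i h) (NP.≤-reflexive (NP.m+[n∸m]≡n i≤r))
... | no i≰r = ⊥-elim (NP.n≮0 (≡.subst (a N.<_) (NP.m≤n⇒m∸n≡0 (NP.<⇒≤ (NP.≰⇒> i≰r))) h))

∸-suc-flip : ∀ x s y → y N.< s → x ≡ s ∸ suc y → y ≡ s ∸ suc x
∸-suc-flip x s y y<s eq = sym (trans (cong (_∸ suc x) (sym sx+y≡s)) (NP.m+n∸m≡n (suc x) y))
  where
  sx+y≡s : suc x + y ≡ s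
  sx+y≡s = trans (sym (NP.+-suc x y)) (trans (cong (_+ suc y) eq) (NP.m∸n+n≡m y<s))

<∸-suc-flip : ∀ a s j → j N.< s → a N.< s ∸ suc j → j N.< s ∸ suc a
<∸-suc-flip a s j j<s a<p =
  NP.m+n≤o⇒m≤o∸n (suc j) (NP.≤-trans (NP.+-monoʳ-≤ (suc j) a<p) (NP.≤-reflexive (NP.m+[n∸m]≡n j<s)))

∸-suc< : ∀ s a → 0 N.< s → s ∸ suc a N.< s
∸-suc< (suc s) a _ = N.s≤s (NP.m∸n≤m s a)

module _ {A : Set} where

  Σ-cong : (xs : List A) {F G : A → ℚ} → (∀ x → F x ≡ G x) → Σℚ (map F xs) ≡ Σℚ (map G xs)
  Σ-cong [] p = refl
  Σ-cong (x ∷ xs) p = cong₂ _+ℚ_ (p x) (Σ-cong xs p)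

  Σ-cong-All : (xs : List A) {F G : A → ℚ} → AllL.All (λ x → F x ≡ G x) xs → Σℚ (map F xs) ≡ Σℚ (map G xs)
  Σ-cong-All [] AllL.[] = refl
  Σ-cong-All (x ∷ xs) (p AllL.∷ ps) = cong₂ _+ℚ_ p (Σ-cong-All xs ps)

  Σ-zero : (xs : List A) (F : A → ℚ) → (∀ x → F x ≡ 0ℚ) → Σℚ (map F xs) ≡ 0ℚ
  Σ-zero [] F p = refl
  Σ-zero (x ∷ xs) F p = trans (cong₂ _+ℚ_ (p x) (Σ-zero xs F p)) (Q.+-identityˡ 0ℚ)

  Σ-+ : (xs : List A) (F G : A → ℚ) →
        Σℚ (map (λ x → F x +ℚ G x) xs) ≡ Σℚ (map F xs) +ℚ Σℚ (map G xs)
  Σ-+ [] F G = sym (Q.+-identityʳ 0ℚ)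
  Σ-+ (x ∷ xs) F G = trans (cong (F x +ℚ G x +ℚ_) (Σ-+ xs F G)) (interchange (F x) (G x) _ _)
    where
    interchange : ∀ a b c d → (a +ℚ b) +ℚ (c +ℚ d) ≡ (a +ℚ c) +ℚ (b +ℚ d)
    interchange = solve-∀ ℚ-ring

  Σ-*ˡ : (c : ℚ) (xs : List A) (F : A → ℚ) → Σℚ (map (λ x → c *ℚ F x) xs) ≡ c *ℚ Σℚ (map F xs)
  Σ-*ˡ c [] F = sym (Q.*-zeroʳ c)
  Σ-*ˡ c (x ∷ xs) F = trans (cong (c *ℚ F x +ℚ_) (Σ-*ˡ c xs F)) (sym (Q.*-distribˡ-+ c (F x) _))

  Σ-*ʳ : (c : ℚ) (xs : List A) (F : A → ℚ) → Σℚ (map (λ x → F x *ℚ c) xs) ≡ Σℚ (map F xs) *ℚ c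
  Σ-*ʳ c xs F = trans (Σ-cong xs (λ x → Q.*-comm (F x) c)) (trans (Σ-*ˡ c xs F) (Q.*-comm c _))

  Σ-neg : (xs : List A) (F : A → ℚ) → Σℚ (map (λ x → -ℚ F x) xs) ≡ -ℚ Σℚ (map F xs)
  Σ-neg [] F = refl
  Σ-neg (x ∷ xs) F = trans (cong (-ℚ F x +ℚ_) (Σ-neg xs F)) (sym (Q.neg-distrib-+ (F x) _))

  Σ-++ : (xs ys : List A) (F : A → ℚ) → Σℚ (map F (xs L.++ ys)) ≡ Σℚ (map F xs) +ℚ Σℚ (map F ys)
  Σ-++ [] ys F = sym (Q.+-identityˡ _)
  Σ-++ (x ∷ xs) ys F = trans (cong (F x +ℚ_) (Σ-++ xs ys F)) (sym (Q.+-assoc (F x) _ _))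

module _ {A B : Set} where

  Σ-map : (xs : List A) (g : A → B) (F : B → ℚ) → Σℚ (map F (map g xs)) ≡ Σℚ (map (λ x → F (g x)) xs)
  Σ-map xs g F = cong Σℚ (sym (LP.map-∘ xs))

  Σ-concatMap : (xs : List A) (g : A → List B) (F : B → ℚ) →
    Σℚ (map F (L.concatMap g xs)) ≡ Σℚ (map (λ x → Σℚ (map F (g x))) xs)
  Σ-concatMap [] g F = refl
  Σ-concatMap (x ∷ xs) g F =
    trans (Σ-++ (g x) (L.concatMap g xs) F) (cong (Σℚ (map F (g x)) +ℚ_) (Σ-concatMap xs g F))

  Σ-swap : (xs : List A) (ys : List B) (F : A → B → ℚ) →
    Σℚ (map (λ x → Σℚ (map (F x) ys)) xs) ≡ Σℚ (map (λ y → Σℚ (map (λ x → F x y) xs)) ys)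
  Σ-swap [] ys F = sym (Σ-zero ys _ (λ _ → refl))
  Σ-swap (x ∷ xs) ys F =
    trans (cong (Σℚ (map (F x) ys) +ℚ_) (Σ-swap xs ys F))
          (sym (Σ-+ ys (F x) (λ y → Σℚ (map (λ x → F x y) xs))))

Σ<-applyUpTo : ∀ n (g : ℕ → ℕ) (f : ℕ → ℚ) → Σℚ (map f (applyUpTo g n)) ≡ Σ< n (λ i → f (g i))
Σ<-applyUpTo zero g f = refl
Σ<-applyUpTo (suc n) g f =
  cong (f (g 0) +ℚ_) (trans (Σ<-applyUpTo n (λ i → g (suc i)) f) (sym (Σ<-applyUpTo n suc (λ i → f (g i)))))

Σ<-suc : ∀ n (f : ℕ → ℚ) → Σ< (suc n) f ≡ f 0 +ℚ Σ< n (λ i → f (suc i))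
Σ<-suc n f = cong (f 0 +ℚ_) (Σ<-applyUpTo n suc f)

Σ<-split : ∀ a b (f : ℕ → ℚ) → Σ< (a + b) f ≡ Σ< a f +ℚ Σ< b (λ i → f (a + i))
Σ<-split zero b f = sym (Q.+-identityˡ _)
Σ<-split (suc a) b f = begin
  Σ< (suc (a + b)) f                                           ≡⟨ Σ<-suc (a + b) f ⟩
  f 0 +ℚ Σ< (a + b) (λ i → f (suc i))                          ≡⟨ cong (f 0 +ℚ_) (Σ<-split a b (λ i → f (suc i))) ⟩
  f 0 +ℚ (Σ< a (λ i → f (suc i)) +ℚ Σ< b (λ i → f (suc a + i))) ≡⟨ Q.+-assoc (f 0) _ _ ⟨
  (f 0 +ℚ Σ< a (λ i → f (suc i))) +ℚ Σ< b (λ i → f (suc a + i)) ≡⟨ cong (_+ℚ Σ< b (λ i → f (suc a + i))) (Σ<-suc a f) ⟨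
  Σ< (suc a) f +ℚ Σ< b (λ i → f (suc a + i))                   ∎

Σ<-last : ∀ n (f : ℕ → ℚ) → Σ< (suc n) f ≡ Σ< n f +ℚ f n
Σ<-last n f = trans (cong (λ k → Σ< k f) (NP.+-comm 1 n))
                    (trans (Σ<-split n 1 f) (cong (Σ< n f +ℚ_) (trans (Q.+-identityʳ _) (cong f (NP.+-identityʳ n)))))

Σ<-cong : ∀ n {f g : ℕ → ℚ} → (∀ i → i N.< n → f i ≡ g i) → Σ< n f ≡ Σ< n g
Σ<-cong zero p = refl
Σ<-cong (suc n) {f} {g} p = trans (Σ<-suc n f) (trans
  (cong₂ _+ℚ_ (p 0 (N.s≤s N.z≤n)) (Σ<-cong n (λ i i<n → p (suc i) (N.s≤s i<n))))
  (sym (Σ<-suc n g)))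

Σ<-zero : ∀ n (f : ℕ → ℚ) → (∀ i → i N.< n → f i ≡ 0ℚ) → Σ< n f ≡ 0ℚ
Σ<-zero n f p = trans (Σ<-cong n p) (Σ-zero (upTo n) _ (λ _ → refl))

Σ<-pick : ∀ n k (f : ℕ → ℚ) → k N.< n → (∀ i → i N.< n → ¬ i ≡ k → f i ≡ 0ℚ) → Σ< n f ≡ f k
Σ<-pick (suc n) zero f k<n p = trans (Σ<-suc n f)
  (trans (cong (f 0 +ℚ_) (Σ<-zero n _ (λ i i<n → p (suc i) (N.s≤s i<n) (λ ())))) (Q.+-identityʳ _))
Σ<-pick (suc n) (suc k) f (N.s≤s k<n) p = trans (Σ<-suc n f)
  (trans (cong₂ _+ℚ_ (p 0 (N.s≤s N.z≤n) (λ ()))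
     (Σ<-pick n k (λ i → f (suc i)) k<n (λ i i<n i≢k → p (suc i) (N.s≤s i<n) (λ e → i≢k (NP.suc-injective e)))))
   (Q.+-identityˡ _))

Σ<-δ : ∀ n k (f : ℕ → ℚ) → k N.< n → Σ< n (λ i → [ i ≡ᵇ k ] *ℚ f i) ≡ f k
Σ<-δ n k f k<n =
  trans (Σ<-pick n k _ k<n (λ i _ i≢k → trans (cong (_*ℚ f i) ([]≡0 (≡ᵇ-false i≢k))) (Q.*-zeroˡ (f i))))
        (trans (cong (_*ℚ f k) ([]≡1 (≡ᵇ-true {k} refl))) (Q.*-identityˡ (f k)))

Σ<-δ-δ : ∀ s k l → k N.< s → l N.< s → Σ< s (λ t → [ t ≡ᵇ k ] -ℚ [ t ≡ᵇ l ]) ≡ 0ℚ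
Σ<-δ-δ s k l k<s l<s = begin
  Σ< s (λ t → [ t ≡ᵇ k ] -ℚ [ t ≡ᵇ l ])         ≡⟨ Σ-+ (upTo s) (λ t → [ t ≡ᵇ k ]) (λ t → -ℚ [ t ≡ᵇ l ]) ⟩
  Σ< s (λ t → [ t ≡ᵇ k ]) +ℚ Σ< s (λ t → -ℚ [ t ≡ᵇ l ]) ≡⟨ cong (Σ< s (λ t → [ t ≡ᵇ k ]) +ℚ_) (Σ-neg (upTo s) (λ t → [ t ≡ᵇ l ])) ⟩
  Σ< s (λ t → [ t ≡ᵇ k ]) -ℚ Σ< s (λ t → [ t ≡ᵇ l ])   ≡⟨ cong₂ _-ℚ_ (count k k<s) (count l l<s) ⟩
  1ℚ -ℚ 1ℚ                                       ≡⟨⟩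
  0ℚ                                             ∎
  where
  count : ∀ k → k N.< s → Σ< s (λ t → [ t ≡ᵇ k ]) ≡ 1ℚ
  count k k<s = trans (Σ-cong (upTo s) (λ t → sym (Q.*-identityʳ [ t ≡ᵇ k ]))) (Σ<-δ s k (λ _ → 1ℚ) k<s)

slice : ∀ {n} → PS (suc n) → ℕ → PS n
slice f i a = f (i ∷ a)

·-∷ : ∀ {n} (f g : PS (suc n)) x e → (f · g) (x ∷ e) ≡ Σ≤ x (λ i → (slice f i · slice g (x ∸ i)) e)
·-∷ f g x e =
  trans (Σ-concatMap (upTo (suc x)) (λ i → map (i ∷_) (below e)) (λ a → f a *ℚ g (V.zipWith _∸_ (x ∷ e) a)))
        (Σ-cong (upTo (suc x)) (λ i → Σ-map (below e) (i ∷_) _))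

·-[] : (f g : PS 0) → (f · g) [] ≡ f [] *ℚ g []
·-[] f g = Q.+-identityʳ _

·-cong : ∀ {n} {f f′ g g′ : PS n} → f ≗ f′ → g ≗ g′ → f · g ≗ f′ · g′
·-cong {f = f} {f′} {g} {g′} p q e =
  Σ-cong (below e) (λ a → cong₂ _*ℚ_ (p a) (q (V.zipWith _∸_ e a)))

·-congˡ : ∀ {n} {f f′ : PS n} (g : PS n) → f ≗ f′ → f · g ≗ f′ · g
·-congˡ {f = f} {f′} g p = ·-cong {f = f} {f′} {g} {g} p (λ _ → refl)

·-congʳ : ∀ {n} (f : PS n) {g g′ : PS n} → g ≗ g′ → f · g ≗ f · g′
·-congʳ f {g} {g′} q = ·-cong {f = f} {f} {g} {g′} (λ _ → refl) q

module _ {n : ℕ} where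

  private
    _-_ : Vec ℕ n → Vec ℕ n → Vec ℕ n
    e - b = V.zipWith _∸_ e b

  ·-•ˡ : ∀ c (f g : PS n) e → ((c • f) · g) e ≡ c *ℚ (f · g) e
  ·-•ˡ c f g e = trans (Σ-cong (below e) (λ b → Q.*-assoc c (f b) (g (e - b))))
                       (Σ-*ˡ c (below e) (λ b → f b *ℚ g (e - b)))

  ·-•ʳ : ∀ c (f g : PS n) e → (f · (c • g)) e ≡ c *ℚ (f · g) e
  ·-•ʳ c f g e = trans (Σ-cong (below e) (λ b → *-leftComm (f b) c (g (e - b))))
                       (Σ-*ˡ c (below e) (λ b → f b *ℚ g (e - b)))

  ·-+ˡ : ∀ (f f′ g : PS n) e → ((λ a → f a +ℚ f′ a) · g) e ≡ (f · g) e +ℚ (f′ · g) e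
  ·-+ˡ f f′ g e = trans (Σ-cong (below e) (λ b → Q.*-distribʳ-+ (g (e - b)) (f b) (f′ b)))
                        (Σ-+ (below e) (λ b → f b *ℚ g (e - b)) (λ b → f′ b *ℚ g (e - b)))

  ·-+ʳ : ∀ (f g g′ : PS n) e → (f · (λ a → g a +ℚ g′ a)) e ≡ (f · g) e +ℚ (f · g′) e
  ·-+ʳ f g g′ e = trans (Σ-cong (below e) (λ b → Q.*-distribˡ-+ (f b) (g (e - b)) (g′ (e - b))))
                        (Σ-+ (below e) (λ b → f b *ℚ g (e - b)) (λ b → f b *ℚ g′ (e - b)))

  ·-ΣPSLˡ : ∀ {A : Set} (xs : List A) (F : A → PS n) (g : PS n) e →
    (ΣPSL xs F · g) e ≡ Σℚ (map (λ x → (F x · g) e) xs)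
  ·-ΣPSLˡ xs F g e =
    trans (Σ-cong (below e) (λ b → sym (Σ-*ʳ (g (e - b)) xs (λ x → F x b))))
          (Σ-swap (below e) xs (λ b x → F x b *ℚ g (e - b)))

  ·-ΣPSLʳ : ∀ {A : Set} (xs : List A) (f : PS n) (G : A → PS n) e →
    (f · ΣPSL xs G) e ≡ Σℚ (map (λ x → (f · G x) e) xs)
  ·-ΣPSLʳ xs f G e =
    trans (Σ-cong (below e) (λ b → sym (Σ-*ˡ (f b) xs (λ x → G x (e - b)))))
          (Σ-swap (below e) xs (λ b x → f b *ℚ G x (e - b)))

  ·-zeroˡ : ∀ {f : PS n} (g : PS n) → (∀ e → f e ≡ 0ℚ) → ∀ e → (f · g) e ≡ 0ℚ
  ·-zeroˡ {f} g p e = Σ-zero (below e) (λ b → f b *ℚ g (e - b))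
    (λ b → trans (cong (_*ℚ g (e - b)) (p b)) (Q.*-zeroˡ (g (e - b))))

  ·-zeroʳ : ∀ (f : PS n) {g : PS n} → (∀ e → g e ≡ 0ℚ) → ∀ e → (f · g) e ≡ 0ℚ
  ·-zeroʳ f {g} p e = Σ-zero (below e) (λ b → f b *ℚ g (e - b))
    (λ b → trans (cong (f b *ℚ_) (p (e - b))) (Q.*-zeroʳ (f b)))

·-identityˡ : ∀ {n} (g : PS n) → onePS · g ≗ g
·-identityˡ g [] = trans (·-[] onePS g) (Q.*-identityˡ _)
·-identityˡ g (x ∷ e) = begin
  (onePS · g) (x ∷ e)                                             ≡⟨ ·-∷ onePS g x e ⟩
  Σ≤ x (λ i → (slice onePS i · slice g (x ∸ i)) e)                ≡⟨ Σ<-suc x (λ i → (slice onePS i · slice g (x ∸ i)) e) ⟩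
  (onePS · slice g x) e +ℚ Σ< x (λ i → (slice onePS (suc i) · slice g (x ∸ suc i)) e)
    ≡⟨ cong₂ _+ℚ_ (·-identityˡ (slice g x) e)
                  (Σ<-zero x _ (λ i _ → ·-zeroˡ (slice g (x ∸ suc i)) (λ _ → refl) e)) ⟩
  g (x ∷ e) +ℚ 0ℚ                                                 ≡⟨ Q.+-identityʳ _ ⟩
  g (x ∷ e)                                                       ∎

·-identityʳ : ∀ {n} (f : PS n) → f · onePS ≗ f
·-identityʳ f [] = trans (·-[] f onePS) (Q.*-identityʳ _)
·-identityʳ f (x ∷ e) = begin
  (f · onePS) (x ∷ e)                                  ≡⟨ ·-∷ f onePS x e ⟩
  Σ≤ x (λ i → (slice f i · slice onePS (x ∸ i)) e)     ≡⟨ Σ<-pick (suc x) x _ (NP.n<1+n x) others ⟩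
  (slice f x · slice onePS (x ∸ x)) e                  ≡⟨ ·-congʳ (slice f x) (λ a → cong (λ k → onePS (k ∷ a)) (NP.n∸n≡0 x)) e ⟩
  (slice f x · onePS) e                                ≡⟨ ·-identityʳ (slice f x) e ⟩
  f (x ∷ e)                                            ∎
  where
  others : ∀ i → i N.< suc x → ¬ i ≡ x → (slice f i · slice onePS (x ∸ i)) e ≡ 0ℚ
  others i i≤x i≢x with x ∸ i | NP.m>n⇒m∸n≢0 (NP.≤∧≢⇒< (NP.≤-pred i≤x) i≢x)
  ... | zero | x∸i≢0 = ⊥-elim (x∸i≢0 refl)
  ... | suc _ | _ = ·-zeroʳ (slice f i) (λ _ → refl) e

sucAt : ∀ {n} → ℕ → Vec ℕ n → ℕ
sucAt v [] = 0
sucAt zero (x ∷ e) = suc x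
sucAt (suc v) (x ∷ e) = sucAt v e

incAt : ∀ {n} → ℕ → Vec ℕ n → Vec ℕ n
incAt v [] = []
incAt zero (x ∷ e) = suc x ∷ e
incAt (suc v) (x ∷ e) = x ∷ incAt v e

∂ : ∀ {n} → ℕ → PS n → PS n
∂ v f e = ℕ→ℚ (sucAt v e) *ℚ f (incAt v e)

Σ≤-Leibniz : ∀ x (P : ℕ → ℕ → ℚ) →
  ℕ→ℚ (suc x) *ℚ Σ≤ (suc x) (λ i → P i (suc x ∸ i)) ≡
  Σ≤ x (λ i → ℕ→ℚ (suc i) *ℚ P (suc i) (x ∸ i)) +ℚ
  Σ≤ x (λ i → ℕ→ℚ (suc (x ∸ i)) *ℚ P i (suc (x ∸ i)))
Σ≤-Leibniz x P = begin
  ℕ→ℚ (suc x) *ℚ Σ≤ (suc x) T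
    ≡⟨ sym (Σ-*ˡ (ℕ→ℚ (suc x)) (upTo (suc (suc x))) T) ⟩
  Σ≤ (suc x) (λ i → ℕ→ℚ (suc x) *ℚ T i)
    ≡⟨ Σ<-cong (suc (suc x)) {λ i → ℕ→ℚ (suc x) *ℚ T i} {λ i → ℕ→ℚ i *ℚ T i +ℚ ℕ→ℚ (suc x ∸ i) *ℚ T i}
          (λ i i< → trans (cong (λ k → ℕ→ℚ k *ℚ T i) (sym (NP.m+[n∸m]≡n (NP.≤-pred i<))))
                                    (trans (cong (_*ℚ T i) (ℕ→ℚ-+ i (suc x ∸ i))) (Q.*-distribʳ-+ (T i) (ℕ→ℚ i) (ℕ→ℚ (suc x ∸ i))))) ⟩
  Σ≤ (suc x) (λ i → ℕ→ℚ i *ℚ T i +ℚ ℕ→ℚ (suc x ∸ i) *ℚ T i)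
    ≡⟨ Σ-+ (upTo (suc (suc x))) (λ i → ℕ→ℚ i *ℚ T i) (λ i → ℕ→ℚ (suc x ∸ i) *ℚ T i) ⟩
  Σ≤ (suc x) (λ i → ℕ→ℚ i *ℚ T i) +ℚ Σ≤ (suc x) (λ i → ℕ→ℚ (suc x ∸ i) *ℚ T i)
    ≡⟨ cong₂ _+ℚ_ first second ⟩
  Σ≤ x (λ i → ℕ→ℚ (suc i) *ℚ P (suc i) (x ∸ i)) +ℚ
  Σ≤ x (λ i → ℕ→ℚ (suc (x ∸ i)) *ℚ P i (suc (x ∸ i))) ∎
  where
  T : ℕ → ℚ
  T i = P i (suc x ∸ i)
  first : Σ≤ (suc x) (λ i → ℕ→ℚ i *ℚ T i) ≡ Σ≤ x (λ i → ℕ→ℚ (suc i) *ℚ P (suc i) (x ∸ i))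
  first = trans (Σ<-suc (suc x) (λ i → ℕ→ℚ i *ℚ T i)) (trans (cong (_+ℚ Σ≤ x (λ i → ℕ→ℚ (suc i) *ℚ P (suc i) (x ∸ i))) (Q.*-zeroˡ (T 0))) (Q.+-identityˡ _))
  second : Σ≤ (suc x) (λ i → ℕ→ℚ (suc x ∸ i) *ℚ T i) ≡ Σ≤ x (λ i → ℕ→ℚ (suc (x ∸ i)) *ℚ P i (suc (x ∸ i)))
  second = trans (Σ<-last (suc x) (λ i → ℕ→ℚ (suc x ∸ i) *ℚ T i))
    (trans (cong₂ _+ℚ_ (Σ<-cong (suc x) {λ i → ℕ→ℚ (suc x ∸ i) *ℚ T i} {λ i → ℕ→ℚ (suc (x ∸ i)) *ℚ P i (suc (x ∸ i))} (λ i i< → cong (λ k → ℕ→ℚ k *ℚ P i k) (NP.+-∸-assoc 1 (NP.≤-pred i<))))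
                       (trans (cong (λ k → ℕ→ℚ k *ℚ T (suc x)) (NP.n∸n≡0 x)) (Q.*-zeroˡ (T (suc x)))))
    (Q.+-identityʳ _))

∂-· : ∀ {n} v (f g : PS n) e → ∂ v (f · g) e ≡ (∂ v f · g) e +ℚ (f · ∂ v g) e
∂-· v f g [] = begin
  0ℚ *ℚ (f · g) []  ≡⟨ Q.*-zeroˡ ((f · g) []) ⟩
  0ℚ ≡⟨ sym (trans (cong₂ _+ℚ_ (trans (·-[] (∂ v f) g) (trans (cong (_*ℚ g []) (Q.*-zeroˡ (f []))) (Q.*-zeroˡ (g []))))
                     (trans (·-[] f (∂ v g)) (trans (cong (f [] *ℚ_) (Q.*-zeroˡ (g []))) (Q.*-zeroʳ (f []))))) (Q.+-identityˡ 0ℚ)) ⟩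
  (∂ v f · g) [] +ℚ (f · ∂ v g) [] ∎
∂-· zero f g (x ∷ e) = begin
  ℕ→ℚ (suc x) *ℚ (f · g) (suc x ∷ e)
    ≡⟨ cong (ℕ→ℚ (suc x) *ℚ_) (·-∷ f g (suc x) e) ⟩
  ℕ→ℚ (suc x) *ℚ Σ≤ (suc x) (λ i → (slice f i · slice g (suc x ∸ i)) e)
    ≡⟨ Σ≤-Leibniz x (λ i j → (slice f i · slice g j) e) ⟩
  Σ≤ x (λ i → ℕ→ℚ (suc i) *ℚ (slice f (suc i) · slice g (x ∸ i)) e) +ℚ
  Σ≤ x (λ i → ℕ→ℚ (suc (x ∸ i)) *ℚ (slice f i · slice g (suc (x ∸ i))) e)
    ≡⟨ sym (cong₂ _+ℚ_ (Σ-cong (upTo (suc x)) (λ i → ·-•ˡ (ℕ→ℚ (suc i)) (slice f (suc i)) (slice g (x ∸ i)) e))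
                       (Σ-cong (upTo (suc x)) (λ i → ·-•ʳ (ℕ→ℚ (suc (x ∸ i))) (slice f i) (slice g (suc (x ∸ i))) e))) ⟩
  Σ≤ x (λ i → (slice (∂ 0 f) i · slice g (x ∸ i)) e) +ℚ
  Σ≤ x (λ i → (slice f i · slice (∂ 0 g) (x ∸ i)) e)
    ≡⟨ sym (cong₂ _+ℚ_ (·-∷ (∂ 0 f) g x e) (·-∷ f (∂ 0 g) x e)) ⟩
  (∂ 0 f · g) (x ∷ e) +ℚ (f · ∂ 0 g) (x ∷ e) ∎
∂-· (suc v) f g (x ∷ e) = begin
  ℕ→ℚ (sucAt v e) *ℚ (f · g) (x ∷ incAt v e)
    ≡⟨ cong (ℕ→ℚ (sucAt v e) *ℚ_) (·-∷ f g x (incAt v e)) ⟩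
  ℕ→ℚ (sucAt v e) *ℚ Σ≤ x (λ i → (slice f i · slice g (x ∸ i)) (incAt v e))
    ≡⟨ sym (Σ-*ˡ (ℕ→ℚ (sucAt v e)) (upTo (suc x)) (λ i → (slice f i · slice g (x ∸ i)) (incAt v e))) ⟩
  Σ≤ x (λ i → ∂ v (slice f i · slice g (x ∸ i)) e)
    ≡⟨ Σ-cong (upTo (suc x)) (λ i → ∂-· v (slice f i) (slice g (x ∸ i)) e) ⟩
  Σ≤ x (λ i → (∂ v (slice f i) · slice g (x ∸ i)) e +ℚ (slice f i · ∂ v (slice g (x ∸ i))) e)
    ≡⟨ Σ-+ (upTo (suc x)) (λ i → (∂ v (slice f i) · slice g (x ∸ i)) e) (λ i → (slice f i · ∂ v (slice g (x ∸ i))) e) ⟩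
  Σ≤ x (λ i → (slice (∂ (suc v) f) i · slice g (x ∸ i)) e) +ℚ
  Σ≤ x (λ i → (slice f i · slice (∂ (suc v) g) (x ∸ i)) e)
    ≡⟨ sym (cong₂ _+ℚ_ (·-∷ (∂ (suc v) f) g x e) (·-∷ f (∂ (suc v) g) x e)) ⟩
  (∂ (suc v) f · g) (x ∷ e) +ℚ (f · ∂ (suc v) g) (x ∷ e) ∎

at : ∀ {n} → ℕ → Vec ℕ n → ℕ
at v [] = 0
at zero (x ∷ e) = x
at (suc v) (x ∷ e) = at v e

decAt : ∀ {n} → ℕ → Vec ℕ n → Vec ℕ n
decAt v [] = []
decAt zero (x ∷ e) = N.pred x ∷ e
decAt (suc v) (x ∷ e) = x ∷ decAt v e

decAt-incAt : ∀ {n} b (a : Vec ℕ n) → decAt b (incAt b a) ≡ a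
decAt-incAt b [] = refl
decAt-incAt zero (x ∷ a) = refl
decAt-incAt (suc b) (x ∷ a) = cong (x ∷_) (decAt-incAt b a)

sumV-incAt : ∀ {n} v (e : Vec ℕ n) → v N.< n → sumV (incAt v e) ≡ suc (sumV e)
sumV-incAt zero (x ∷ e) _ = refl
sumV-incAt (suc v) (x ∷ e) (N.s≤s v<n) = trans (cong (x +_) (sumV-incAt v e v<n)) (NP.+-suc x (sumV e))

sumV≡0⇒replicate : ∀ {n} (e : Vec ℕ n) → sumV e ≡ 0 → e ≡ V.replicate n 0
sumV≡0⇒replicate [] _ = refl
sumV≡0⇒replicate (zero ∷ e) p = cong (0 ∷_) (sumV≡0⇒replicate e p)

at-replicate : ∀ {n} b → at b (V.replicate n 0) ≡ 0
at-replicate {zero} b = refl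
at-replicate {suc n} zero = refl
at-replicate {suc n} (suc b) = at-replicate {n} b

dotV-replicate : ∀ {n} (c : ℕ → ℚ) → dotV c (V.replicate n 0) ≡ 0ℚ
dotV-replicate {zero} c = refl
dotV-replicate {suc n} c = trans (cong₂ _+ℚ_ (Q.*-zeroʳ (c 0)) (dotV-replicate {n} (λ t → c (suc t)))) (Q.+-identityˡ 0ℚ)

∂-one : ∀ {n} v (e : Vec ℕ n) → ∂ v onePS e ≡ 0ℚ
∂-one v [] = Q.*-zeroˡ (onePS (incAt v []))
∂-one zero (x ∷ e) = Q.*-zeroʳ (ℕ→ℚ (suc x))
∂-one (suc v) (zero ∷ e) = ∂-one v e
∂-one (suc v) (suc x ∷ e) = Q.*-zeroʳ (ℕ→ℚ (sucAt v e))

linPS-0∷ : ∀ {n} (c : ℕ → ℚ) (a : Vec ℕ n) → linPS c (0 ∷ a) ≡ linPS (λ t → c (suc t)) a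
linPS-0∷ c a with sumV a ≡ᵇ 1
... | true = trans (cong (_+ℚ dotV (λ t → c (suc t)) a) (Q.*-zeroʳ (c 0))) (Q.+-identityˡ _)
... | false = refl

∂-linPS : ∀ {n} v (c : ℕ → ℚ) (e : Vec ℕ n) → v N.< n → ∂ v (linPS c) e ≡ c v *ℚ onePS e
∂-linPS {suc n} zero c (zero ∷ e) _ with sumV e ≡ᵇ 0 in eq
... | true = begin
  ℕ→ℚ 1 *ℚ (c 0 *ℚ ℕ→ℚ 1 +ℚ dotV (λ t → c (suc t)) e)
    ≡⟨ Q.*-identityˡ _ ⟩
  c 0 *ℚ ℕ→ℚ 1 +ℚ dotV (λ t → c (suc t)) e
    ≡⟨ cong₂ _+ℚ_ (Q.*-identityʳ (c 0)) (trans (cong (dotV (λ t → c (suc t))) (sumV≡0⇒replicate e (≡ᵇ-true⇒≡ eq)))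
                                     (dotV-replicate {n} (λ t → c (suc t)))) ⟩
  c 0 +ℚ 0ℚ ≡⟨ Q.+-identityʳ (c 0) ⟩
  c 0 ≡⟨ sym (Q.*-identityʳ (c 0)) ⟩
  c 0 *ℚ 1ℚ ∎
... | false = trans (Q.*-zeroʳ (ℕ→ℚ 1)) (sym (Q.*-zeroʳ (c 0)))
∂-linPS zero c (suc x ∷ e) _ = trans (Q.*-zeroʳ (ℕ→ℚ (suc (suc x)))) (sym (Q.*-zeroʳ (c 0)))
∂-linPS (suc v) c (zero ∷ e) (N.s≤s v<n) =
  trans (cong (ℕ→ℚ (sucAt v e) *ℚ_) (linPS-0∷ c (incAt v e))) (∂-linPS v (λ t → c (suc t)) e v<n)
∂-linPS (suc v) c (suc zero ∷ e) (N.s≤s v<n) =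
  trans (cong (λ k → ℕ→ℚ (sucAt v e) *ℚ (if suc k ≡ᵇ 1 then c 0 *ℚ ℕ→ℚ 1 +ℚ dotV (λ t → c (suc t)) (incAt v e) else 0ℚ)) (sumV-incAt v e v<n))
    (trans (Q.*-zeroʳ (ℕ→ℚ (sucAt v e))) (sym (Q.*-zeroʳ (c (suc v)))))
∂-linPS (suc v) c (suc (suc x) ∷ e) _ = trans (Q.*-zeroʳ (ℕ→ℚ (sucAt v e))) (sym (Q.*-zeroʳ (c (suc v))))

∂-powPS-suc : ∀ {n} v (f : PS n) (d : ℚ) → (∀ e → ∂ v f e ≡ d *ℚ onePS e) →
       ∀ k e → ∂ v (powPS f (suc k)) e ≡ ℕ→ℚ (suc k) *ℚ (d *ℚ powPS f k e)
∂-powPS-suc v f d hf zero e = begin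
  ∂ v (f · onePS) e ≡⟨ ∂-· v f onePS e ⟩
  (∂ v f · onePS) e +ℚ (f · ∂ v onePS) e
    ≡⟨ cong₂ _+ℚ_ (trans (·-identityʳ (∂ v f) e) (hf e)) (·-zeroʳ f (∂-one v) e) ⟩
  d *ℚ onePS e +ℚ 0ℚ ≡⟨ trans (Q.+-identityʳ (d *ℚ onePS e)) (sym (Q.*-identityˡ (d *ℚ onePS e))) ⟩
  1ℚ *ℚ (d *ℚ onePS e) ∎
∂-powPS-suc v f d hf (suc k) e = begin
  ∂ v (f · powPS f (suc k)) e ≡⟨ ∂-· v f (powPS f (suc k)) e ⟩
  (∂ v f · powPS f (suc k)) e +ℚ (f · ∂ v (powPS f (suc k))) e
    ≡⟨ cong₂ _+ℚ_ (trans (·-congˡ (powPS f (suc k)) hf e) (trans (·-•ˡ d onePS (powPS f (suc k)) e)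
                            (cong (d *ℚ_) (·-identityˡ (powPS f (suc k)) e))))
                  (trans (·-congʳ f (∂-powPS-suc v f d hf k) e) (trans (·-•ʳ (ℕ→ℚ (suc k)) f (d • powPS f k) e)
                            (cong (ℕ→ℚ (suc k) *ℚ_) (·-•ʳ d f (powPS f k) e)))) ⟩
  d *ℚ powPS f (suc k) e +ℚ ℕ→ℚ (suc k) *ℚ (d *ℚ powPS f (suc k) e)
    ≡⟨ trans (collect d (powPS f (suc k) e) (ℕ→ℚ (suc k))) (cong (_*ℚ (d *ℚ powPS f (suc k) e)) (sym (ℕ→ℚ-suc (suc k)))) ⟩
  ℕ→ℚ (suc (suc k)) *ℚ (d *ℚ powPS f (suc k) e) ∎
  where
  collect : ∀ d p k → d *ℚ p +ℚ k *ℚ (d *ℚ p) ≡ (1ℚ +ℚ k) *ℚ (d *ℚ p)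
  collect = solve-∀ ℚ-ring

∂-powPS : ∀ {n} v (f : PS n) (d : ℚ) → (∀ e → ∂ v f e ≡ d *ℚ onePS e) →
       ∀ x e → ∂ v (powPS f x) e ≡ (d *ℚ ℕ→ℚ x) *ℚ powPS f (N.pred x) e
∂-powPS v f d hf zero e = trans (∂-one v e) (sym (trans (cong (_*ℚ onePS e) (Q.*-zeroʳ d)) (Q.*-zeroˡ (onePS e))))
∂-powPS v f d hf (suc k) e = trans (∂-powPS-suc v f d hf k e) (rotate (ℕ→ℚ (suc k)) d (powPS f k e))
  where
  rotate : ∀ a b c → a *ℚ (b *ℚ c) ≡ (b *ℚ a) *ℚ c
  rotate = solve-∀ ℚ-ring

∂-monoL : ∀ {n} v → v N.< n → ∀ {m} (a : Vec ℕ m) (L : ℕ → ℕ → ℚ) (e : Vec ℕ n) →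
  ∂ v (monoL a L) e ≡ Σ< m (λ b → (L b v *ℚ ℕ→ℚ (at b a)) *ℚ monoL (decAt b a) L e)
∂-monoL v v<n [] L e = ∂-one v e
∂-monoL v v<n {suc m} (x ∷ as) L e = begin
  ∂ v (P · R) e ≡⟨ ∂-· v P R e ⟩
  (∂ v P · R) e +ℚ (P · ∂ v R) e
    ≡⟨ cong₂ _+ℚ_
        (trans (·-congˡ R (∂-powPS v (linPS (L 0)) (L 0 v) (λ e′ → ∂-linPS v (L 0) e′ v<n) x) e)
               (·-•ˡ (L 0 v *ℚ ℕ→ℚ x) (powPS (linPS (L 0)) (N.pred x)) R e))
        (trans (·-congʳ P (∂-monoL v v<n as (λ i → L (suc i))) e)
               (trans (·-ΣPSLʳ (upTo m) P (λ b → (L (suc b) v *ℚ ℕ→ℚ (at b as)) • monoL (decAt b as) (λ i → L (suc i))) e)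
                      (Σ-cong (upTo m) (λ b → ·-•ʳ (L (suc b) v *ℚ ℕ→ℚ (at b as)) P (monoL (decAt b as) (λ i → L (suc i))) e)))) ⟩
  (L 0 v *ℚ ℕ→ℚ x) *ℚ monoL (N.pred x ∷ as) L e +ℚ
  Σ< m (λ b → (L (suc b) v *ℚ ℕ→ℚ (at b as)) *ℚ monoL (x ∷ decAt b as) L e)
    ≡⟨ sym (Σ<-suc m (λ b → (L b v *ℚ ℕ→ℚ (at b (x ∷ as))) *ℚ monoL (decAt b (x ∷ as)) L e)) ⟩
  Σ< (suc m) (λ b → (L b v *ℚ ℕ→ℚ (at b (x ∷ as))) *ℚ monoL (decAt b (x ∷ as)) L e) ∎
  where
  P = powPS (linPS (L 0)) x
  R = monoL as (λ i → L (suc i))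

Σ-ofDeg-suc : ∀ m d (F : Vec ℕ (suc m) → ℚ) →
  Σℚ (map F (ofDeg (suc m) d)) ≡ Σ≤ d (λ i → Σℚ (map (λ a → F (i ∷ a)) (ofDeg m (d ∸ i))))
Σ-ofDeg-suc m d F = trans (Σ-concatMap (upTo (suc d)) (λ i → map (i ∷_) (ofDeg m (d ∸ i))) F)
                       (Σ-cong (upTo (suc d)) (λ i → Σ-map (ofDeg m (d ∸ i)) (i ∷_) F))

ofDeg-zero : ∀ m → ofDeg m 0 ≡ V.replicate m 0 ∷ []
ofDeg-zero zero = refl
ofDeg-zero (suc m) rewrite ofDeg-zero m = refl

Σ-ofDeg-shift : ∀ m d b (H : Vec ℕ m → ℚ) →
  Σℚ (map (λ a → ℕ→ℚ (at b a) *ℚ H a) (ofDeg m (suc d))) ≡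
  Σℚ (map (λ a → ℕ→ℚ (sucAt b a) *ℚ H (incAt b a)) (ofDeg m d))
Σ-ofDeg-shift zero zero b H = sym (trans (Q.+-identityʳ (ℕ→ℚ 0 *ℚ H [])) (Q.*-zeroˡ (H [])))
Σ-ofDeg-shift zero (suc d) b H = refl
Σ-ofDeg-shift (suc m) d zero H = begin
  Σℚ (map (λ a → ℕ→ℚ (at 0 a) *ℚ H a) (ofDeg (suc m) (suc d)))
    ≡⟨ Σ-ofDeg-suc m (suc d) (λ a → ℕ→ℚ (at 0 a) *ℚ H a) ⟩
  Σ≤ (suc d) (λ i → Σℚ (map (λ a → ℕ→ℚ i *ℚ H (i ∷ a)) (ofDeg m (suc d ∸ i))))
    ≡⟨ Σ<-suc (suc d) (λ i → Σℚ (map (λ a → ℕ→ℚ i *ℚ H (i ∷ a)) (ofDeg m (suc d ∸ i)))) ⟩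
  Σℚ (map (λ a → ℕ→ℚ 0 *ℚ H (0 ∷ a)) (ofDeg m (suc d))) +ℚ
  Σ≤ d (λ i → Σℚ (map (λ a → ℕ→ℚ (suc i) *ℚ H (suc i ∷ a)) (ofDeg m (d ∸ i))))
    ≡⟨ cong (_+ℚ Σ≤ d (λ i → Σℚ (map (λ a → ℕ→ℚ (suc i) *ℚ H (suc i ∷ a)) (ofDeg m (d ∸ i)))))
            (Σ-zero (ofDeg m (suc d)) (λ a → ℕ→ℚ 0 *ℚ H (0 ∷ a)) (λ a → Q.*-zeroˡ (H (0 ∷ a)))) ⟩
  0ℚ +ℚ Σ≤ d (λ i → Σℚ (map (λ a → ℕ→ℚ (suc i) *ℚ H (suc i ∷ a)) (ofDeg m (d ∸ i))))
    ≡⟨ Q.+-identityˡ _ ⟩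
  Σ≤ d (λ i → Σℚ (map (λ a → ℕ→ℚ (suc i) *ℚ H (suc i ∷ a)) (ofDeg m (d ∸ i))))
    ≡⟨ sym (Σ-ofDeg-suc m d (λ a → ℕ→ℚ (sucAt 0 a) *ℚ H (incAt 0 a))) ⟩
  Σℚ (map (λ a → ℕ→ℚ (sucAt 0 a) *ℚ H (incAt 0 a)) (ofDeg (suc m) d)) ∎
Σ-ofDeg-shift (suc m) d (suc b) H = begin
  Σℚ (map (λ a → ℕ→ℚ (at (suc b) a) *ℚ H a) (ofDeg (suc m) (suc d)))
    ≡⟨ Σ-ofDeg-suc m (suc d) (λ a → ℕ→ℚ (at (suc b) a) *ℚ H a) ⟩
  Σ≤ (suc d) T
    ≡⟨ Σ<-last (suc d) T ⟩
  Σ≤ d T +ℚ T (suc d)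
    ≡⟨ cong₂ _+ℚ_ (Σ<-cong (suc d) {T} {T′} (λ i i< → trans
           (cong (λ k → Σℚ (map (λ a → ℕ→ℚ (at b a) *ℚ H (i ∷ a)) (ofDeg m k))) (NP.+-∸-assoc 1 (NP.≤-pred i<)))
           (Σ-ofDeg-shift m (d ∸ i) b (λ a → H (i ∷ a)))))
         last ⟩
  Σ≤ d T′ +ℚ 0ℚ ≡⟨ Q.+-identityʳ _ ⟩
  Σ≤ d T′
    ≡⟨ sym (Σ-ofDeg-suc m d (λ a → ℕ→ℚ (sucAt (suc b) a) *ℚ H (incAt (suc b) a))) ⟩
  Σℚ (map (λ a → ℕ→ℚ (sucAt (suc b) a) *ℚ H (incAt (suc b) a)) (ofDeg (suc m) d)) ∎
  where
  T : ℕ → ℚ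
  T i = Σℚ (map (λ a → ℕ→ℚ (at b a) *ℚ H (i ∷ a)) (ofDeg m (suc d ∸ i)))
  T′ : ℕ → ℚ
  T′ i = Σℚ (map (λ a → ℕ→ℚ (sucAt b a) *ℚ H (i ∷ incAt b a)) (ofDeg m (d ∸ i)))
  last : T (suc d) ≡ 0ℚ
  last = trans (cong (λ k → Σℚ (map (λ a → ℕ→ℚ (at b a) *ℚ H (suc d ∷ a)) (ofDeg m k))) (NP.n∸n≡0 d))
    (trans (cong (λ l → Σℚ (map (λ a → ℕ→ℚ (at b a) *ℚ H (suc d ∷ a)) l)) (ofDeg-zero m))
    (trans (Q.+-identityʳ _) (trans (cong (λ k → ℕ→ℚ k *ℚ H (suc d ∷ V.replicate m 0)) (at-replicate {m} b))
                         (Q.*-zeroˡ (H (suc d ∷ V.replicate m 0))))))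

∂-subst : ∀ {n} v → v N.< n → ∀ m (f : PS m) (L : ℕ → ℕ → ℚ) (e : Vec ℕ n) →
  ∂ v (subst m f L) e ≡ Σ< m (λ b → L b v *ℚ subst m (∂ b f) L e)
∂-subst {n} v v<n m f L e = begin
  ℕ→ℚ (sucAt v e) *ℚ Σℚ (map (λ a → f a *ℚ monoL a L (incAt v e)) (ofDeg m (sumV (incAt v e))))
    ≡⟨ cong (λ k → ℕ→ℚ (sucAt v e) *ℚ Σℚ (map (λ a → f a *ℚ monoL a L (incAt v e)) (ofDeg m k))) (sumV-incAt v e v<n) ⟩
  ℕ→ℚ (sucAt v e) *ℚ Σℚ (map (λ a → f a *ℚ monoL a L (incAt v e)) (ofDeg m (suc s)))
    ≡⟨ sym (Σ-*ˡ (ℕ→ℚ (sucAt v e)) (ofDeg m (suc s)) (λ a → f a *ℚ monoL a L (incAt v e))) ⟩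
  Σℚ (map (λ a → ℕ→ℚ (sucAt v e) *ℚ (f a *ℚ monoL a L (incAt v e))) (ofDeg m (suc s)))
    ≡⟨ Σ-cong (ofDeg m (suc s)) (λ a → trans (*-leftComm (ℕ→ℚ (sucAt v e)) (f a) (monoL a L (incAt v e)))
         (trans (cong (f a *ℚ_) (∂-monoL v v<n a L e))
         (sym (Σ-*ˡ (f a) (upTo m) (λ b → (L b v *ℚ ℕ→ℚ (at b a)) *ℚ monoL (decAt b a) L e))))) ⟩
  Σℚ (map (λ a → Σ< m (λ b → f a *ℚ ((L b v *ℚ ℕ→ℚ (at b a)) *ℚ monoL (decAt b a) L e))) (ofDeg m (suc s)))
    ≡⟨ Σ-cong (ofDeg m (suc s)) (λ a → Σ-cong (upTo m) (λ b → regroup (f a) (L b v) (ℕ→ℚ (at b a)) (monoL (decAt b a) L e))) ⟩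
  Σℚ (map (λ a → Σ< m (λ b → L b v *ℚ (ℕ→ℚ (at b a) *ℚ (f a *ℚ monoL (decAt b a) L e)))) (ofDeg m (suc s)))
    ≡⟨ Σ-swap (ofDeg m (suc s)) (upTo m) (λ a b → L b v *ℚ (ℕ→ℚ (at b a) *ℚ (f a *ℚ monoL (decAt b a) L e))) ⟩
  Σ< m (λ b → Σℚ (map (λ a → L b v *ℚ (ℕ→ℚ (at b a) *ℚ (f a *ℚ monoL (decAt b a) L e))) (ofDeg m (suc s))))
    ≡⟨ Σ-cong (upTo m) (λ b → trans (Σ-*ˡ (L b v) (ofDeg m (suc s)) (λ a → ℕ→ℚ (at b a) *ℚ (f a *ℚ monoL (decAt b a) L e)))
         (cong (L b v *ℚ_) (trans (Σ-ofDeg-shift m s b (λ a → f a *ℚ monoL (decAt b a) L e))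
            (Σ-cong (ofDeg m s) (λ a → trans (cong (λ z → ℕ→ℚ (sucAt b a) *ℚ (f (incAt b a) *ℚ monoL z L e)) (decAt-incAt b a))
                 (sym (Q.*-assoc (ℕ→ℚ (sucAt b a)) (f (incAt b a)) (monoL a L e)))))))) ⟩
  Σ< m (λ b → L b v *ℚ subst m (∂ b f) L e) ∎
  where
  s = sumV e
  regroup : ∀ x l g y → x *ℚ ((l *ℚ g) *ℚ y) ≡ l *ℚ (g *ℚ (x *ℚ y))
  regroup = solve-∀ ℚ-ring

Euler : ∀ {n} → (ℕ → ℚ) → PS n → PS n
Euler w f e = dotV w e *ℚ f e

slice-Euler : ∀ {n} (w : ℕ → ℚ) (f : PS (suc n)) i →
  slice (Euler w f) i ≗ (λ a → (w 0 *ℚ ℕ→ℚ i) *ℚ slice f i a +ℚ Euler (λ t → w (suc t)) (slice f i) a)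
slice-Euler w f i a = Q.*-distribʳ-+ (f (i ∷ a)) (w 0 *ℚ ℕ→ℚ i) (dotV (λ t → w (suc t)) a)

·-slice-Eulerˡ : ∀ {n} (w : ℕ → ℚ) (f : PS (suc n)) (g : PS n) i e →
  (slice (Euler w f) i · g) e ≡ (w 0 *ℚ ℕ→ℚ i) *ℚ (slice f i · g) e +ℚ (Euler (λ t → w (suc t)) (slice f i) · g) e
·-slice-Eulerˡ w f g i e = begin
  (slice (Euler w f) i · g) e
    ≡⟨ ·-congˡ {f = slice (Euler w f) i} g (slice-Euler w f i) e ⟩
  ((λ a → ((w 0 *ℚ ℕ→ℚ i) • slice f i) a +ℚ Euler w′ (slice f i) a) · g) e
    ≡⟨ ·-+ˡ ((w 0 *ℚ ℕ→ℚ i) • slice f i) (Euler w′ (slice f i)) g e ⟩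
  (((w 0 *ℚ ℕ→ℚ i) • slice f i) · g) e +ℚ (Euler w′ (slice f i) · g) e
    ≡⟨ cong (_+ℚ (Euler w′ (slice f i) · g) e) (·-•ˡ (w 0 *ℚ ℕ→ℚ i) (slice f i) g e) ⟩
  (w 0 *ℚ ℕ→ℚ i) *ℚ (slice f i · g) e +ℚ (Euler w′ (slice f i) · g) e ∎
  where
  w′ : ℕ → ℚ
  w′ t = w (suc t)

·-slice-Eulerʳ : ∀ {n} (w : ℕ → ℚ) (f : PS n) (g : PS (suc n)) i e →
  (f · slice (Euler w g) i) e ≡ (w 0 *ℚ ℕ→ℚ i) *ℚ (f · slice g i) e +ℚ (f · Euler (λ t → w (suc t)) (slice g i)) e
·-slice-Eulerʳ w f g i e = begin
  (f · slice (Euler w g) i) e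
    ≡⟨ ·-congʳ f {slice (Euler w g) i} (slice-Euler w g i) e ⟩
  (f · (λ a → ((w 0 *ℚ ℕ→ℚ i) • slice g i) a +ℚ Euler w′ (slice g i) a)) e
    ≡⟨ ·-+ʳ f ((w 0 *ℚ ℕ→ℚ i) • slice g i) (Euler w′ (slice g i)) e ⟩
  (f · ((w 0 *ℚ ℕ→ℚ i) • slice g i)) e +ℚ (f · Euler w′ (slice g i)) e
    ≡⟨ cong (_+ℚ (f · Euler w′ (slice g i)) e) (·-•ʳ (w 0 *ℚ ℕ→ℚ i) f (slice g i) e) ⟩
  (w 0 *ℚ ℕ→ℚ i) *ℚ (f · slice g i) e +ℚ (f · Euler w′ (slice g i)) e ∎
  where
  w′ : ℕ → ℚ
  w′ t = w (suc t)

Euler-· : ∀ {n} (w : ℕ → ℚ) (f g : PS n) e →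
  Euler w (f · g) e ≡ (Euler w f · g) e +ℚ (f · Euler w g) e
Euler-· w f g [] = begin
  0ℚ *ℚ (f · g) []                              ≡⟨ Q.*-zeroˡ ((f · g) []) ⟩
  0ℚ                                            ≡⟨ vanish (f []) (g []) ⟨
  (0ℚ *ℚ f []) *ℚ g [] +ℚ f [] *ℚ (0ℚ *ℚ g [])  ≡⟨ cong₂ _+ℚ_ (·-[] (Euler w f) g) (·-[] f (Euler w g)) ⟨
  (Euler w f · g) [] +ℚ (f · Euler w g) []      ∎
  where
  vanish : ∀ a b → (0ℚ *ℚ a) *ℚ b +ℚ a *ℚ (0ℚ *ℚ b) ≡ 0ℚ
  vanish = solve-∀ ℚ-ring
Euler-· w f g (x ∷ e) = begin
  c *ℚ (f · g) (x ∷ e)                   ≡⟨ cong (c *ℚ_) (·-∷ f g x e) ⟩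
  c *ℚ Σ≤ x P                            ≡⟨ Σ-*ˡ c (upTo (suc x)) P ⟨
  Σ≤ x (λ i → c *ℚ P i)                  ≡⟨ Σ<-cong (suc x) {λ i → c *ℚ P i} {λ i → A i +ℚ B i} term ⟩
  Σ≤ x (λ i → A i +ℚ B i)                ≡⟨ Σ-+ (upTo (suc x)) A B ⟩
  Σ≤ x A +ℚ Σ≤ x B                       ≡⟨ cong₂ _+ℚ_ (·-∷ (Euler w f) g x e) (·-∷ f (Euler w g) x e) ⟨
  (Euler w f · g) (x ∷ e) +ℚ (f · Euler w g) (x ∷ e) ∎
  where
  w′ : ℕ → ℚ
  w′ t = w (suc t)
  c = w 0 *ℚ ℕ→ℚ x +ℚ dotV w′ e
  P A B : ℕ → ℚ
  P i = (slice f i · slice g (x ∸ i)) e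
  A i = (slice (Euler w f) i · slice g (x ∸ i)) e
  B i = (slice f i · slice (Euler w g) (x ∸ i)) e
  distribute : ∀ a b c d p → (a *ℚ (b +ℚ c) +ℚ d) *ℚ p ≡ (a *ℚ b *ℚ p +ℚ a *ℚ c *ℚ p) +ℚ d *ℚ p
  distribute = solve-∀ ℚ-ring
  interchange : ∀ u v x y → (u +ℚ v) +ℚ (x +ℚ y) ≡ (u +ℚ x) +ℚ (v +ℚ y)
  interchange = solve-∀ ℚ-ring
  term : ∀ i → i N.< suc x → c *ℚ P i ≡ A i +ℚ B i
  term i i≤x = begin
    c *ℚ P i
      ≡⟨ cong (λ k → (w 0 *ℚ ℕ→ℚ k +ℚ dotV w′ e) *ℚ P i) (sym (NP.m+[n∸m]≡n (NP.≤-pred i≤x))) ⟩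
    (w 0 *ℚ ℕ→ℚ (i + (x ∸ i)) +ℚ dotV w′ e) *ℚ P i
      ≡⟨ cong (λ k → (w 0 *ℚ k +ℚ dotV w′ e) *ℚ P i) (ℕ→ℚ-+ i (x ∸ i)) ⟩
    (w 0 *ℚ (ℕ→ℚ i +ℚ ℕ→ℚ (x ∸ i)) +ℚ dotV w′ e) *ℚ P i
      ≡⟨ distribute (w 0) (ℕ→ℚ i) (ℕ→ℚ (x ∸ i)) (dotV w′ e) (P i) ⟩
    ((w 0 *ℚ ℕ→ℚ i) *ℚ P i +ℚ (w 0 *ℚ ℕ→ℚ (x ∸ i)) *ℚ P i) +ℚ Euler w′ (slice f i · slice g (x ∸ i)) e
      ≡⟨ cong (((w 0 *ℚ ℕ→ℚ i) *ℚ P i +ℚ (w 0 *ℚ ℕ→ℚ (x ∸ i)) *ℚ P i) +ℚ_) (Euler-· w′ (slice f i) (slice g (x ∸ i)) e) ⟩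
    ((w 0 *ℚ ℕ→ℚ i) *ℚ P i +ℚ (w 0 *ℚ ℕ→ℚ (x ∸ i)) *ℚ P i) +ℚ
    ((Euler w′ (slice f i) · slice g (x ∸ i)) e +ℚ (slice f i · Euler w′ (slice g (x ∸ i))) e)
      ≡⟨ interchange ((w 0 *ℚ ℕ→ℚ i) *ℚ P i) ((w 0 *ℚ ℕ→ℚ (x ∸ i)) *ℚ P i)
                     ((Euler w′ (slice f i) · slice g (x ∸ i)) e) ((slice f i · Euler w′ (slice g (x ∸ i))) e) ⟩
    ((w 0 *ℚ ℕ→ℚ i) *ℚ P i +ℚ (Euler w′ (slice f i) · slice g (x ∸ i)) e) +ℚ
    ((w 0 *ℚ ℕ→ℚ (x ∸ i)) *ℚ P i +ℚ (slice f i · Euler w′ (slice g (x ∸ i))) e)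
      ≡⟨ cong₂ _+ℚ_ (·-slice-Eulerˡ w f (slice g (x ∸ i)) i e) (·-slice-Eulerʳ w (slice f i) g (x ∸ i) e) ⟨
    A i +ℚ B i ∎

Homogeneous : ∀ {n} → (ℕ → ℚ) → ℚ → PS n → Set
Homogeneous w k f = ∀ e → dotV w e *ℚ f e ≡ k *ℚ f e

Homogeneous-cong : ∀ {n} {w : ℕ → ℚ} {k k′ : ℚ} {f : PS n} → k ≡ k′ → Homogeneous w k f → Homogeneous w k′ f
Homogeneous-cong refl h = h

Homogeneous-· : ∀ {n} (w : ℕ → ℚ) {k l : ℚ} (f g : PS n) → Homogeneous w k f → Homogeneous w l g → Homogeneous w (k +ℚ l) (f · g)
Homogeneous-· w {k} {l} f g hf hg e = begin
  dotV w e *ℚ (f · g) e ≡⟨ Euler-· w f g e ⟩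
  (Euler w f · g) e +ℚ (f · Euler w g) e
    ≡⟨ cong₂ _+ℚ_ (trans (·-congˡ g hf e) (·-•ˡ k f g e)) (trans (·-congʳ f hg e) (·-•ʳ l f g e)) ⟩
  k *ℚ (f · g) e +ℚ l *ℚ (f · g) e ≡⟨ sym (Q.*-distribʳ-+ ((f · g) e) k l) ⟩
  (k +ℚ l) *ℚ (f · g) e ∎

Homogeneous-one : ∀ {n} (w : ℕ → ℚ) → Homogeneous {n} w 0ℚ onePS
Homogeneous-one {n} w e with sumV e ≡ᵇ 0 in eq
... | true = trans (cong (λ z → dotV w z *ℚ 1ℚ) (sumV≡0⇒replicate e (≡ᵇ-true⇒≡ eq)))
               (trans (cong (_*ℚ 1ℚ) (dotV-replicate {n} w)) (Q.*-zeroˡ 1ℚ))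
... | false = trans (Q.*-zeroʳ (dotV w e)) (sym (Q.*-zeroʳ 0ℚ))

Homogeneous-powPS : ∀ {n} (w : ℕ → ℚ) {k : ℚ} (f : PS n) → Homogeneous w k f → ∀ x → Homogeneous w (ℕ→ℚ x *ℚ k) (powPS f x)
Homogeneous-powPS w {k} f hf zero = Homogeneous-cong (sym (Q.*-zeroˡ k)) (Homogeneous-one w)
Homogeneous-powPS w {k} f hf (suc x) = Homogeneous-cong (trans (cong (k +ℚ_) (Q.*-comm (ℕ→ℚ x) k))
     (trans (collect k (ℕ→ℚ x)) (cong (_*ℚ k) (sym (ℕ→ℚ-suc x)))))
   (Homogeneous-· w {k} {ℕ→ℚ x *ℚ k} f (powPS f x) hf (Homogeneous-powPS w f hf x))
  where
  collect : ∀ k x → k +ℚ k *ℚ x ≡ (1ℚ +ℚ x) *ℚ k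
  collect = solve-∀ ℚ-ring

dotV-degree-one : ∀ {n} (w c : ℕ → ℚ) (k : ℚ) → (∀ t → t N.< n → c t *ℚ w t ≡ c t *ℚ k) →
  ∀ (e : Vec ℕ n) → sumV e ≡ 1 → dotV w e *ℚ dotV c e ≡ k *ℚ dotV c e
dotV-degree-one {suc n} w c k h (zero ∷ e) s = begin
  (w 0 *ℚ ℕ→ℚ 0 +ℚ dotV w′ e) *ℚ (c 0 *ℚ ℕ→ℚ 0 +ℚ dotV c′ e)
    ≡⟨ cong₂ (λ a b → (a +ℚ dotV w′ e) *ℚ (b +ℚ dotV c′ e)) (Q.*-zeroʳ (w 0)) (Q.*-zeroʳ (c 0)) ⟩
  (0ℚ +ℚ dotV w′ e) *ℚ (0ℚ +ℚ dotV c′ e) ≡⟨ cong₂ _*ℚ_ (Q.+-identityˡ (dotV w′ e)) (Q.+-identityˡ (dotV c′ e)) ⟩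
  dotV w′ e *ℚ dotV c′ e ≡⟨ dotV-degree-one w′ c′ k (λ t t< → h (suc t) (N.s≤s t<)) e s ⟩
  k *ℚ dotV c′ e ≡⟨ cong (k *ℚ_) (sym (trans (cong (_+ℚ dotV c′ e) (Q.*-zeroʳ (c 0))) (Q.+-identityˡ _))) ⟩
  k *ℚ (c 0 *ℚ ℕ→ℚ 0 +ℚ dotV c′ e) ∎
  where
  w′ : ℕ → ℚ
  w′ t = w (suc t)
  c′ : ℕ → ℚ
  c′ t = c (suc t)
dotV-degree-one {suc n} w c k h (suc zero ∷ e) s = begin
  (w 0 *ℚ ℕ→ℚ 1 +ℚ dotV w′ e) *ℚ (c 0 *ℚ ℕ→ℚ 1 +ℚ dotV c′ e)
    ≡⟨ cong₂ (λ a b → (w 0 *ℚ ℕ→ℚ 1 +ℚ a) *ℚ (c 0 *ℚ ℕ→ℚ 1 +ℚ b)) dw dc′ ⟩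
  (w 0 *ℚ 1ℚ +ℚ 0ℚ) *ℚ (c 0 *ℚ 1ℚ +ℚ 0ℚ) ≡⟨ unit (w 0) (c 0) ⟩
  c 0 *ℚ w 0 ≡⟨ h 0 (N.s≤s N.z≤n) ⟩
  c 0 *ℚ k ≡⟨ unit′ k (c 0) ⟨
  k *ℚ (c 0 *ℚ 1ℚ +ℚ 0ℚ) ≡⟨ cong (λ b → k *ℚ (c 0 *ℚ ℕ→ℚ 1 +ℚ b)) (sym dc′) ⟩
  k *ℚ (c 0 *ℚ ℕ→ℚ 1 +ℚ dotV c′ e) ∎
  where
  w′ : ℕ → ℚ
  w′ t = w (suc t)
  c′ : ℕ → ℚ
  c′ t = c (suc t)
  dw : dotV w′ e ≡ 0ℚ
  dw = trans (cong (dotV w′) (sumV≡0⇒replicate e (NP.suc-injective s))) (dotV-replicate {n} w′)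
  dc′ : dotV c′ e ≡ 0ℚ
  dc′ = trans (cong (dotV c′) (sumV≡0⇒replicate e (NP.suc-injective s))) (dotV-replicate {n} c′)
  unit : ∀ a b → (a *ℚ 1ℚ +ℚ 0ℚ) *ℚ (b *ℚ 1ℚ +ℚ 0ℚ) ≡ b *ℚ a
  unit = solve-∀ ℚ-ring
  unit′ : ∀ k b → k *ℚ (b *ℚ 1ℚ +ℚ 0ℚ) ≡ b *ℚ k
  unit′ = solve-∀ ℚ-ring

Homogeneous-linPS : ∀ {n} (w c : ℕ → ℚ) (k : ℚ) → (∀ t → t N.< n → c t *ℚ w t ≡ c t *ℚ k) → Homogeneous {n} w k (linPS c)
Homogeneous-linPS w c k h e with sumV e ≡ᵇ 1 in eq
... | true = dotV-degree-one w c k h e (≡ᵇ-true⇒≡ eq)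
... | false = trans (Q.*-zeroʳ (dotV w e)) (sym (Q.*-zeroʳ k))

WeightCompatible : ℕ → (w w′ : ℕ → ℚ) → (ℕ → ℕ → ℚ) → Set
WeightCompatible n w w′ L = ∀ a t → t N.< n → L a t *ℚ w t ≡ L a t *ℚ w′ a

Homogeneous-monoL : ∀ {n} (w w′ : ℕ → ℚ) {m} (L : ℕ → ℕ → ℚ) →
  WeightCompatible n w w′ L → (as : Vec ℕ m) → Homogeneous {n} w (dotV w′ as) (monoL as L)
Homogeneous-monoL w w′ L h [] = Homogeneous-one w
Homogeneous-monoL w w′ L h (x ∷ as) = Homogeneous-cong (cong (_+ℚ dotV (λ t → w′ (suc t)) as) (Q.*-comm (ℕ→ℚ x) (w′ 0)))
  (Homogeneous-· w {ℕ→ℚ x *ℚ w′ 0} {dotV (λ t → w′ (suc t)) as} (powPS (linPS (L 0)) x) (monoL as (λ i → L (suc i)))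
     (Homogeneous-powPS w (linPS (L 0)) (Homogeneous-linPS w (L 0) (w′ 0) (h 0)) x)
     (Homogeneous-monoL w (λ t → w′ (suc t)) (λ i → L (suc i)) (λ a t t< → h (suc a) t t<) as))

Euler-subst : ∀ {n} (w w′ : ℕ → ℚ) m (f : PS m) (L : ℕ → ℕ → ℚ) →
  WeightCompatible n w w′ L → ∀ (e : Vec ℕ n) →
  Euler w (subst m f L) e ≡ subst m (Euler w′ f) L e
Euler-subst w w′ m f L h e = trans (sym (Σ-*ˡ (dotV w e) (ofDeg m (sumV e)) (λ a → f a *ℚ monoL a L e)))
  (Σ-cong (ofDeg m (sumV e)) (λ a → trans (*-leftComm (dotV w e) (f a) (monoL a L e))
     (trans (cong (f a *ℚ_) (Homogeneous-monoL w w′ L h a e)) (rotate (f a) (dotV w′ a) (monoL a L e)))))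
  where
  rotate : ∀ x d y → x *ℚ (d *ℚ y) ≡ (d *ℚ x) *ℚ y
  rotate = solve-∀ ℚ-ring

∂≡0 : ∀ {n} → ℕ → PS n → Set
∂≡0 v f = ∀ e → ∂ v f e ≡ 0ℚ

Δ : ∀ {n} (r : ℕ) (X Y : ℕ → ℕ) → PS n → PS n
Δ r X Y f e = Σ< r (λ t → ∂ (X t) (∂ (Y t) f) e)

cross : ∀ {n} (r : ℕ) (X Y : ℕ → ℕ) → PS n → PS n → PS n
cross r X Y f g e = Σ< r (λ t → (∂ (X t) f · ∂ (Y t) g) e)

∂-cong : ∀ {n} v {f g : PS n} → f ≗ g → ∀ e → ∂ v f e ≡ ∂ v g e
∂-cong v p e = cong (ℕ→ℚ (sucAt v e) *ℚ_) (p (incAt v e))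

∂-+ : ∀ {n} v (f g : PS n) e → ∂ v (λ e′ → f e′ +ℚ g e′) e ≡ ∂ v f e +ℚ ∂ v g e
∂-+ v f g e = Q.*-distribˡ-+ (ℕ→ℚ (sucAt v e)) (f (incAt v e)) (g (incAt v e))

∂-ΣPSL : ∀ {n} {A : Set} v (xs : List A) (F : A → PS n) e →
  ∂ v (ΣPSL xs F) e ≡ Σℚ (map (λ x → ∂ v (F x) e) xs)
∂-ΣPSL v xs F e = sym (Σ-*ˡ (ℕ→ℚ (sucAt v e)) xs (λ x → F x (incAt v e)))

∂-• : ∀ {n} v c (f : PS n) e → ∂ v (c • f) e ≡ c *ℚ ∂ v f e
∂-• v c f e = *-leftComm (ℕ→ℚ (sucAt v e)) c (f (incAt v e))

zero⇒∂≡0 : ∀ {n} v (f : PS n) → (∀ e → f e ≡ 0ℚ) → ∂≡0 v f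
zero⇒∂≡0 v f p e = trans (cong (ℕ→ℚ (sucAt v e) *ℚ_) (p (incAt v e))) (Q.*-zeroʳ (ℕ→ℚ (sucAt v e)))

sucAt-out : ∀ {n} v (e : Vec ℕ n) → ¬ v N.< n → sucAt v e ≡ 0
sucAt-out v [] _ = refl
sucAt-out zero (x ∷ e) p = ⊥-elim (p (N.s≤s N.z≤n))
sucAt-out (suc v) (x ∷ e) p = sucAt-out v e (λ q → p (N.s≤s q))

∂≡0-out : ∀ {n} v (f : PS n) → ¬ v N.< n → ∂≡0 v f
∂≡0-out v f p e = trans (cong (λ k → ℕ→ℚ k *ℚ f (incAt v e)) (sucAt-out v e p)) (Q.*-zeroˡ (f (incAt v e)))

∂≡0-· : ∀ {n} v (f g : PS n) → ∂≡0 v f → ∂≡0 v g → ∂≡0 v (f · g)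
∂≡0-· v f g hf hg e = trans (∂-· v f g e)
  (trans (cong₂ _+ℚ_ (·-zeroˡ g hf e) (·-zeroʳ f hg e)) (Q.+-identityˡ 0ℚ))

∂≡0-subst : ∀ {n} v m (f : PS m) (L : ℕ → ℕ → ℚ) → (∀ a → a N.< m → L a v ≡ 0ℚ) → ∂≡0 {n} v (subst m f L)
∂≡0-subst {n} v m f L p e with v N.<? n
... | yes v<n = trans (∂-subst v v<n m f L e)
        (Σ<-zero m (λ a → L a v *ℚ subst m (∂ a f) L e) (λ a a<m → trans (cong (_*ℚ subst m (∂ a f) L e) (p a a<m)) (Q.*-zeroˡ (subst m (∂ a f) L e))))
... | no v≮n = ∂≡0-out v (subst m f L) v≮n e

∂-subst-δ : ∀ {n} v → v N.< n → ∀ m k → k N.< m → (f : PS m) (L : ℕ → ℕ → ℚ) →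
  (∀ a → a N.< m → L a v ≡ [ a ≡ᵇ k ]) → ∀ e → ∂ v (subst m f L) e ≡ subst m (∂ k f) L e
∂-subst-δ {n} v v<n m k k<m f L p e = trans (∂-subst v v<n m f L e)
  (trans (Σ<-cong m {λ a → L a v *ℚ subst m (∂ a f) L e} {λ a → [ a ≡ᵇ k ] *ℚ subst m (∂ a f) L e}
           (λ a a<m → cong (_*ℚ subst m (∂ a f) L e) (p a a<m)))
         (Σ<-δ m k (λ a → subst m (∂ a f) L e) k<m))

Σ∂-subst : ∀ {n} r (X : ℕ → ℕ) → (∀ t → t N.< r → X t N.< n) → ∀ m (f : PS m) (L : ℕ → ℕ → ℚ) e →
  Σ< r (λ t → ∂ (X t) (subst m f L) e) ≡ Σ< m (λ a → Σ< r (λ t → L a (X t)) *ℚ subst m (∂ a f) L e)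
Σ∂-subst {n} r X hX m f L e = begin
  Σ< r (λ t → ∂ (X t) (subst m f L) e)
    ≡⟨ Σ<-cong r (λ t t<r → ∂-subst (X t) (hX t t<r) m f L e) ⟩
  Σ< r (λ t → Σ< m (λ a → L a (X t) *ℚ subst m (∂ a f) L e))
    ≡⟨ Σ-swap (upTo r) (upTo m) (λ t a → L a (X t) *ℚ subst m (∂ a f) L e) ⟩
  Σ< m (λ a → Σ< r (λ t → L a (X t) *ℚ subst m (∂ a f) L e))
    ≡⟨ Σ-cong (upTo m) (λ a → Σ-*ʳ (subst m (∂ a f) L e) (upTo r) (λ t → L a (X t))) ⟩
  Σ< m (λ a → Σ< r (λ t → L a (X t)) *ℚ subst m (∂ a f) L e) ∎

Δ-· : ∀ {n} r (X Y : ℕ → ℕ) (f g : PS n) e →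
  Δ r X Y (f · g) e ≡ ((Δ r X Y f · g) e +ℚ (f · Δ r X Y g) e) +ℚ (cross r X Y f g e +ℚ cross r Y X f g e)
Δ-· r X Y f g e = begin
  Σ< r (λ t → ∂ (X t) (∂ (Y t) (f · g)) e)
    ≡⟨ Σ-cong (upTo r) term ⟩
  Σ< r (λ t → (a t +ℚ b t) +ℚ (c t +ℚ d t))
    ≡⟨ Σ-+ (upTo r) (λ t → a t +ℚ b t) (λ t → c t +ℚ d t) ⟩
  Σ< r (λ t → a t +ℚ b t) +ℚ Σ< r (λ t → c t +ℚ d t)
    ≡⟨ cong₂ _+ℚ_ (Σ-+ (upTo r) a b) (Σ-+ (upTo r) c d) ⟩
  (Σ< r a +ℚ Σ< r b) +ℚ (Σ< r c +ℚ Σ< r d)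
    ≡⟨ cong (λ z → z +ℚ (Σ< r c +ℚ Σ< r d))
         (cong₂ _+ℚ_ (sym (·-ΣPSLˡ (upTo r) (λ t → ∂ (X t) (∂ (Y t) f)) g e))
                     (sym (·-ΣPSLʳ (upTo r) f (λ t → ∂ (X t) (∂ (Y t) g)) e))) ⟩
  ((Δ r X Y f · g) e +ℚ (f · Δ r X Y g) e) +ℚ (cross r X Y f g e +ℚ cross r Y X f g e) ∎
  where
  a b c d : ℕ → ℚ
  a t = (∂ (X t) (∂ (Y t) f) · g) e
  b t = (f · ∂ (X t) (∂ (Y t) g)) e
  c t = (∂ (X t) f · ∂ (Y t) g) e
  d t = (∂ (Y t) f · ∂ (X t) g) e
  swap-middle : ∀ p q u v → (p +ℚ q) +ℚ (u +ℚ v) ≡ (p +ℚ v) +ℚ (u +ℚ q)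
  swap-middle = solve-∀ ℚ-ring
  term : ∀ t → ∂ (X t) (∂ (Y t) (f · g)) e ≡ (a t +ℚ b t) +ℚ (c t +ℚ d t)
  term t = begin
    ∂ (X t) (∂ (Y t) (f · g)) e
      ≡⟨ ∂-cong (X t) (∂-· (Y t) f g) e ⟩
    ∂ (X t) (λ e′ → (∂ (Y t) f · g) e′ +ℚ (f · ∂ (Y t) g) e′) e
      ≡⟨ ∂-+ (X t) (∂ (Y t) f · g) (f · ∂ (Y t) g) e ⟩
    ∂ (X t) (∂ (Y t) f · g) e +ℚ ∂ (X t) (f · ∂ (Y t) g) e
      ≡⟨ cong₂ _+ℚ_ (∂-· (X t) (∂ (Y t) f) g e) (∂-· (X t) f (∂ (Y t) g) e) ⟩
    (a t +ℚ d t) +ℚ (c t +ℚ b t)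
      ≡⟨ swap-middle (a t) (d t) (c t) (b t) ⟩
    (a t +ℚ b t) +ℚ (c t +ℚ d t) ∎

Δ-ΣPSL : ∀ {n} {A : Set} r (X Y : ℕ → ℕ) (xs : List A) (F : A → PS n) e →
  Δ r X Y (ΣPSL xs F) e ≡ Σℚ (map (λ x → Δ r X Y (F x) e) xs)
Δ-ΣPSL r X Y xs F e =
  trans (Σ-cong (upTo r) (λ t → trans (∂-cong (X t) (∂-ΣPSL (Y t) xs F) e) (∂-ΣPSL (X t) xs (λ x → ∂ (Y t) (F x)) e)))
        (Σ-swap (upTo r) xs (λ t x → ∂ (X t) (∂ (Y t) (F x)) e))

cross≡0 : ∀ {n} r (X Y : ℕ → ℕ) (f g : PS n) → (∀ t → t N.< r → ∂≡0 (X t) f ⊎ ∂≡0 (Y t) g) → ∀ e → cross r X Y f g e ≡ 0ℚ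
cross≡0 r X Y f g p e = Σ<-zero r (λ t → (∂ (X t) f · ∂ (Y t) g) e) (λ t t<r → case (p t t<r))
  where
  case : ∀ {t} → ∂≡0 (X t) f ⊎ ∂≡0 (Y t) g → (∂ (X t) f · ∂ (Y t) g) e ≡ 0ℚ
  case {t} (inj₁ h) = ·-zeroˡ (∂ (Y t) g) h e
  case {t} (inj₂ h) = ·-zeroʳ (∂ (X t) f) h e

incAt-comm : ∀ {n} u v (e : Vec ℕ n) → incAt u (incAt v e) ≡ incAt v (incAt u e)
incAt-comm u v [] = refl
incAt-comm zero zero (x ∷ e) = refl
incAt-comm zero (suc v) (x ∷ e) = refl
incAt-comm (suc u) zero (x ∷ e) = refl
incAt-comm (suc u) (suc v) (x ∷ e) = cong (x ∷_) (incAt-comm u v e)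

sucAt-incAt : ∀ {n} u v (e : Vec ℕ n) → ¬ u ≡ v → sucAt u (incAt v e) ≡ sucAt u e
sucAt-incAt u v [] _ = refl
sucAt-incAt zero zero (x ∷ e) p = ⊥-elim (p refl)
sucAt-incAt zero (suc v) (x ∷ e) p = refl
sucAt-incAt (suc u) zero (x ∷ e) p = refl
sucAt-incAt (suc u) (suc v) (x ∷ e) p = sucAt-incAt u v e (λ q → p (cong suc q))

∂-comm : ∀ {n} u v (f : PS n) e → ∂ u (∂ v f) e ≡ ∂ v (∂ u f) e
∂-comm u v f e with u N.≟ v
... | yes refl = refl
... | no u≢v = begin
  ℕ→ℚ (sucAt u e) *ℚ (ℕ→ℚ (sucAt v (incAt u e)) *ℚ f (incAt v (incAt u e)))
    ≡⟨ cong₂ (λ a b → ℕ→ℚ (sucAt u e) *ℚ (ℕ→ℚ a *ℚ f b)) (sucAt-incAt v u e (λ q → u≢v (sym q))) (incAt-comm v u e) ⟩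
  ℕ→ℚ (sucAt u e) *ℚ (ℕ→ℚ (sucAt v e) *ℚ f (incAt u (incAt v e)))
    ≡⟨ *-leftComm (ℕ→ℚ (sucAt u e)) (ℕ→ℚ (sucAt v e)) (f (incAt u (incAt v e))) ⟩
  ℕ→ℚ (sucAt v e) *ℚ (ℕ→ℚ (sucAt u e) *ℚ f (incAt u (incAt v e)))
    ≡⟨ cong (λ a → ℕ→ℚ (sucAt v e) *ℚ (ℕ→ℚ a *ℚ f (incAt u (incAt v e)))) (sym (sucAt-incAt u v e u≢v)) ⟩
  ℕ→ℚ (sucAt v e) *ℚ (ℕ→ℚ (sucAt u (incAt v e)) *ℚ f (incAt u (incAt v e))) ∎

∂≡0-ΣPSL : ∀ {n} {A : Set} v (xs : List A) (F : A → PS n) → (∀ x → ∂≡0 v (F x)) → ∂≡0 v (ΣPSL xs F)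
∂≡0-ΣPSL v xs F p e = trans (∂-ΣPSL v xs F e) (Σ-zero xs (λ x → ∂ v (F x) e) (λ x → p x e))

∂≡0-• : ∀ {n} v c (f : PS n) → ∂≡0 v f → ∂≡0 v (c • f)
∂≡0-• v c f p e = trans (∂-• v c f e) (trans (cong (c *ℚ_) (p e)) (Q.*-zeroʳ c))

∂≡0-∂ : ∀ {n} u v (f : PS n) → ∂≡0 u f → ∂≡0 u (∂ v f)
∂≡0-∂ u v f p e = trans (∂-comm u v f e) (zero⇒∂≡0 v (∂ u f) p e)

∂∂≡0 : ∀ {n} → ℕ → ℕ → PS n → Set
∂∂≡0 u v f = ∀ e → ∂ u (∂ v f) e ≡ 0ℚ

∂∂≡0ˡ : ∀ {n} u v (f : PS n) → ∂≡0 u f → ∂∂≡0 u v f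
∂∂≡0ˡ u v f p = ∂≡0-∂ u v f p

∂∂≡0ʳ : ∀ {n} u v (f : PS n) → ∂≡0 v f → ∂∂≡0 u v f
∂∂≡0ʳ u v f p = zero⇒∂≡0 u (∂ v f) p

∂∂≡0-ΣPSL : ∀ {n} {A : Set} u v (xs : List A) (F : A → PS n) → (∀ x → ∂∂≡0 u v (F x)) → ∂∂≡0 u v (ΣPSL xs F)
∂∂≡0-ΣPSL u v xs F p e = trans (∂-cong u (∂-ΣPSL v xs F) e)
  (∂≡0-ΣPSL u xs (λ x → ∂ v (F x)) p e)

∂∂≡0-• : ∀ {n} u v c (f : PS n) → ∂∂≡0 u v f → ∂∂≡0 u v (c • f)
∂∂≡0-• u v c f p e = trans (∂-cong u (∂-• v c f) e) (∂≡0-• u c (∂ v f) p e)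

subst-zero : ∀ {n} m (f : PS m) (L : ℕ → ℕ → ℚ) → (∀ a → f a ≡ 0ℚ) → ∀ (e : Vec ℕ n) → subst m f L e ≡ 0ℚ
subst-zero m f L p e = Σ-zero (ofDeg m (sumV e)) (λ a → f a *ℚ monoL a L e) (λ a → trans (cong (_*ℚ monoL a L e) (p a)) (Q.*-zeroˡ (monoL a L e)))

∂-subst-cδ : ∀ {n} v → v N.< n → ∀ m k → k N.< m → (f : PS m) (L : ℕ → ℕ → ℚ) (c : ℚ) →
  (∀ a → a N.< m → L a v ≡ c *ℚ [ a ≡ᵇ k ]) → ∀ e → ∂ v (subst m f L) e ≡ c *ℚ subst m (∂ k f) L e
∂-subst-cδ {n} v v<n m k k<m f L c p e = trans (∂-subst v v<n m f L e)
  (trans (Σ<-cong m {λ a → L a v *ℚ subst m (∂ a f) L e} {λ a → c *ℚ ([ a ≡ᵇ k ] *ℚ subst m (∂ a f) L e)}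
           (λ a a<m → trans (cong (_*ℚ subst m (∂ a f) L e) (p a a<m)) (Q.*-assoc c [ a ≡ᵇ k ] (subst m (∂ a f) L e))))
  (trans (Σ-*ˡ c (upTo m) (λ a → [ a ≡ᵇ k ] *ℚ subst m (∂ a f) L e))
         (cong (c *ℚ_) (Σ<-δ m k (λ a → subst m (∂ a f) L e) k<m))))

-- Each summand of 𝔟 is a series in Y₁ … Y_{j−i} times a series in X_{j+1} … X_r, so no
-- summand involves both X_α and Y_β when α ≤ β.
𝔟-∂∂≡0 : ∀ μ r α β → α N.≤ β → β N.< r → ∂∂≡0 α (r + β) (𝔟 μ r)
𝔟-∂∂≡0 μ r α β α≤β β<r =
  ∂∂≡0-ΣPSL α (r + β) (upTo (suc r)) (λ j → ΣPS≤ j (λ i → γ μ i • summand j i)) (λ j →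
  ∂∂≡0-ΣPSL α (r + β) (upTo (suc j)) (λ i → γ μ i • summand j i) (λ i →
  ∂∂≡0-• α (r + β) (γ μ i) (summand j i) (summand-∂∂≡0 j i)))
  where
  LY : ℕ → ℕ → ℕ → ℕ → ℚ
  LY j i t v = [ (r ≤ᵇ v) ∧ ((v ∸ r) <ᵇ (j ∸ i ∸ t)) ]
  LX : ℕ → ℕ → ℕ → ℚ
  LX j t v = [ v ≡ᵇ j + t ]
  βY : ℕ → ℕ → PS (r + r)
  βY j i = subst (j ∸ i) (βps μ (j ∸ i)) (LY j i)
  βX : ℕ → PS (r + r)
  βX j = subst (r ∸ j) (βps μ (r ∸ j)) (LX j)
  summand : ℕ → ℕ → PS (r + r)
  summand j i = βY j i · βX j
  r≰α : ¬ r N.≤ α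
  r≰α r≤α = NP.<⇒≱ (NP.≤-<-trans α≤β β<r) r≤α
  α≢j+a : ∀ j → α N.< j → ∀ a → ¬ α ≡ j + a
  α≢j+a j α<j a q = NP.<⇒≱ α<j (≡.subst (λ z → j N.≤ z) (sym q) (NP.m≤m+n j a))
  β≮j∸i∸a : ∀ j i → ¬ α N.< j → ∀ a → ¬ β N.< j ∸ i ∸ a
  β≮j∸i∸a j i α≮j a q = α≮j (NP.≤-<-trans α≤β (NP.<-≤-trans q (NP.≤-trans (NP.m∸n≤m (j ∸ i) a) (NP.m∸n≤m j i))))
  r+β≢j+a : ∀ j → ¬ α N.< j → ∀ a → a N.< r ∸ j → ¬ r + β ≡ j + a
  r+β≢j+a j α≮j a a< q = NP.<⇒≱ (j+a<r) (≡.subst (λ z → r N.≤ z) q (NP.m≤m+n r β))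
    where
    j≤r : j N.≤ r
    j≤r = NP.≤-trans (NP.≮⇒≥ α≮j) (NP.≤-trans α≤β (NP.<⇒≤ β<r))
    j+a<r : j + a N.< r
    j+a<r = NP.<-≤-trans (NP.+-monoʳ-< j a<) (NP.≤-reflexive (NP.m+[n∸m]≡n j≤r))
  summand-∂∂≡0 : ∀ j i → ∂∂≡0 α (r + β) (summand j i)
  summand-∂∂≡0 j i with α N.<? j
  ... | yes α<j = ∂∂≡0ˡ α (r + β) (summand j i) (∂≡0-· α (βY j i) (βX j)
         (∂≡0-subst α (j ∸ i) (βps μ (j ∸ i)) (LY j i) (λ a _ → cong [_] (cong (_∧ ((α ∸ r) <ᵇ (j ∸ i ∸ a))) (≤ᵇ-false r≰α))))
         (∂≡0-subst α (r ∸ j) (βps μ (r ∸ j)) (LX j) (λ a _ → []≡0 (≡ᵇ-false (α≢j+a j α<j a)))))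
  ... | no α≮j = ∂∂≡0ʳ α (r + β) (summand j i) (∂≡0-· (r + β) (βY j i) (βX j)
         (∂≡0-subst (r + β) (j ∸ i) (βps μ (j ∸ i)) (LY j i) (λ a _ → cong [_] (trans (cong ((r ≤ᵇ (r + β)) ∧_)
            (trans (cong (_<ᵇ (j ∸ i ∸ a)) (NP.m+n∸m≡n r β)) (<ᵇ-false (β≮j∸i∸a j i α≮j a)))) (BP.∧-zeroʳ _))))
         (∂≡0-subst (r + β) (r ∸ j) (βps μ (r ∸ j)) (LX j) (λ a a< → []≡0 (≡ᵇ-false (r+β≢j+a j α≮j a a<)))))

-- 𝔟~ is a combination of the series 𝔟[X_{i+1}, …, X_r | −Y₁, …, −Y_{r−i}], which inherit
-- the vanishing of ∂_{X_α} ∂_{Y_β} for α ≤ β through the shift of the X-variables.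
module 𝔟~-summand (μ : Mould) (r i : ℕ) where

  p : ℕ
  p = r ∸ i

  L : ℕ → ℕ → ℚ
  L a v = if a <ᵇ p then [ v ≡ᵇ i + a ] else -ℚ [ v ≡ᵇ r + (a ∸ p) ]

  summand : PS (r + r)
  summand = subst (p + p) (𝔟 μ p) L

  L-< : ∀ {a} v → a N.< p → L a v ≡ [ v ≡ᵇ i + a ]
  L-< v a<p = if-true (<ᵇ-true a<p)

  L-≥ : ∀ {a} v → ¬ a N.< p → L a v ≡ -ℚ [ v ≡ᵇ r + (a ∸ p) ]
  L-≥ v a≮p = if-false (<ᵇ-false a≮p)

  module _ (α β : ℕ) (α≤β : α N.≤ β) (β<r : β N.< r) where

    α<r : α N.< r
    α<r = NP.≤-<-trans α≤β β<r

    r+β≢i+a : ∀ a → a N.< p → ¬ r + β ≡ i + a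
    r+β≢i+a a a<p q = NP.<⇒≱ (<∸⇒+< i a r a<p) (≡.subst (r N.≤_) q (NP.m≤m+n r β))

    α≢r+x : ∀ x → ¬ α ≡ r + x
    α≢r+x x q = NP.<⇒≱ α<r (≡.subst (r N.≤_) (sym q) (NP.m≤m+n r x))

    ∂Y≡0 : ¬ β N.< p → ∂≡0 (r + β) summand
    ∂Y≡0 β≮p = ∂≡0-subst (r + β) (p + p) (𝔟 μ p) L L-Y
      where
      L-Y : ∀ a → a N.< p + p → L a (r + β) ≡ 0ℚ
      L-Y a a< with a N.<? p
      ... | yes a<p = trans (L-< (r + β) a<p) ([]≡0 (≡ᵇ-false (r+β≢i+a a a<p)))
      ... | no a≮p = trans (L-≥ (r + β) a≮p) (cong -ℚ_ ([]≡0 (≡ᵇ-false (λ q → β≮p (≡.subst (N._< p)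
              (sym (NP.+-cancelˡ-≡ r β (a ∸ p) q))
              (NP.<-≤-trans (NP.∸-monoˡ-< a< (NP.≮⇒≥ a≮p)) (NP.≤-reflexive (NP.m+n∸n≡m p p))))))))

    ∂X≡0 : ¬ i N.≤ α → ∂≡0 α summand
    ∂X≡0 i≰α = ∂≡0-subst α (p + p) (𝔟 μ p) L L-X
      where
      L-X : ∀ a → a N.< p + p → L a α ≡ 0ℚ
      L-X a a< with a N.<? p
      ... | yes a<p = trans (L-< α a<p) ([]≡0 (≡ᵇ-false (λ q → i≰α (≡.subst (i N.≤_) (sym q) (NP.m≤m+n i a)))))
      ... | no a≮p = trans (L-≥ α a≮p) (cong -ℚ_ ([]≡0 (≡ᵇ-false (α≢r+x (a ∸ p)))))

    ∂∂≡0-shifted : i N.≤ α → β N.< p → ∂∂≡0 α (r + β) summand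
    ∂∂≡0-shifted i≤α β<p e = begin
      ∂ α (∂ (r + β) summand) e
        ≡⟨ ∂-cong α (∂-subst-cδ (r + β) (NP.+-monoʳ-< r β<r) (p + p) (p + β) (NP.+-monoʳ-< p β<p) (𝔟 μ p) L (-ℚ 1ℚ) L-Y) e ⟩
      ∂ α ((-ℚ 1ℚ) • subst (p + p) (∂ (p + β) (𝔟 μ p)) L) e
        ≡⟨ ∂-• α (-ℚ 1ℚ) (subst (p + p) (∂ (p + β) (𝔟 μ p)) L) e ⟩
      (-ℚ 1ℚ) *ℚ ∂ α (subst (p + p) (∂ (p + β) (𝔟 μ p)) L) e
        ≡⟨ cong ((-ℚ 1ℚ) *ℚ_) (∂-subst-δ α (NP.<-≤-trans α<r (NP.m≤m+n r r)) (p + p) (α ∸ i)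
                                          (NP.<-≤-trans α-i<p (NP.m≤m+n p p)) (∂ (p + β) (𝔟 μ p)) L L-X e) ⟩
      (-ℚ 1ℚ) *ℚ subst (p + p) (∂ (α ∸ i) (∂ (p + β) (𝔟 μ p))) L e
        ≡⟨ cong ((-ℚ 1ℚ) *ℚ_) (subst-zero (p + p) _ L (𝔟-∂∂≡0 μ p (α ∸ i) β (NP.≤-trans (NP.m∸n≤m α i) α≤β) β<p) e) ⟩
      (-ℚ 1ℚ) *ℚ 0ℚ
        ≡⟨ Q.*-zeroʳ (-ℚ 1ℚ) ⟩
      0ℚ ∎
      where
      α-i<p : α ∸ i N.< p
      α-i<p = NP.∸-monoˡ-< α<r i≤α
      neg-as-* : ∀ x → -ℚ x ≡ (-ℚ 1ℚ) *ℚ x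
      neg-as-* x = trans (cong -ℚ_ (sym (Q.*-identityˡ x))) (Q.neg-distribˡ-* 1ℚ x)
      L-Y : ∀ a → a N.< p + p → L a (r + β) ≡ (-ℚ 1ℚ) *ℚ [ a ≡ᵇ p + β ]
      L-Y a a< with a N.<? p
      ... | yes a<p = trans (L-< (r + β) a<p) (trans ([]≡0 (≡ᵇ-false (r+β≢i+a a a<p)))
              (sym (trans (cong ((-ℚ 1ℚ) *ℚ_) ([]≡0 (≡ᵇ-false (λ q → NP.<-irrefl refl
                                  (NP.<-≤-trans a<p (≡.subst (p N.≤_) (sym q) (NP.m≤m+n p β)))))))
                          (Q.*-zeroʳ (-ℚ 1ℚ)))))
      ... | no a≮p = trans (L-≥ (r + β) a≮p) (trans (neg-as-* _) (cong (λ z → (-ℚ 1ℚ) *ℚ [ z ])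
              (≡ᵇ-cong (λ q → trans (sym (NP.m+[n∸m]≡n (NP.≮⇒≥ a≮p))) (cong (p +_) (sym (NP.+-cancelˡ-≡ r β (a ∸ p) q))))
                       (λ q → cong (r +_) (trans (sym (NP.m+n∸m≡n p β)) (cong (_∸ p) (sym q)))))))
      L-X : ∀ a → a N.< p + p → L a α ≡ [ a ≡ᵇ α ∸ i ]
      L-X a a< with a N.<? p
      ... | yes a<p = trans (L-< α a<p) (cong [_]
              (≡ᵇ-cong (λ q → trans (sym (NP.m+n∸m≡n i a)) (cong (_∸ i) (sym q)))
                       (λ q → trans (sym (NP.m+[n∸m]≡n i≤α)) (cong (i +_) (sym q)))))
      ... | no a≮p = trans (L-≥ α a≮p) (trans (cong -ℚ_ ([]≡0 (≡ᵇ-false (α≢r+x (a ∸ p)))))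
              (sym ([]≡0 (≡ᵇ-false (λ q → a≮p (≡.subst (N._< p) (sym q) α-i<p))))))

    summand-∂∂≡0 : ∂∂≡0 α (r + β) summand
    summand-∂∂≡0 with β N.<? p | i N.≤? α
    ... | no β≮p | _ = ∂∂≡0ʳ α (r + β) summand (∂Y≡0 β≮p)
    ... | yes _ | no i≰α = ∂∂≡0ˡ α (r + β) summand (∂X≡0 i≰α)
    ... | yes β<p | yes i≤α = ∂∂≡0-shifted i≤α β<p

𝔟~-∂∂≡0 : ∀ μ r α β → α N.≤ β → β N.< r → ∂∂≡0 α (r + β) (𝔟~ μ r)
𝔟~-∂∂≡0 μ r α β α≤β β<r = ∂∂≡0-ΣPSL α (r + β) (upTo (suc r)) (λ i → c i • 𝔟~-summand.summand μ r i)
  (λ i → ∂∂≡0-• α (r + β) (c i) (𝔟~-summand.summand μ r i) (𝔟~-summand.summand-∂∂≡0 μ r i α β α≤β β<r))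
  where
  c : ℕ → ℚ
  c i = (((-ℚ 1ℚ) ^ℚ i) *ℚ ((Z.+ 1 / 2) ^ℚ i)) *ℚ inv! i

qdeg : ℕ → ℚ
qdeg v = [ v ≡ᵇ 0 ]

q∂q : ∀ {n} → PS n → PS n
q∂q = Euler qdeg

ΔXY : ∀ r → PS (suc (r + r)) → PS (suc (r + r))
ΔXY r = Δ r (λ t → 1 + t) (λ t → 1 + r + t)

-- Variables of a bimould series of depth r: q, then X₁ … X_r, then Y₁ … Y_r.
HeatEq : (r : ℕ) → PS (suc (r + r)) → Set
HeatEq r f = ∀ e → q∂q f e ≡ ΔXY r f e

-- Termwise: ∂_X ∂_Y e^{nX+mY} q^{mn} = mn · e^{nX+mY} q^{mn}, and q∂q multiplies q^{mn} by mn.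
Lm-heat : ∀ μ m (e : Vec ℕ 3) → ∂ 1 (∂ 2 (Lm μ m)) e ≡ q∂q (Lm μ m) e
Lm-heat μ m (a ∷ b ∷ c ∷ []) = begin
  sb *ℚ (sc *ℚ Σ≤ a (λ n → I n *ℚ T n (suc b) (suc c)))
    ≡⟨ cong (sb *ℚ_) (Σ-*ˡ sc (upTo (suc a)) (λ n → I n *ℚ T n (suc b) (suc c))) ⟨
  sb *ℚ Σ≤ a (λ n → sc *ℚ (I n *ℚ T n (suc b) (suc c)))
    ≡⟨ Σ-*ˡ sb (upTo (suc a)) (λ n → sc *ℚ (I n *ℚ T n (suc b) (suc c))) ⟨
  Σ≤ a (λ n → sb *ℚ (sc *ℚ (I n *ℚ T n (suc b) (suc c))))
    ≡⟨ Σ-cong (upTo (suc a)) term ⟩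
  Σ≤ a (λ n → D *ℚ (I n *ℚ T n b c))
    ≡⟨ Σ-*ˡ D (upTo (suc a)) (λ n → I n *ℚ T n b c) ⟩
  D *ℚ Σ≤ a (λ n → I n *ℚ T n b c) ∎
  where
  sb = ℕ→ℚ (suc b)
  sc = ℕ→ℚ (suc c)
  D = dotV qdeg (a ∷ b ∷ c ∷ [])
  I : ℕ → ℚ
  I n = [ (1 ≤ᵇ n) ∧ (m * n ≡ᵇ a) ]
  T : ℕ → ℕ → ℕ → ℚ
  T n b c = (ℕ→ℚ n ^ℚ b) *ℚ ((ℕ→ℚ m ^ℚ c) *ℚ (inv! b *ℚ inv! c))
  vanishˡ : ∀ x y z → x *ℚ (y *ℚ (0ℚ *ℚ z)) ≡ 0ℚ
  vanishˡ = solve-∀ ℚ-ring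
  vanishʳ : ∀ x z → x *ℚ (0ℚ *ℚ z) ≡ 0ℚ
  vanishʳ = solve-∀ ℚ-ring
  regroup : ∀ sb sc nb Nb mb Mc isb isc → sb *ℚ (sc *ℚ (1ℚ *ℚ ((nb *ℚ Nb) *ℚ ((mb *ℚ Mc) *ℚ (isb *ℚ isc)))))
                                       ≡ (mb *ℚ nb) *ℚ (Nb *ℚ (Mc *ℚ ((sb *ℚ isb) *ℚ (sc *ℚ isc))))
  regroup = solve-∀ ℚ-ring
  qdeg-a : ∀ A b c X → (1ℚ *ℚ A +ℚ (0ℚ *ℚ b +ℚ (0ℚ *ℚ c +ℚ 0ℚ))) *ℚ (1ℚ *ℚ X) ≡ A *ℚ X
  qdeg-a = solve-∀ ℚ-ring
  term : ∀ n → sb *ℚ (sc *ℚ (I n *ℚ T n (suc b) (suc c))) ≡ D *ℚ (I n *ℚ T n b c)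
  term n with (1 ≤ᵇ n) ∧ (m * n ≡ᵇ a) in eq
  ... | false = trans (vanishˡ sb sc (T n (suc b) (suc c))) (sym (vanishʳ D (T n b c)))
  ... | true = begin
    sb *ℚ (sc *ℚ (1ℚ *ℚ T n (suc b) (suc c)))
      ≡⟨ regroup sb sc (ℕ→ℚ n) (ℕ→ℚ n ^ℚ b) (ℕ→ℚ m) (ℕ→ℚ m ^ℚ c) (inv! (suc b)) (inv! (suc c)) ⟩
    (ℕ→ℚ m *ℚ ℕ→ℚ n) *ℚ ((ℕ→ℚ n ^ℚ b) *ℚ ((ℕ→ℚ m ^ℚ c) *ℚ ((sb *ℚ inv! (suc b)) *ℚ (sc *ℚ inv! (suc c)))))
      ≡⟨ cong₂ (λ z w → z *ℚ ((ℕ→ℚ n ^ℚ b) *ℚ ((ℕ→ℚ m ^ℚ c) *ℚ w)))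
               (trans (sym (ℕ→ℚ-* m n)) (cong ℕ→ℚ mn≡a))
               (cong₂ _*ℚ_ (*-inv!-suc b) (*-inv!-suc c)) ⟩
    ℕ→ℚ a *ℚ T n b c
      ≡⟨ qdeg-a (ℕ→ℚ a) (ℕ→ℚ b) (ℕ→ℚ c) (T n b c) ⟨
    D *ℚ (1ℚ *ℚ T n b c) ∎
    where
    mn≡a : m * n ≡ a
    mn≡a = ≡ᵇ-true⇒≡ (∧-true (1 ≤ᵇ n) eq)
      where
      ∧-true : ∀ x {y} → (x ∧ y) ≡ true → y ≡ true
      ∧-true true p = p

dotV-zero : ∀ {n} (a : Vec ℕ n) → dotV (λ _ → 0ℚ) a ≡ 0ℚ
dotV-zero [] = refl
dotV-zero (x ∷ a) = trans (cong (0ℚ *ℚ ℕ→ℚ x +ℚ_) (dotV-zero a))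
                          (trans (Q.+-identityʳ (0ℚ *ℚ ℕ→ℚ x)) (Q.*-zeroˡ (ℕ→ℚ x)))

q∂q-subst≡0 : ∀ {n} m (f : PS m) (L : ℕ → ℕ → ℚ) → (∀ a → L a 0 ≡ 0ℚ) → ∀ (e : Vec ℕ (suc n)) →
  q∂q (subst m f L) e ≡ 0ℚ
q∂q-subst≡0 m f L h e = trans (Euler-subst qdeg (λ _ → 0ℚ) m f L compatible e)
  (subst-zero m (Euler (λ _ → 0ℚ) f) L (λ a → trans (cong (_*ℚ f a) (dotV-zero a)) (Q.*-zeroˡ (f a))) e)
  where
  compatible : WeightCompatible (suc _) qdeg (λ _ → 0ℚ) L
  compatible a zero _ = trans (cong (_*ℚ 1ℚ) (h a)) (trans (Q.*-zeroˡ 1ℚ) (sym (trans (cong (_*ℚ 0ℚ) (h a)) (Q.*-zeroˡ 0ℚ))))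
  compatible a (suc t) _ = refl

HeatEq-ΣPSL : ∀ {A : Set} r (xs : List A) (F : A → PS (suc (r + r))) →
  AllL.All (λ x → HeatEq r (F x)) xs → HeatEq r (ΣPSL xs F)
HeatEq-ΣPSL r xs F hs e = begin
  q∂q (ΣPSL xs F) e                  ≡⟨ Σ-*ˡ (dotV qdeg e) xs (λ x → F x e) ⟨
  Σℚ (map (λ x → q∂q (F x) e) xs)    ≡⟨ Σ-cong-All xs (AllL.map (λ h → h e) hs) ⟩
  Σℚ (map (λ x → ΔXY r (F x) e) xs)  ≡⟨ Δ-ΣPSL r (λ t → 1 + t) (λ t → 1 + r + t) xs F e ⟨
  ΔXY r (ΣPSL xs F) e                ∎

HeatEq-Σ< : ∀ r k (F : ℕ → PS (suc (r + r))) → (∀ j → j N.< k → HeatEq r (F j)) → HeatEq r (ΣPS< k F)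
HeatEq-Σ< r k F hs = HeatEq-ΣPSL r (upTo k) F (AllLP.applyUpTo⁺₁ (λ j → j) k (λ {j} → hs j))

HeatEq-one : ∀ r → HeatEq r onePS
HeatEq-one r e = begin
  q∂q onePS e          ≡⟨ Homogeneous-one qdeg e ⟩
  0ℚ *ℚ onePS e        ≡⟨ Q.*-zeroˡ (onePS e) ⟩
  0ℚ                   ≡⟨ Σ<-zero r _ (λ t _ → zero⇒∂≡0 (1 + t) (∂ (1 + r + t) onePS) (∂-one (1 + r + t)) e) ⟨
  ΔXY r onePS e        ∎

HeatEq-· : ∀ r (f g : PS (suc (r + r))) → HeatEq r f → HeatEq r g →
  (∀ t → t N.< r → ∂≡0 (1 + t) f ⊎ ∂≡0 (1 + r + t) g) →
  (∀ t → t N.< r → ∂≡0 (1 + r + t) f ⊎ ∂≡0 (1 + t) g) →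
  HeatEq r (f · g)
HeatEq-· r f g hf hg sepXY sepYX e = begin
  q∂q (f · g) e                                              ≡⟨ Euler-· qdeg f g e ⟩
  (q∂q f · g) e +ℚ (f · q∂q g) e
    ≡⟨ cong₂ _+ℚ_ (·-congˡ {f = q∂q f} {ΔXY r f} g hf e) (·-congʳ f {q∂q g} {ΔXY r g} hg e) ⟩
  (ΔXY r f · g) e +ℚ (f · ΔXY r g) e                         ≡⟨ Q.+-identityʳ _ ⟨
  ((ΔXY r f · g) e +ℚ (f · ΔXY r g) e) +ℚ 0ℚ
    ≡⟨ cong (((ΔXY r f · g) e +ℚ (f · ΔXY r g) e) +ℚ_)
            (cong₂ _+ℚ_ (cross≡0 r X Y f g sepXY e) (cross≡0 r Y X f g sepYX e)) ⟨
  ((ΔXY r f · g) e +ℚ (f · ΔXY r g) e) +ℚ (cross r X Y f g e +ℚ cross r Y X f g e)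
    ≡⟨ Δ-· r X Y f g e ⟨
  ΔXY r (f · g) e                                            ∎
  where
  X Y : ℕ → ℕ
  X t = 1 + t
  Y t = 1 + r + t

-- The j-th summand of 𝔏_m is 𝔟[X₁ − X_j, … | Y₁, …] · L_m[X_j | Y₁ + … + Y_s] · 𝔟~[X_s − X_j, … | Y_s, …].
-- Its outer factors see the X's only through differences X_a − X_j, so Σ_t ∂_{X_t} annihilates
-- them; this makes the cross terms of Δ cancel, and only ∂_{X_j} ∂_Y L_m = q∂q L_m survives.
module 𝔏-summand (μ : Mould) (m s j : ℕ) where

  X Y : ℕ → ℕ
  X t = 1 + t
  Y t = 1 + s + t

  p : ℕ
  p = s ∸ suc j

  Lpre : ℕ → ℕ → ℚ
  Lpre a v = if a <ᵇ j then [ v ≡ᵇ 1 + a ] -ℚ [ v ≡ᵇ 1 + j ]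
           else [ v ≡ᵇ 1 + s + (a ∸ j) ]
  Lmid : ℕ → ℕ → ℚ
  Lmid a v = if a ≡ᵇ 0 then [ v ≡ᵇ 0 ]
           else if a ≡ᵇ 1 then [ v ≡ᵇ 1 + j ]
           else [ (1 + s ≤ᵇ v) ∧ (v <ᵇ 1 + s + s) ]
  Lpost : ℕ → ℕ → ℚ
  Lpost a v = if a <ᵇ (s ∸ suc j)
           then [ v ≡ᵇ 1 + (s ∸ suc a) ] -ℚ [ v ≡ᵇ 1 + j ]
           else [ v ≡ᵇ 1 + s + (s ∸ suc (a ∸ (s ∸ suc j))) ]

  pre : PS (suc (s + s))
  pre = subst (j + j) (𝔟 μ j) Lpre
  mid : PS (suc (s + s))
  mid = subst 3 (Lm μ m) Lmid
  post : PS (suc (s + s))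
  post = subst (p + p) (𝔟~ μ p) Lpost

  term : PS (suc (s + s))
  term = (pre · mid) · post

  Xn : ∀ t → t N.< s → X t N.< suc (s + s)
  Xn t t<s = N.s≤s (NP.≤-trans t<s (NP.m≤m+n s s))
  Yn : ∀ t → t N.< s → Y t N.< suc (s + s)
  Yn t t<s = N.s≤s (NP.+-monoʳ-< s t<s)

  Lpre-< : ∀ a v → a N.< j → Lpre a v ≡ [ v ≡ᵇ 1 + a ] -ℚ [ v ≡ᵇ 1 + j ]
  Lpre-< a v a<j = if-true (<ᵇ-true a<j)
  Lpre-≥ : ∀ a v → ¬ a N.< j → Lpre a v ≡ [ v ≡ᵇ 1 + s + (a ∸ j) ]
  Lpre-≥ a v a≮j = if-false (<ᵇ-false a≮j)
  Lpost-< : ∀ a v → a N.< p → Lpost a v ≡ [ v ≡ᵇ 1 + (s ∸ suc a) ] -ℚ [ v ≡ᵇ 1 + j ]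
  Lpost-< a v a<p = if-true (<ᵇ-true a<p)
  Lpost-≥ : ∀ a v → ¬ a N.< p → Lpost a v ≡ [ v ≡ᵇ 1 + s + (s ∸ suc (a ∸ p)) ]
  Lpost-≥ a v a≮p = if-false (<ᵇ-false a≮p)

  mid-∂Y mid-∂X∂Y : PS (suc (s + s))
  mid-∂Y = subst 3 (∂ 2 (Lm μ m)) Lmid
  mid-∂X∂Y = subst 3 (∂ 1 (∂ 2 (Lm μ m))) Lmid

  q∂q-pre : ∀ e → q∂q pre e ≡ 0ℚ
  q∂q-pre = q∂q-subst≡0 (j + j) (𝔟 μ j) Lpre (λ a → if-same (a <ᵇ j) 0ℚ)

  q∂q-post : ∀ e → q∂q post e ≡ 0ℚ
  q∂q-post = q∂q-subst≡0 (p + p) (𝔟~ μ p) Lpost (λ a → if-same (a <ᵇ p) 0ℚ)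

  q∂q-mid : ∀ e → q∂q mid e ≡ mid-∂X∂Y e
  q∂q-mid e = trans (Euler-subst qdeg qdeg 3 (Lm μ m) Lmid compatible e)
    (Σ-cong (ofDeg 3 (sumV e)) (λ a → cong (_*ℚ monoL a Lmid e) (sym (Lm-heat μ m a))))
    where
    compatible : WeightCompatible (suc (s + s)) qdeg qdeg Lmid
    compatible zero zero _ = refl
    compatible zero (suc t) _ = refl
    compatible (suc zero) zero _ = refl
    compatible (suc zero) (suc t) _ = refl
    compatible (suc (suc a)) zero _ = refl
    compatible (suc (suc a)) (suc t) _ = refl

  q∂q-term : ∀ e → q∂q term e ≡ ((pre · mid-∂X∂Y) · post) e
  q∂q-term e = begin
    q∂q term e                                                   ≡⟨ Euler-· qdeg (pre · mid) post e ⟩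
    (q∂q (pre · mid) · post) e +ℚ ((pre · mid) · q∂q post) e
      ≡⟨ cong₂ _+ℚ_ (·-congˡ {f = q∂q (pre · mid)} {pre · mid-∂X∂Y} post q∂q-pre·mid e)
                    (·-zeroʳ (pre · mid) {q∂q post} q∂q-post e) ⟩
    ((pre · mid-∂X∂Y) · post) e +ℚ 0ℚ                            ≡⟨ Q.+-identityʳ _ ⟩
    ((pre · mid-∂X∂Y) · post) e                                  ∎
    where
    q∂q-pre·mid : ∀ e′ → q∂q (pre · mid) e′ ≡ (pre · mid-∂X∂Y) e′
    q∂q-pre·mid e′ = trans (Euler-· qdeg pre mid e′)
      (trans (cong₂ _+ℚ_ (·-zeroˡ {f = q∂q pre} mid q∂q-pre e′) (·-congʳ pre {q∂q mid} {mid-∂X∂Y} q∂q-mid e′))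
             (Q.+-identityˡ _))

  module _ (j<s : j N.< s) where

    s>0 : 0 N.< s
    s>0 = NP.≤-<-trans N.z≤n j<s

    Lmid-Y : ∀ t → t N.< s → ∀ a → a N.< 3 → Lmid a (Y t) ≡ [ a ≡ᵇ 2 ]
    Lmid-Y t t<s zero _ = refl
    Lmid-Y t t<s (suc zero) _ = []≡0 (≡ᵇ-false (λ q → NP.<⇒≱ j<s (≡.subst (s N.≤_) (NP.suc-injective q) (NP.m≤m+n s t))))
    Lmid-Y t t<s (suc (suc zero)) _ = cong [_] (cong₂ _∧_ (≤ᵇ-true (N.s≤s (NP.m≤m+n s t))) (<ᵇ-true (N.s≤s (NP.+-monoʳ-< s t<s))))
    Lmid-Y t t<s (suc (suc (suc a))) (N.s≤s (N.s≤s (N.s≤s ())))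

    ∂Y-mid : ∀ t → t N.< s → ∀ e → ∂ (Y t) mid e ≡ subst 3 (∂ 2 (Lm μ m)) Lmid e
    ∂Y-mid t t<s = ∂-subst-δ (Y t) (Yn t t<s) 3 2 (N.s≤s (N.s≤s (N.s≤s N.z≤n))) (Lm μ m) Lmid (Lmid-Y t t<s)

    ∂X≡0-mid : ∀ t → t N.< s → ¬ t ≡ j → ∀ (f : PS 3) → ∂≡0 {suc (s + s)} (X t) (subst 3 f Lmid)
    ∂X≡0-mid t t<s t≢j f = ∂≡0-subst (X t) 3 f Lmid Lmid-X≡0
      where
      Lmid-X≡0 : ∀ a → a N.< 3 → Lmid a (X t) ≡ 0ℚ
      Lmid-X≡0 zero _ = refl
      Lmid-X≡0 (suc zero) _ = []≡0 (≡ᵇ-false (λ q → t≢j (NP.suc-injective q)))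
      Lmid-X≡0 (suc (suc zero)) _ = cong [_] (cong (_∧ (suc t <ᵇ 1 + s + s)) (≤ᵇ-false (λ q → NP.<⇒≱ t<s (NP.≤-pred q))))
      Lmid-X≡0 (suc (suc (suc a))) (N.s≤s (N.s≤s (N.s≤s ())))

    ∂X-mid : ∀ (f : PS 3) e → ∂ (X j) (subst 3 f Lmid) e ≡ subst 3 (∂ 1 f) Lmid e
    ∂X-mid f = ∂-subst-δ (X j) (Xn j j<s) 3 1 (N.s≤s (N.s≤s N.z≤n)) f Lmid Lmid-Xj
      where
      Lmid-Xj : ∀ a → a N.< 3 → Lmid a (X j) ≡ [ a ≡ᵇ 1 ]
      Lmid-Xj zero _ = refl
      Lmid-Xj (suc zero) _ = []≡1 (≡ᵇ-true {suc j} refl)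
      Lmid-Xj (suc (suc zero)) _ = cong [_] (cong (_∧ (suc j <ᵇ 1 + s + s)) (≤ᵇ-false (λ q → NP.<⇒≱ j<s (NP.≤-pred q))))
      Lmid-Xj (suc (suc (suc a))) (N.s≤s (N.s≤s (N.s≤s ())))

    Δ-mid : ∀ e → Δ s X Y mid e ≡ subst 3 (∂ 1 (∂ 2 (Lm μ m))) Lmid e
    Δ-mid e = trans (Σ<-cong s {λ t → ∂ (X t) (∂ (Y t) mid) e} {λ t → ∂ (X t) (subst 3 (∂ 2 (Lm μ m)) Lmid) e}
                     (λ t t<s → ∂-cong (X t) {∂ (Y t) mid} {subst 3 (∂ 2 (Lm μ m)) Lmid} (∂Y-mid t t<s) e))
            (trans (Σ<-pick s j (λ t → ∂ (X t) (subst 3 (∂ 2 (Lm μ m)) Lmid) e) j<s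
                      (λ t t<s t≢j → ∂X≡0-mid t t<s t≢j (∂ 2 (Lm μ m)) e))
                   (∂X-mid (∂ 2 (Lm μ m)) e))

    ∂X≡0-pre : ∀ t → j N.< t → t N.< s → ∂≡0 (X t) pre
    ∂X≡0-pre t j<t t<s = ∂≡0-subst (X t) (j + j) (𝔟 μ j) Lpre Lpre-X≡0
      where
      Lpre-X≡0 : ∀ a → a N.< j + j → Lpre a (X t) ≡ 0ℚ
      Lpre-X≡0 a _ with a N.<? j
      ... | yes a<j = trans (Lpre-< a (X t) a<j) (cong₂ _-ℚ_
              ([]≡0 (≡ᵇ-false {X t} {1 + a} (λ q → NP.<-irrefl refl (NP.<-trans a<j (≡.subst (j N.<_) (NP.suc-injective q) j<t)))))
              ([]≡0 (≡ᵇ-false {X t} {1 + j} (λ q → NP.<-irrefl (sym (NP.suc-injective q)) j<t))))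
      ... | no a≮j = trans (Lpre-≥ a (X t) a≮j) ([]≡0 (≡ᵇ-false {X t} {1 + s + (a ∸ j)} (λ q → NP.<⇒≱ t<s (≡.subst (s N.≤_) (sym (NP.suc-injective q)) (NP.m≤m+n s (a ∸ j))))))

    a∸j<j : ∀ a → a N.< j + j → ¬ a N.< j → a ∸ j N.< j
    a∸j<j a a< a≮j = ≡.subst (a ∸ j N.<_) (NP.m+n∸m≡n j j) (NP.∸-monoˡ-< a< (NP.≮⇒≥ a≮j))

    ∂Y≡0-pre : ∀ t → j N.≤ t → ∂≡0 (Y t) pre
    ∂Y≡0-pre t j≤t = ∂≡0-subst (Y t) (j + j) (𝔟 μ j) Lpre Lpre-Y≡0
      where
      Lpre-Y≡0 : ∀ a → a N.< j + j → Lpre a (Y t) ≡ 0ℚ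
      Lpre-Y≡0 a a< with a N.<? j
      ... | yes a<j = trans (Lpre-< a (Y t) a<j) (cong₂ _-ℚ_
              ([]≡0 (≡ᵇ-false {Y t} {1 + a} (λ q → NP.<⇒≱ (NP.<-trans a<j j<s) (≡.subst (s N.≤_) (NP.suc-injective q) (NP.m≤m+n s t)))))
              ([]≡0 (≡ᵇ-false {Y t} {1 + j} (λ q → NP.<⇒≱ j<s (≡.subst (s N.≤_) (NP.suc-injective q) (NP.m≤m+n s t))))))
      ... | no a≮j = trans (Lpre-≥ a (Y t) a≮j) ([]≡0 (≡ᵇ-false {Y t} {1 + s + (a ∸ j)} (λ q → NP.<-irrefl refl
              (NP.<-≤-trans (a∸j<j a a< a≮j) (≡.subst (j N.≤_) (NP.+-cancelˡ-≡ s t (a ∸ j) (NP.suc-injective q)) j≤t)))))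

    ∂Y-pre : ∀ t → t N.< j → ∀ e → ∂ (Y t) pre e ≡ subst (j + j) (∂ (j + t) (𝔟 μ j)) Lpre e
    ∂Y-pre t t<j = ∂-subst-δ (Y t) (Yn t (NP.<-trans t<j j<s)) (j + j) (j + t) (NP.+-monoʳ-< j t<j) (𝔟 μ j) Lpre Lpre-Y
      where
      Lpre-Y : ∀ a → a N.< j + j → Lpre a (Y t) ≡ [ a ≡ᵇ j + t ]
      Lpre-Y a a< with a N.<? j
      ... | yes a<j = trans (Lpre-< a (Y t) a<j) (trans (cong₂ _-ℚ_
              ([]≡0 (≡ᵇ-false {Y t} {1 + a} (λ q → NP.<⇒≱ (NP.<-trans a<j j<s) (≡.subst (s N.≤_) (NP.suc-injective q) (NP.m≤m+n s t)))))
              ([]≡0 (≡ᵇ-false {Y t} {1 + j} (λ q → NP.<⇒≱ j<s (≡.subst (s N.≤_) (NP.suc-injective q) (NP.m≤m+n s t))))))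
              (sym ([]≡0 (≡ᵇ-false {a} {j + t} (λ q → NP.<⇒≱ a<j (≡.subst (j N.≤_) (sym q) (NP.m≤m+n j t)))))))
      ... | no a≮j = trans (Lpre-≥ a (Y t) a≮j) (cong [_] (≡ᵇ-cong {Y t} {1 + s + (a ∸ j)} {a} {j + t}
              (λ q → trans (sym (NP.m+[n∸m]≡n (NP.≮⇒≥ a≮j))) (cong (j +_) (sym (NP.+-cancelˡ-≡ s t (a ∸ j) (NP.suc-injective q)))))
              (λ q → cong (λ n → suc (s + n)) (trans (sym (NP.m+n∸m≡n j t)) (cong (_∸ j) (sym q))))))

    ∂X-pre : ∀ t → t N.< j → ∀ (f : PS (j + j)) e → ∂ (X t) (subst (j + j) f Lpre) e ≡ subst (j + j) (∂ t f) Lpre e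
    ∂X-pre t t<j f = ∂-subst-δ (X t) (Xn t (NP.<-trans t<j j<s)) (j + j) t (NP.<-≤-trans t<j (NP.m≤m+n j j)) f Lpre Lpre-X
      where
      Lpre-X : ∀ a → a N.< j + j → Lpre a (X t) ≡ [ a ≡ᵇ t ]
      Lpre-X a a< with a N.<? j
      ... | yes a<j = trans (Lpre-< a (X t) a<j) (trans (cong₂ _-ℚ_
              (cong [_] (≡ᵇ-cong {X t} {1 + a} {a} {t} (λ q → sym (NP.suc-injective q)) (λ q → cong suc (sym q))))
              ([]≡0 (≡ᵇ-false {X t} {1 + j} (λ q → NP.<-irrefl (NP.suc-injective q) t<j))))
              (Q.+-identityʳ [ a ≡ᵇ t ]))
      ... | no a≮j = trans (Lpre-≥ a (X t) a≮j) (trans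
              ([]≡0 (≡ᵇ-false {X t} {1 + s + (a ∸ j)} (λ q → NP.<⇒≱ (NP.<-trans t<j j<s) (≡.subst (s N.≤_) (sym (NP.suc-injective q)) (NP.m≤m+n s (a ∸ j))))))
              (sym ([]≡0 (≡ᵇ-false {a} {t} (λ q → a≮j (≡.subst (N._< j) (sym q) t<j))))))

    Δ-pre : ∀ e → Δ s X Y pre e ≡ 0ℚ
    Δ-pre e = Σ<-zero s (λ t → ∂ (X t) (∂ (Y t) pre) e) ∂X∂Y≡0
      where
      ∂X∂Y≡0 : ∀ t → t N.< s → ∂ (X t) (∂ (Y t) pre) e ≡ 0ℚ
      ∂X∂Y≡0 t t<s with t N.<? j
      ... | yes t<j = trans (∂-cong (X t) {∂ (Y t) pre} {subst (j + j) (∂ (j + t) (𝔟 μ j)) Lpre} (∂Y-pre t t<j) e)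
            (trans (∂X-pre t t<j (∂ (j + t) (𝔟 μ j)) e)
                   (subst-zero (j + j) (∂ t (∂ (j + t) (𝔟 μ j))) Lpre (𝔟-∂∂≡0 μ j t t NP.≤-refl t<j) e))
      ... | no t≮j = zero⇒∂≡0 (X t) (∂ (Y t) pre) (∂Y≡0-pre t (NP.≮⇒≥ t≮j)) e

    Σ∂X-pre : ∀ e → Σ< s (λ t → ∂ (X t) pre e) ≡ 0ℚ
    Σ∂X-pre e = trans (Σ∂-subst s X Xn (j + j) (𝔟 μ j) Lpre e)
      (Σ<-zero (j + j) (λ a → Σ< s (λ t → Lpre a (X t)) *ℚ subst (j + j) (∂ a (𝔟 μ j)) Lpre e)
        (λ a a< → trans (cong (_*ℚ subst (j + j) (∂ a (𝔟 μ j)) Lpre e) (ΣLpre-X a a<)) (Q.*-zeroˡ (subst (j + j) (∂ a (𝔟 μ j)) Lpre e))))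
      where
      ΣLpre-X : ∀ a → a N.< j + j → Σ< s (λ t → Lpre a (X t)) ≡ 0ℚ
      ΣLpre-X a a< with a N.<? j
      ... | yes a<j = trans (Σ-cong (upTo s) (λ t → Lpre-< a (X t) a<j)) (Σ<-δ-δ s a j (NP.<-trans a<j j<s) j<s)
      ... | no a≮j = Σ<-zero s (λ t → Lpre a (X t)) (λ t t<s → trans (Lpre-≥ a (X t) a≮j)
              ([]≡0 (≡ᵇ-false {X t} {1 + s + (a ∸ j)} (λ q → NP.<⇒≱ t<s (≡.subst (s N.≤_) (sym (NP.suc-injective q)) (NP.m≤m+n s (a ∸ j)))))))

    p≤s : p N.≤ s
    p≤s = NP.m∸n≤m s (suc j)

    a∸p<p : ∀ a → a N.< p + p → ¬ a N.< p → a ∸ p N.< p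
    a∸p<p a a< a≮p = ≡.subst (a ∸ p N.<_) (NP.m+n∸m≡n p p) (NP.∸-monoˡ-< a< (NP.≮⇒≥ a≮p))

    Lpost-Y-< : ∀ t a → a N.< p → Lpost a (Y t) ≡ 0ℚ
    Lpost-Y-< t a a<p = trans (Lpost-< a (Y t) a<p) (cong₂ _-ℚ_
       ([]≡0 (≡ᵇ-false {Y t} {1 + (s ∸ suc a)} (λ q → NP.<⇒≱ (∸-suc< s a s>0) (≡.subst (s N.≤_) (NP.suc-injective q) (NP.m≤m+n s t)))))
       ([]≡0 (≡ᵇ-false {Y t} {1 + j} (λ q → NP.<⇒≱ j<s (≡.subst (s N.≤_) (NP.suc-injective q) (NP.m≤m+n s t))))))

    Lpost-X-≥ : ∀ t a → t N.< s → ¬ a N.< p → Lpost a (X t) ≡ 0ℚ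
    Lpost-X-≥ t a t<s a≮p = trans (Lpost-≥ a (X t) a≮p)
       ([]≡0 (≡ᵇ-false {X t} {1 + s + (s ∸ suc (a ∸ p))} (λ q → NP.<⇒≱ t<s (≡.subst (s N.≤_) (sym (NP.suc-injective q)) (NP.m≤m+n s _)))))

    ∂X≡0-post : ∀ t → t N.< j → ∂≡0 (X t) post
    ∂X≡0-post t t<j = ∂≡0-subst (X t) (p + p) (𝔟~ μ p) Lpost Lpost-X≡0
      where
      Lpost-X≡0 : ∀ a → a N.< p + p → Lpost a (X t) ≡ 0ℚ
      Lpost-X≡0 a a< with a N.<? p
      ... | yes a<p = trans (Lpost-< a (X t) a<p) (cong₂ _-ℚ_
              ([]≡0 (≡ᵇ-false {X t} {1 + (s ∸ suc a)} (λ q → NP.<-irrefl refl (NP.<-trans t<j (≡.subst (j N.<_) (sym (NP.suc-injective q)) (<∸-suc-flip a s j j<s a<p))))))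
              ([]≡0 (≡ᵇ-false {X t} {1 + j} (λ q → NP.<-irrefl (NP.suc-injective q) t<j))))
      ... | no a≮p = Lpost-X-≥ t a (NP.<-trans t<j j<s) a≮p

    ∂Y≡0-post : ∀ t → t N.≤ j → ∂≡0 (Y t) post
    ∂Y≡0-post t t≤j = ∂≡0-subst (Y t) (p + p) (𝔟~ μ p) Lpost Lpost-Y≡0
      where
      Lpost-Y≡0 : ∀ a → a N.< p + p → Lpost a (Y t) ≡ 0ℚ
      Lpost-Y≡0 a a< with a N.<? p
      ... | yes a<p = Lpost-Y-< t a a<p
      ... | no a≮p = trans (Lpost-≥ a (Y t) a≮p) ([]≡0 (≡ᵇ-false {Y t} {1 + s + (s ∸ suc (a ∸ p))} (λ q → NP.<-irrefl refl
              (NP.<-≤-trans (<∸-suc-flip (a ∸ p) s j j<s (a∸p<p a a< a≮p))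
                 (≡.subst (N._≤ j) (NP.+-cancelˡ-≡ s t _ (NP.suc-injective q)) t≤j)))))

    s∸suc-t<p : ∀ t → j N.< t → t N.< s → s ∸ suc t N.< p
    s∸suc-t<p t j<t t<s = NP.∸-monoʳ-< (N.s≤s j<t) t<s

    ∂Y-post : ∀ t → j N.< t → t N.< s → ∀ e → ∂ (Y t) post e ≡ subst (p + p) (∂ (p + (s ∸ suc t)) (𝔟~ μ p)) Lpost e
    ∂Y-post t j<t t<s = ∂-subst-δ (Y t) (Yn t t<s) (p + p) (p + (s ∸ suc t)) (NP.+-monoʳ-< p (s∸suc-t<p t j<t t<s)) (𝔟~ μ p) Lpost Lpost-Y
      where
      Lpost-Y : ∀ a → a N.< p + p → Lpost a (Y t) ≡ [ a ≡ᵇ p + (s ∸ suc t) ]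
      Lpost-Y a a< with a N.<? p
      ... | yes a<p = trans (Lpost-Y-< t a a<p) (sym ([]≡0 (≡ᵇ-false {a} {p + (s ∸ suc t)} (λ q → NP.<⇒≱ a<p (≡.subst (p N.≤_) (sym q) (NP.m≤m+n p _))))))
      ... | no a≮p = trans (Lpost-≥ a (Y t) a≮p) (cong [_] (≡ᵇ-cong {Y t} {1 + s + (s ∸ suc (a ∸ p))} {a} {p + (s ∸ suc t)}
              (λ q → trans (sym (NP.m+[n∸m]≡n (NP.≮⇒≥ a≮p))) (cong (p +_) (∸-suc-flip t s (a ∸ p) (NP.<-≤-trans (a∸p<p a a< a≮p) p≤s) (NP.+-cancelˡ-≡ s t _ (NP.suc-injective q)))))
              (λ q → cong (λ n → suc (s + n)) (∸-suc-flip (a ∸ p) s t t<s (trans (cong (_∸ p) q) (NP.m+n∸m≡n p (s ∸ suc t)))))))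

    ∂X-post : ∀ t → j N.< t → t N.< s → ∀ (f : PS (p + p)) e → ∂ (X t) (subst (p + p) f Lpost) e ≡ subst (p + p) (∂ (s ∸ suc t) f) Lpost e
    ∂X-post t j<t t<s f = ∂-subst-δ (X t) (Xn t t<s) (p + p) (s ∸ suc t) (NP.<-≤-trans (s∸suc-t<p t j<t t<s) (NP.m≤m+n p p)) f Lpost Lpost-X
      where
      Lpost-X : ∀ a → a N.< p + p → Lpost a (X t) ≡ [ a ≡ᵇ s ∸ suc t ]
      Lpost-X a a< with a N.<? p
      ... | yes a<p = trans (Lpost-< a (X t) a<p) (trans (cong₂ _-ℚ_
              (cong [_] (≡ᵇ-cong {X t} {1 + (s ∸ suc a)} {a} {s ∸ suc t}
                 (λ q → ∸-suc-flip t s a (NP.<-≤-trans a<p p≤s) (NP.suc-injective q))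
                 (λ q → cong suc (∸-suc-flip a s t t<s q))))
              ([]≡0 (≡ᵇ-false {X t} {1 + j} (λ q → NP.<-irrefl (sym (NP.suc-injective q)) j<t))))
              (Q.+-identityʳ [ a ≡ᵇ s ∸ suc t ]))
      ... | no a≮p = trans (Lpost-X-≥ t a t<s a≮p) (sym ([]≡0 (≡ᵇ-false {a} {s ∸ suc t} (λ q → a≮p (≡.subst (N._< p) (sym q) (s∸suc-t<p t j<t t<s))))))

    Δ-post : ∀ e → Δ s X Y post e ≡ 0ℚ
    Δ-post e = Σ<-zero s (λ t → ∂ (X t) (∂ (Y t) post) e) ∂X∂Y≡0
      where
      ∂X∂Y≡0 : ∀ t → t N.< s → ∂ (X t) (∂ (Y t) post) e ≡ 0ℚ
      ∂X∂Y≡0 t t<s with j N.<? t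
      ... | yes j<t = trans (∂-cong (X t) {∂ (Y t) post} {subst (p + p) (∂ (p + (s ∸ suc t)) (𝔟~ μ p)) Lpost} (∂Y-post t j<t t<s) e)
            (trans (∂X-post t j<t t<s (∂ (p + (s ∸ suc t)) (𝔟~ μ p)) e)
                   (subst-zero (p + p) (∂ (s ∸ suc t) (∂ (p + (s ∸ suc t)) (𝔟~ μ p))) Lpost
                       (𝔟~-∂∂≡0 μ p (s ∸ suc t) (s ∸ suc t) NP.≤-refl (s∸suc-t<p t j<t t<s)) e))
      ... | no j≮t = zero⇒∂≡0 (X t) (∂ (Y t) post) (∂Y≡0-post t (NP.≮⇒≥ j≮t)) e

    Σ∂X-post : ∀ e → Σ< s (λ t → ∂ (X t) post e) ≡ 0ℚ
    Σ∂X-post e = trans (Σ∂-subst s X Xn (p + p) (𝔟~ μ p) Lpost e)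
      (Σ<-zero (p + p) (λ a → Σ< s (λ t → Lpost a (X t)) *ℚ subst (p + p) (∂ a (𝔟~ μ p)) Lpost e)
        (λ a a< → trans (cong (_*ℚ subst (p + p) (∂ a (𝔟~ μ p)) Lpost e) (ΣLpost-X a a<)) (Q.*-zeroˡ (subst (p + p) (∂ a (𝔟~ μ p)) Lpost e))))
      where
      ΣLpost-X : ∀ a → a N.< p + p → Σ< s (λ t → Lpost a (X t)) ≡ 0ℚ
      ΣLpost-X a a< with a N.<? p
      ... | yes a<p = trans (Σ-cong (upTo s) (λ t → Lpost-< a (X t) a<p)) (Σ<-δ-δ s (s ∸ suc a) j (∸-suc< s a s>0) j<s)
      ... | no a≮p = Σ<-zero s (λ t → Lpost a (X t)) (λ t t<s → Lpost-X-≥ t a t<s a≮p)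

    crossXY-pre-mid : ∀ e → cross s X Y pre mid e ≡ 0ℚ
    crossXY-pre-mid e = begin
      Σ< s (λ t → (∂ (X t) pre · ∂ (Y t) mid) e)
        ≡⟨ Σ<-cong s {λ t → (∂ (X t) pre · ∂ (Y t) mid) e} {λ t → (∂ (X t) pre · mid-∂Y) e}
             (λ t t<s → ·-congʳ (∂ (X t) pre) {∂ (Y t) mid} {mid-∂Y} (∂Y-mid t t<s) e) ⟩
      Σ< s (λ t → (∂ (X t) pre · mid-∂Y) e)
        ≡⟨ sym (·-ΣPSLˡ (upTo s) (λ t → ∂ (X t) pre) mid-∂Y e) ⟩
      (ΣPSL (upTo s) (λ t → ∂ (X t) pre) · mid-∂Y) e
        ≡⟨ ·-zeroˡ {f = ΣPSL (upTo s) (λ t → ∂ (X t) pre)} mid-∂Y Σ∂X-pre e ⟩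
      0ℚ ∎

    crossYX-pre-mid : ∀ e → cross s Y X pre mid e ≡ 0ℚ
    crossYX-pre-mid = cross≡0 s Y X pre mid separate
      where
      separate : ∀ t → t N.< s → ∂≡0 (Y t) pre ⊎ ∂≡0 (X t) mid
      separate t t<s with t N.<? j
      ... | yes t<j = inj₂ (∂X≡0-mid t t<s (λ q → NP.<-irrefl q t<j) (Lm μ m))
      ... | no t≮j = inj₁ (∂Y≡0-pre t (NP.≮⇒≥ t≮j))

    crossXY-premid-post : ∀ e → cross s X Y (pre · mid) post e ≡ 0ℚ
    crossXY-premid-post = cross≡0 s X Y (pre · mid) post separate
      where
      separate : ∀ t → t N.< s → ∂≡0 (X t) (pre · mid) ⊎ ∂≡0 (Y t) post
      separate t t<s with j N.<? t
      ... | yes j<t = inj₁ (∂≡0-· (X t) pre mid (∂X≡0-pre t j<t t<s) (∂X≡0-mid t t<s (λ q → NP.<-irrefl (sym q) j<t) (Lm μ m)))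
      ... | no j≮t = inj₂ (∂Y≡0-post t (NP.≮⇒≥ j≮t))

    crossYX-premid-post : ∀ e → cross s Y X (pre · mid) post e ≡ 0ℚ
    crossYX-premid-post e = begin
      Σ< s (λ t → (∂ (Y t) (pre · mid) · ∂ (X t) post) e)
        ≡⟨ Σ<-cong s {λ t → (∂ (Y t) (pre · mid) · ∂ (X t) post) e} {λ t → P1 t +ℚ P2 t} split ⟩
      Σ< s (λ t → P1 t +ℚ P2 t)
        ≡⟨ Σ-+ (upTo s) P1 P2 ⟩
      Σ< s P1 +ℚ Σ< s P2
        ≡⟨ cong₂ _+ℚ_ (Σ<-zero s P1 P1≡0) ΣP2≡0 ⟩
      0ℚ +ℚ 0ℚ ≡⟨ refl ⟩
      0ℚ ∎
      where
      P1 P2 : ℕ → ℚ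
      P1 t = ((∂ (Y t) pre · mid) · ∂ (X t) post) e
      P2 t = ((pre · ∂ (Y t) mid) · ∂ (X t) post) e
      split : ∀ t → t N.< s → (∂ (Y t) (pre · mid) · ∂ (X t) post) e ≡ P1 t +ℚ P2 t
      split t _ = trans (·-congˡ {f = ∂ (Y t) (pre · mid)} {λ e′ → (∂ (Y t) pre · mid) e′ +ℚ (pre · ∂ (Y t) mid) e′} (∂ (X t) post) (∂-· (Y t) pre mid) e)
                        (·-+ˡ (∂ (Y t) pre · mid) (pre · ∂ (Y t) mid) (∂ (X t) post) e)
      P1≡0 : ∀ t → t N.< s → P1 t ≡ 0ℚ
      P1≡0 t t<s with t N.<? j
      ... | yes t<j = ·-zeroʳ (∂ (Y t) pre · mid) {∂ (X t) post} (∂X≡0-post t t<j) e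
      ... | no t≮j = ·-zeroˡ {f = ∂ (Y t) pre · mid} (∂ (X t) post) (·-zeroˡ {f = ∂ (Y t) pre} mid (∂Y≡0-pre t (NP.≮⇒≥ t≮j))) e
      ΣP2≡0 : Σ< s P2 ≡ 0ℚ
      ΣP2≡0 = begin
        Σ< s P2
          ≡⟨ Σ<-cong s {P2} {λ t → ((pre · mid-∂Y) · ∂ (X t) post) e}
               (λ t t<s → ·-congˡ {f = pre · ∂ (Y t) mid} {pre · mid-∂Y} (∂ (X t) post) (·-congʳ pre {∂ (Y t) mid} {mid-∂Y} (∂Y-mid t t<s)) e) ⟩
        Σ< s (λ t → ((pre · mid-∂Y) · ∂ (X t) post) e)
          ≡⟨ sym (·-ΣPSLʳ (upTo s) (pre · mid-∂Y) (λ t → ∂ (X t) post) e) ⟩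
        ((pre · mid-∂Y) · ΣPSL (upTo s) (λ t → ∂ (X t) post)) e
          ≡⟨ ·-zeroʳ (pre · mid-∂Y) {ΣPSL (upTo s) (λ t → ∂ (X t) post)} Σ∂X-post e ⟩
        0ℚ ∎

    Δ-pre·mid : ∀ e → Δ s X Y (pre · mid) e ≡ (pre · mid-∂X∂Y) e
    Δ-pre·mid e = begin
      Δ s X Y (pre · mid) e ≡⟨ Δ-· s X Y pre mid e ⟩
      ((Δ s X Y pre · mid) e +ℚ (pre · Δ s X Y mid) e) +ℚ (cross s X Y pre mid e +ℚ cross s Y X pre mid e)
        ≡⟨ cong₂ _+ℚ_ (cong₂ _+ℚ_ (·-zeroˡ {f = Δ s X Y pre} mid Δ-pre e) (·-congʳ pre {Δ s X Y mid} {mid-∂X∂Y} Δ-mid e))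
                      (cong₂ _+ℚ_ (crossXY-pre-mid e) (crossYX-pre-mid e)) ⟩
      (0ℚ +ℚ (pre · mid-∂X∂Y) e) +ℚ (0ℚ +ℚ 0ℚ) ≡⟨ trans (Q.+-identityʳ _) (Q.+-identityˡ _) ⟩
      (pre · mid-∂X∂Y) e ∎

    Δ-term : ∀ e → Δ s X Y term e ≡ ((pre · mid-∂X∂Y) · post) e
    Δ-term e = begin
      Δ s X Y term e ≡⟨ Δ-· s X Y (pre · mid) post e ⟩
      ((Δ s X Y (pre · mid) · post) e +ℚ ((pre · mid) · Δ s X Y post) e) +ℚ (cross s X Y (pre · mid) post e +ℚ cross s Y X (pre · mid) post e)
        ≡⟨ cong₂ _+ℚ_ (cong₂ _+ℚ_ (·-congˡ {f = Δ s X Y (pre · mid)} {pre · mid-∂X∂Y} post Δ-pre·mid e) (·-zeroʳ (pre · mid) {Δ s X Y post} Δ-post e))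
                      (cong₂ _+ℚ_ (crossXY-premid-post e) (crossYX-premid-post e)) ⟩
      (((pre · mid-∂X∂Y) · post) e +ℚ 0ℚ) +ℚ (0ℚ +ℚ 0ℚ) ≡⟨ trans (Q.+-identityʳ _) (Q.+-identityʳ _) ⟩
      ((pre · mid-∂X∂Y) · post) e ∎

    term-heat : HeatEq s term
    term-heat e = trans (q∂q-term e) (sym (Δ-term e))

𝔏-heat : ∀ μ m s → HeatEq s (𝔏 μ m s)
𝔏-heat μ m s = HeatEq-Σ< s s (λ j → 𝔏-summand.term μ m s j) (λ j j<s → 𝔏-summand.term-heat μ m s j j<s)

subst-Σ< : ∀ {n} m k (F : ℕ → PS m) (L : ℕ → ℕ → ℚ) (e : Vec ℕ n) →
  subst m (λ a → Σ< k (λ i → F i a)) L e ≡ Σ< k (λ i → subst m (F i) L e)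
subst-Σ< m k F L e =
  trans (Σ-cong (ofDeg m (sumV e)) (λ a → sym (Σ-*ʳ (monoL a L e) (upTo k) (λ i → F i a))))
        (Σ-swap (ofDeg m (sumV e)) (upTo k) (λ a i → F i a *ℚ monoL a L e))

subst-cong : ∀ {n} m {f g : PS m} (L : ℕ → ℕ → ℚ) → f ≗ g → ∀ (e : Vec ℕ n) → subst m f L e ≡ subst m g L e
subst-cong m L p e = Σ-cong (ofDeg m (sumV e)) (λ a → cong (_*ℚ monoL a L e) (p a))

Δ-subst : ∀ {n} r (XB YB : ℕ → ℕ) → (∀ t → t N.< r → XB t N.< n) → (∀ t → t N.< r → YB t N.< n) →
  ∀ m (f : PS m) (L : ℕ → ℕ → ℚ) o s k → o + (s + k) ≡ r →
  ∀ (XA YA : ℕ → ℕ) → (∀ t → t N.< s → XA t N.< m) → (∀ t → t N.< s → YA t N.< m) →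
  (∀ t → t N.< s → ∀ a → a N.< m → L a (XB (o + t)) ≡ [ a ≡ᵇ XA t ]) →
  (∀ t → t N.< s → ∀ a → a N.< m → L a (YB (o + t)) ≡ [ a ≡ᵇ YA t ]) →
  (∀ t → t N.< r → (t N.< o ⊎ o + s N.≤ t) → ∀ a → a N.< m → L a (YB t) ≡ 0ℚ) →
  ∀ (e : Vec ℕ n) → Δ r XB YB (subst m f L) e ≡ subst m (Δ s XA YA f) L e
Δ-subst {n} r XB YB hXB hYB m f L o s k o+s+k≡r XA YA hXA hYA X-inside Y-inside Y-outside e = begin
  Σ< r D                                                          ≡⟨ cong (λ z → Σ< z D) (sym o+s+k≡r) ⟩
  Σ< (o + (s + k)) D                                              ≡⟨ Σ<-split o (s + k) D ⟩
  Σ< o D +ℚ Σ< (s + k) (λ i → D (o + i))                           ≡⟨ cong (Σ< o D +ℚ_) (Σ<-split s k (λ i → D (o + i))) ⟩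
  Σ< o D +ℚ (Σ< s (λ i → D (o + i)) +ℚ Σ< k (λ i → D (o + (s + i))))
    ≡⟨ cong₂ (λ x y → x +ℚ (Σ< s (λ i → D (o + i)) +ℚ y))
         (Σ<-zero o D (λ t t<o → outside t (NP.<-≤-trans t<o (NP.≤-trans (NP.m≤m+n o (s + k)) (NP.≤-reflexive o+s+k≡r))) (inj₁ t<o)))
         (Σ<-zero k (λ i → D (o + (s + i))) (λ i i<k → outside (o + (s + i))
             (NP.<-≤-trans (NP.+-monoʳ-< o (NP.+-monoʳ-< s i<k)) (NP.≤-reflexive o+s+k≡r))
             (inj₂ (NP.+-monoʳ-≤ o (NP.m≤m+n s i))))) ⟩
  0ℚ +ℚ (Σ< s (λ i → D (o + i)) +ℚ 0ℚ)                             ≡⟨ trans (Q.+-identityˡ _) (Q.+-identityʳ _) ⟩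
  Σ< s (λ i → D (o + i))                                          ≡⟨ Σ<-cong s inside ⟩
  Σ< s (λ i → subst m (∂ (XA i) (∂ (YA i) f)) L e)                ≡⟨ subst-Σ< m s (λ i → ∂ (XA i) (∂ (YA i) f)) L e ⟨
  subst m (Δ s XA YA f) L e                                       ∎
  where
  D : ℕ → ℚ
  D t = ∂ (XB t) (∂ (YB t) (subst m f L)) e
  outside : ∀ t → t N.< r → (t N.< o ⊎ o + s N.≤ t) → D t ≡ 0ℚ
  outside t t<r h = zero⇒∂≡0 (XB t) (∂ (YB t) (subst m f L)) (∂≡0-subst (YB t) m f L (Y-outside t t<r h)) e
  o+i<r : ∀ i → i N.< s → o + i N.< r
  o+i<r i i<s = NP.<-≤-trans (NP.+-monoʳ-< o (NP.<-≤-trans i<s (NP.m≤m+n s k))) (NP.≤-reflexive o+s+k≡r)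
  inside : ∀ i → i N.< s → D (o + i) ≡ subst m (∂ (XA i) (∂ (YA i) f)) L e
  inside i i<s = trans
    (∂-cong (XB (o + i)) {∂ (YB (o + i)) (subst m f L)} {subst m (∂ (YA i) f) L}
            (∂-subst-δ (YB (o + i)) (hYB (o + i) (o+i<r i i<s)) m (YA i) (hYA i i<s) f L (Y-inside i i<s)) e)
    (∂-subst-δ (XB (o + i)) (hXB (o + i) (o+i<r i i<s)) m (XA i) (hXA i i<s) (∂ (YA i) f) L (X-inside i i<s) e)

-- Places the variables q, X₁ … X_s, Y₁ … Y_s of a depth-s block at q, X_{o+1} … X_{o+s},
-- Y_{o+1} … Y_{o+s} in depth r.
embed : (r o s : ℕ) → ℕ → ℕ → ℚ
embed r o s a v = if a ≡ᵇ 0 then [ v ≡ᵇ 0 ]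
                  else if a ≤ᵇ s then [ v ≡ᵇ o + a ]
                  else [ v ≡ᵇ 1 + r + o + (a ∸ suc s) ]

module Embedding (r o s : ℕ) (os≤r : o + s N.≤ r) where

  X Y : ℕ → ℕ
  X t = 1 + t
  Y t = 1 + r + t

  embed-≤ : ∀ a v → suc a N.≤ s → embed r o s (suc a) v ≡ [ v ≡ᵇ o + suc a ]
  embed-≤ a v h = if-true (≤ᵇ-true h)
  embed-> : ∀ a v → ¬ suc a N.≤ s → embed r o s (suc a) v ≡ [ v ≡ᵇ 1 + r + o + (a ∸ s) ]
  embed-> a v h = if-false (≤ᵇ-false h)

  o+suc : ∀ a → o + suc a ≡ suc (o + a)
  o+suc a = NP.+-suc o a

  o+suc≤r : ∀ a → suc a N.≤ s → o + suc a N.≤ r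
  o+suc≤r a h = NP.≤-trans (NP.+-monoʳ-≤ o h) os≤r

  X-inside : ∀ t → t N.< s → ∀ a → a N.< suc (s + s) → embed r o s a (X (o + t)) ≡ [ a ≡ᵇ 1 + t ]
  X-inside t t<s zero _ = refl
  X-inside t t<s (suc a) _ with suc a N.≤? s
  ... | yes h = trans (embed-≤ a (X (o + t)) h) (cong [_] (≡ᵇ-cong {X (o + t)} {o + suc a} {suc a} {1 + t}
         (λ q → cong suc (sym (NP.+-cancelˡ-≡ o t a (NP.suc-injective (trans q (o+suc a))))))
         (λ q → trans (cong (λ n → suc (o + n)) (sym (NP.suc-injective q))) (sym (o+suc a)))))
  ... | no h = trans (embed-> a (X (o + t)) h) (trans
         ([]≡0 (≡ᵇ-false {X (o + t)} {1 + r + o + (a ∸ s)} (λ q → NP.<⇒≱ (NP.+-monoʳ-< o t<s) (NP.≤-trans os≤r (≡.subst (r N.≤_) (sym (NP.suc-injective q)) (NP.≤-trans (NP.m≤m+n r o) (NP.m≤m+n (r + o) (a ∸ s))))))))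
         (sym ([]≡0 (≡ᵇ-false {suc a} {1 + t} (λ q → h (≡.subst (λ n → suc n N.≤ s) (sym (NP.suc-injective q)) t<s))))))

  Y-inside : ∀ t → t N.< s → ∀ a → a N.< suc (s + s) → embed r o s a (Y (o + t)) ≡ [ a ≡ᵇ 1 + s + t ]
  Y-inside t t<s zero _ = refl
  Y-inside t t<s (suc a) a< with suc a N.≤? s
  ... | yes h = trans (embed-≤ a (Y (o + t)) h) (trans
         ([]≡0 (≡ᵇ-false {Y (o + t)} {o + suc a} (λ q → NP.<⇒≱ (N.s≤s (NP.m≤m+n r (o + t))) (≡.subst (N._≤ r) (sym q) (o+suc≤r a h)))))
         (sym ([]≡0 (≡ᵇ-false {suc a} {1 + s + t} (λ q → NP.<⇒≱ (≡.subst (s N.<_) (sym q) (N.s≤s (NP.m≤m+n s t))) h)))))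
  ... | no h = trans (embed-> a (Y (o + t)) h) (cong [_] (≡ᵇ-cong {Y (o + t)} {1 + r + o + (a ∸ s)} {suc a} {1 + s + t}
         (λ q → cong suc (trans (sym (NP.m+[n∸m]≡n (NP.≤-pred (NP.≰⇒> h)))) (cong (s +_) (sym (t≡a∸s q)))))
         (λ q → cong suc (trans (sym (NP.+-assoc r o t)) (cong (r + o +_) (sym (trans (cong (_∸ s) (NP.suc-injective q)) (NP.m+n∸m≡n s t))))))))
    where
    t≡a∸s : suc (r + (o + t)) ≡ suc (r + o + (a ∸ s)) → t ≡ a ∸ s
    t≡a∸s q = NP.+-cancelˡ-≡ o t (a ∸ s) (NP.+-cancelˡ-≡ r (o + t) (o + (a ∸ s)) (trans (NP.suc-injective q) (NP.+-assoc r o (a ∸ s))))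

  ≢o+inside : ∀ t → (t N.< o ⊎ o + s N.≤ t) → ∀ d → d N.< s → ¬ t ≡ o + d
  ≢o+inside t (inj₁ t<o) d d<s q = NP.<⇒≱ t<o (≡.subst (o N.≤_) (sym q) (NP.m≤m+n o d))
  ≢o+inside t (inj₂ os≤t) d d<s q = NP.<⇒≱ (NP.+-monoʳ-< o d<s) (≡.subst (o + s N.≤_) q os≤t)

  X-outside : ∀ t → t N.< r → (t N.< o ⊎ o + s N.≤ t) → ∀ a → embed r o s a (X t) ≡ 0ℚ
  X-outside t t<r h zero = refl
  X-outside t t<r h (suc a) with suc a N.≤? s
  ... | yes le = trans (embed-≤ a (X t) le) ([]≡0 (≡ᵇ-false {X t} {o + suc a} (λ q → ≢o+inside t h a le (NP.suc-injective (trans q (o+suc a))))))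
  ... | no gt = trans (embed-> a (X t) gt) ([]≡0 (≡ᵇ-false {X t} {1 + r + o + (a ∸ s)} (λ q → NP.<⇒≱ t<r (≡.subst (r N.≤_) (sym (NP.suc-injective q)) (NP.≤-trans (NP.m≤m+n r o) (NP.m≤m+n (r + o) (a ∸ s)))))))

  Y-outside : ∀ t → t N.< r → (t N.< o ⊎ o + s N.≤ t) → ∀ a → a N.< suc (s + s) → embed r o s a (Y t) ≡ 0ℚ
  Y-outside t t<r h zero _ = refl
  Y-outside t t<r h (suc a) a< with suc a N.≤? s
  ... | yes le = trans (embed-≤ a (Y t) le) ([]≡0 (≡ᵇ-false {Y t} {o + suc a} (λ q → NP.<⇒≱ (N.s≤s (NP.m≤m+n r t)) (≡.subst (N._≤ r) (sym q) (o+suc≤r a le)))))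
  ... | no gt = trans (embed-> a (Y t) gt) ([]≡0 (≡ᵇ-false {Y t} {1 + r + o + (a ∸ s)} (λ q → ≢o+inside t h (a ∸ s) d<s
            (NP.+-cancelˡ-≡ r t (o + (a ∸ s)) (trans (NP.suc-injective q) (NP.+-assoc r o (a ∸ s)))))))
    where
    d<s : a ∸ s N.< s
    d<s = ≡.subst (a ∸ s N.<_) (NP.m+n∸m≡n s s) (NP.∸-monoˡ-< (NP.≤-pred a<) (NP.≤-pred (NP.≰⇒> gt)))

  compatible : WeightCompatible (suc (r + r)) qdeg qdeg (embed r o s)
  compatible zero zero _ = refl
  compatible zero (suc t) _ = refl
  compatible (suc a) zero _ = trans (cong (_*ℚ 1ℚ) embed-q≡0) (trans (Q.*-zeroˡ 1ℚ) (sym (trans (cong (_*ℚ 0ℚ) embed-q≡0) (Q.*-zeroˡ 0ℚ))))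
    where
    embed-q≡0 : embed r o s (suc a) 0 ≡ 0ℚ
    embed-q≡0 with suc a N.≤? s
    ... | yes le = trans (embed-≤ a 0 le) ([]≡0 (≡ᵇ-false {0} {o + suc a} (λ q → NP.0≢1+n (trans q (o+suc a)))))
    ... | no gt = trans (embed-> a 0 gt) refl
  compatible (suc a) (suc t) _ = refl

  module _ (L : ℕ → ℕ → ℚ) (L≗embed : ∀ a v → L a v ≡ embed r o s a v) (f : PS (suc (s + s))) where

    ∂X≡0 : ∀ t → t N.< r → (t N.< o ⊎ o + s N.≤ t) → ∂≡0 {suc (r + r)} (X t) (subst (suc (s + s)) f L)
    ∂X≡0 t t<r h = ∂≡0-subst (X t) (suc (s + s)) f L (λ a _ → trans (L≗embed a (X t)) (X-outside t t<r h a))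

    ∂Y≡0 : ∀ t → t N.< r → (t N.< o ⊎ o + s N.≤ t) → ∂≡0 {suc (r + r)} (Y t) (subst (suc (s + s)) f L)
    ∂Y≡0 t t<r h = ∂≡0-subst (Y t) (suc (s + s)) f L (λ a a< → trans (L≗embed a (Y t)) (Y-outside t t<r h a a<))

    heat : HeatEq s f → HeatEq r (subst (suc (s + s)) f L)
    heat hf e = begin
      q∂q (subst (suc (s + s)) f L) e                 ≡⟨ Euler-subst qdeg qdeg (suc (s + s)) f L compatibleL e ⟩
      subst (suc (s + s)) (q∂q f) L e                 ≡⟨ subst-cong (suc (s + s)) L hf e ⟩
      subst (suc (s + s)) (ΔXY s f) L e               ≡⟨ Δ-subst r X Y Xn Yn (suc (s + s)) f L o s (r ∸ (o + s))
                                                          (trans (sym (NP.+-assoc o s (r ∸ (o + s)))) (NP.m+[n∸m]≡n os≤r))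
                                                          (λ t → 1 + t) (λ t → 1 + s + t)
                                                          (λ t t<s → N.s≤s (NP.≤-trans t<s (NP.m≤m+n s s)))
                                                          (λ t t<s → N.s≤s (NP.+-monoʳ-< s t<s))
                                                          (λ t t<s a a< → trans (L≗embed a (X (o + t))) (X-inside t t<s a a<))
                                                          (λ t t<s a a< → trans (L≗embed a (Y (o + t))) (Y-inside t t<s a a<))
                                                          (λ t t<r h a a< → trans (L≗embed a (Y t)) (Y-outside t t<r h a a<)) e ⟨
      ΔXY r (subst (suc (s + s)) f L) e               ∎
      where
      compatibleL : WeightCompatible (suc (r + r)) qdeg qdeg L
      compatibleL a t t< = trans (cong (_*ℚ qdeg t) (L≗embed a t))
        (trans (compatible a t t<) (cong (_*ℚ qdeg a) (sym (L≗embed a t))))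
      Xn : ∀ t → t N.< r → X t N.< suc (r + r)
      Xn t t<r = N.s≤s (NP.≤-trans t<r (NP.m≤m+n r r))
      Yn : ∀ t → t N.< r → Y t N.< suc (r + r)
      Yn t t<r = N.s≤s (NP.+-monoʳ-< r t<r)

sum-compsF : ∀ f n → AllL.All (λ c → sum c ≡ n) (compsF f n)
sum-compsF f zero = refl AllL.∷ AllL.[]
sum-compsF zero (suc n) = AllL.[]
sum-compsF (suc f) (suc n) = AllLP.concat⁺ (AllLP.map⁺ (AllLP.applyUpTo⁺₁ (λ p → p) (suc n) (λ {p} p≤n →
  AllLP.map⁺ (AllL.map (λ c-sum → cong suc (trans (cong (p +_) c-sum) (NP.m+[n∸m]≡n (NP.≤-pred p≤n))))
                       (sum-compsF f (n ∸ p))))))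

module BlockProducts (μ : Mould) (r : ℕ) where

  block : ℕ → ℕ → ℕ → PS (suc (r + r))
  block s m o = subst (suc (s + s)) (𝔏 μ m s) (embed r o s)

  blockProd-∂≡0 : ∀ v ss ms o → o + sum ss N.≤ r →
    (∀ s m o′ → o′ + s N.≤ r → o N.≤ o′ → ∂≡0 v (block s m o′)) → ∂≡0 v (blockProd μ r ss ms o)
  blockProd-∂≡0 v [] ms o _ _ = ∂-one v
  blockProd-∂≡0 v (s ∷ ss) [] o _ _ = ∂-one v
  blockProd-∂≡0 v (s ∷ ss) (m ∷ ms) o o+Σ≤r free =
    ∂≡0-· v (block s m o) (blockProd μ r ss ms (o + s))
      (free s m o (NP.≤-trans (NP.+-monoʳ-≤ o (NP.m≤m+n s (sum ss))) o+Σ≤r) NP.≤-refl)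
      (blockProd-∂≡0 v ss ms (o + s) (≡.subst (N._≤ r) (sym (NP.+-assoc o s (sum ss))) o+Σ≤r)
        (λ s′ m′ o′ le o+s≤o′ → free s′ m′ o′ le (NP.≤-trans (NP.m≤m+n o s) o+s≤o′)))

  blockProd-heat : ∀ ss ms o → o + sum ss N.≤ r → HeatEq r (blockProd μ r ss ms o)
  blockProd-heat [] ms o _ = HeatEq-one r
  blockProd-heat (s ∷ ss) [] o _ = HeatEq-one r
  blockProd-heat (s ∷ ss) (m ∷ ms) o o+Σ≤r =
    HeatEq-· r (block s m o) (blockProd μ r ss ms (o + s))
      (Embedding.heat r o s o+s≤r (embed r o s) (λ _ _ → refl) (𝔏 μ m s) (𝔏-heat μ m s))
      (blockProd-heat ss ms (o + s) rest≤r)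
      (separate (λ t → 1 + t) (λ t → 1 + r + t) (Embedding.∂X≡0 r) (Embedding.∂Y≡0 r))
      (separate (λ t → 1 + r + t) (λ t → 1 + t) (Embedding.∂Y≡0 r) (Embedding.∂X≡0 r))
    where
    o+s≤r : o + s N.≤ r
    o+s≤r = NP.≤-trans (NP.+-monoʳ-≤ o (NP.m≤m+n s (sum ss))) o+Σ≤r
    rest≤r : o + s + sum ss N.≤ r
    rest≤r = ≡.subst (N._≤ r) (sym (NP.+-assoc o s (sum ss))) o+Σ≤r
    Outside : (ℕ → ℕ) → Set
    Outside V = ∀ o s → (os≤r : o + s N.≤ r) → ∀ L → (∀ a v → L a v ≡ embed r o s a v) → ∀ f t → t N.< r →
                (t N.< o ⊎ o + s N.≤ t) → ∂≡0 {suc (r + r)} (V t) (subst (suc (s + s)) f L)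
    separate : ∀ (V W : ℕ → ℕ) → Outside V → Outside W →
      ∀ t → t N.< r → ∂≡0 (V t) (block s m o) ⊎ ∂≡0 (W t) (blockProd μ r ss ms (o + s))
    separate V W outV outW t t<r with t N.<? o + s
    ... | yes t<o+s = inj₂ (blockProd-∂≡0 (W t) ss ms (o + s) rest≤r (λ s′ m′ o′ le o+s≤o′ →
            outW o′ s′ le (embed r o′ s′) (λ _ _ → refl) (𝔏 μ m′ s′) t t<r (inj₁ (NP.<-≤-trans t<o+s o+s≤o′))))
    ... | no t≮o+s = inj₁ (outV o s o+s≤r (embed r o s) (λ _ _ → refl) (𝔏 μ m s) t t<r (inj₂ (NP.≮⇒≥ t≮o+s)))

𝔤*-heat : ∀ μ M r → HeatEq r (𝔤* μ M r)
𝔤*-heat μ M r = HeatEq-ΣPSL r (comps r) _ (AllL.map (λ {c} c-sum →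
  HeatEq-ΣPSL r (chains (L.length c) M) _
    (AllL.universal (λ ms → BlockProducts.blockProd-heat μ r c ms 0 (NP.≤-reflexive c-sum)) _))
  (sum-compsF r r))

module 𝔊-summand (μ : Mould) (M r j : ℕ) where

  X Y : ℕ → ℕ
  X t = 1 + t
  Y t = 1 + r + t

  q : ℕ
  q = r ∸ j

  Lpre : ℕ → ℕ → ℚ
  Lpre a v = if a ≡ᵇ 0 then [ v ≡ᵇ 0 ]
             else if a ≤ᵇ j then [ v ≡ᵇ a ]
             else [ v ≡ᵇ 1 + r + (a ∸ suc j) ]

  Lpost : ℕ → ℕ → ℚ
  Lpost a v = if a <ᵇ q then [ v ≡ᵇ 1 + j + a ]
              else [ v ≡ᵇ 1 + r + j + (a ∸ q) ]

  pre post term : PS (suc (r + r))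
  pre = subst (suc (j + j)) (𝔤* μ M j) Lpre
  post = subst (q + q) (𝔟 μ q) Lpost
  term = pre · post

  Lpre≗embed : ∀ a v → Lpre a v ≡ embed r 0 j a v
  Lpre≗embed a v with a ≡ᵇ 0 | a ≤ᵇ j
  ... | true | _ = refl
  ... | false | true = refl
  ... | false | false = cong (λ z → [ v ≡ᵇ suc (z + (a ∸ suc j)) ]) (sym (NP.+-identityʳ r))

  q∂q-post : ∀ e → q∂q post e ≡ 0ℚ
  q∂q-post = q∂q-subst≡0 (q + q) (𝔟 μ q) Lpost (λ a → if-same (a <ᵇ q) 0ℚ)

  module _ (j≤r : j N.≤ r) where

    j+q : j + q ≡ r
    j+q = NP.m+[n∸m]≡n j≤r

    Lpost-< : ∀ a v → a N.< q → Lpost a v ≡ [ v ≡ᵇ 1 + j + a ]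
    Lpost-< a v h = if-true (<ᵇ-true h)
    Lpost-≥ : ∀ a v → ¬ a N.< q → Lpost a v ≡ [ v ≡ᵇ 1 + r + j + (a ∸ q) ]
    Lpost-≥ a v h = if-false (<ᵇ-false h)

    ja<r : ∀ a → a N.< q → j + a N.< r
    ja<r a a<q = NP.<-≤-trans (NP.+-monoʳ-< j a<q) (NP.≤-reflexive j+q)

    big : ∀ x → r N.≤ r + j + x
    big x = NP.≤-trans (NP.m≤m+n r j) (NP.m≤m+n (r + j) x)

    Lpost-X-inside : ∀ t → t N.< q → ∀ a → a N.< q + q → Lpost a (X (j + t)) ≡ [ a ≡ᵇ t ]
    Lpost-X-inside t t<q a a< with a N.<? q
    ... | yes a<q = trans (Lpost-< a (X (j + t)) a<q) (cong [_] (≡ᵇ-cong {X (j + t)} {1 + j + a} {a} {t}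
           (λ e → sym (NP.+-cancelˡ-≡ j t a (NP.suc-injective e))) (λ e → cong (λ z → suc (j + z)) (sym e))))
    ... | no a≮q = trans (Lpost-≥ a (X (j + t)) a≮q) (trans
           ([]≡0 (≡ᵇ-false {X (j + t)} {1 + r + j + (a ∸ q)} (λ e → NP.<⇒≱ (ja<r t t<q) (≡.subst (r N.≤_) (sym (NP.suc-injective e)) (big (a ∸ q))))))
           (sym ([]≡0 (≡ᵇ-false {a} {t} (λ e → a≮q (≡.subst (N._< q) (sym e) t<q))))))

    Lpost-Y-inside : ∀ t → t N.< q → ∀ a → a N.< q + q → Lpost a (Y (j + t)) ≡ [ a ≡ᵇ q + t ]
    Lpost-Y-inside t t<q a a< with a N.<? q
    ... | yes a<q = trans (Lpost-< a (Y (j + t)) a<q) (trans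
           ([]≡0 (≡ᵇ-false {Y (j + t)} {1 + j + a} (λ e → NP.<⇒≱ (ja<r a a<q) (≡.subst (r N.≤_) (NP.suc-injective e) (NP.m≤m+n r (j + t))))))
           (sym ([]≡0 (≡ᵇ-false {a} {q + t} (λ e → NP.<⇒≱ a<q (≡.subst (q N.≤_) (sym e) (NP.m≤m+n q t)))))))
    ... | no a≮q = trans (Lpost-≥ a (Y (j + t)) a≮q) (cong [_] (≡ᵇ-cong {Y (j + t)} {1 + r + j + (a ∸ q)} {a} {q + t}
           (λ e → trans (sym (NP.m+[n∸m]≡n (NP.≮⇒≥ a≮q))) (cong (q +_) (sym (tq e))))
           (λ e → cong suc (trans (sym (NP.+-assoc r j t)) (cong (r + j +_) (sym (trans (cong (_∸ q) e) (NP.m+n∸m≡n q t))))))))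
      where
      tq : suc (r + (j + t)) ≡ suc (r + j + (a ∸ q)) → t ≡ a ∸ q
      tq e = NP.+-cancelˡ-≡ j t (a ∸ q) (NP.+-cancelˡ-≡ r (j + t) (j + (a ∸ q)) (trans (NP.suc-injective e) (NP.+-assoc r j (a ∸ q))))

    Lpost-Y-outside : ∀ t → t N.< r → (t N.< j ⊎ j + q N.≤ t) → ∀ a → a N.< q + q → Lpost a (Y t) ≡ 0ℚ
    Lpost-Y-outside t t<r (inj₂ h) a _ = ⊥-elim (NP.<⇒≱ t<r (≡.subst (N._≤ t) j+q h))
    Lpost-Y-outside t t<r (inj₁ t<j) a a< with a N.<? q
    ... | yes a<q = trans (Lpost-< a (Y t) a<q) ([]≡0 (≡ᵇ-false {Y t} {1 + j + a} (λ e → NP.<⇒≱ (ja<r a a<q) (≡.subst (r N.≤_) (NP.suc-injective e) (NP.m≤m+n r t)))))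
    ... | no a≮q = trans (Lpost-≥ a (Y t) a≮q) ([]≡0 (≡ᵇ-false {Y t} {1 + r + j + (a ∸ q)} (λ e → NP.<⇒≱ t<j (≡.subst (j N.≤_) (sym (NP.+-cancelˡ-≡ r t (j + (a ∸ q)) (trans (NP.suc-injective e) (NP.+-assoc r j (a ∸ q))))) (NP.m≤m+n j (a ∸ q))))))

    Lpost-X-outside : ∀ t → t N.< j → ∀ a → Lpost a (X t) ≡ 0ℚ
    Lpost-X-outside t t<j a with a N.<? q
    ... | yes a<q = trans (Lpost-< a (X t) a<q) ([]≡0 (≡ᵇ-false {X t} {1 + j + a} (λ e → NP.<⇒≱ t<j (≡.subst (j N.≤_) (sym (NP.suc-injective e)) (NP.m≤m+n j a)))))
    ... | no a≮q = trans (Lpost-≥ a (X t) a≮q) ([]≡0 (≡ᵇ-false {X t} {1 + r + j + (a ∸ q)} (λ e → NP.<⇒≱ (NP.<-≤-trans t<j j≤r) (≡.subst (r N.≤_) (sym (NP.suc-injective e)) (big (a ∸ q))))))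

    ΔXY-post : ∀ e → ΔXY r post e ≡ 0ℚ
    ΔXY-post e = trans
      (Δ-subst r X Y Xn Yn (q + q) (𝔟 μ q) Lpost j q 0 (trans (cong (j +_) (NP.+-identityʳ q)) j+q)
         (λ t → t) (λ t → q + t) (λ t t< → NP.<-≤-trans t< (NP.m≤m+n q q)) (λ t t< → NP.+-monoʳ-< q t<)
         Lpost-X-inside Lpost-Y-inside (λ t t<r h a a< → Lpost-Y-outside t t<r h a a<) e)
      (subst-zero (q + q) (Δ q (λ t → t) (λ t → q + t) (𝔟 μ q)) Lpost
         (λ a → Σ<-zero q (λ t → ∂ t (∂ (q + t) (𝔟 μ q)) a) (λ t t<q → 𝔟-∂∂≡0 μ q t t NP.≤-refl t<q a)) e)
      where
      Xn : ∀ t → t N.< r → X t N.< suc (r + r)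
      Xn t t<r = N.s≤s (NP.≤-trans t<r (NP.m≤m+n r r))
      Yn : ∀ t → t N.< r → Y t N.< suc (r + r)
      Yn t t<r = N.s≤s (NP.+-monoʳ-< r t<r)

    term-heat : HeatEq r term
    term-heat = HeatEq-· r pre post
      (Embedding.heat r 0 j j≤r Lpre Lpre≗embed (𝔤* μ M j) (𝔤*-heat μ M j))
      (λ e → trans (q∂q-post e) (sym (ΔXY-post e)))
      separateXY separateYX
      where
      separateXY : ∀ t → t N.< r → ∂≡0 (X t) pre ⊎ ∂≡0 (Y t) post
      separateXY t t<r with t N.<? j
      ... | yes t<j = inj₂ (∂≡0-subst (Y t) (q + q) (𝔟 μ q) Lpost (Lpost-Y-outside t t<r (inj₁ t<j)))
      ... | no t≮j = inj₁ (Embedding.∂X≡0 r 0 j j≤r Lpre Lpre≗embed (𝔤* μ M j) t t<r (inj₂ (NP.≮⇒≥ t≮j)))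
      separateYX : ∀ t → t N.< r → ∂≡0 (Y t) pre ⊎ ∂≡0 (X t) post
      separateYX t t<r with t N.<? j
      ... | yes t<j = inj₂ (∂≡0-subst (X t) (q + q) (𝔟 μ q) Lpost (λ a _ → Lpost-X-outside t t<j a))
      ... | no t≮j = inj₁ (Embedding.∂Y≡0 r 0 j j≤r Lpre Lpre≗embed (𝔤* μ M j) t t<r (inj₂ (NP.≮⇒≥ t≮j)))

𝔊-heat : ∀ μ M r → HeatEq r (𝔊 μ M r)
𝔊-heat μ M r = HeatEq-Σ< r (suc r) (𝔊-summand.term μ M r) (λ j j≤r → 𝔊-summand.term-heat μ M r j (NP.≤-pred j≤r))

sucAt-lookup : ∀ {n} (v : Vec ℕ n) (i : Fin n) → sucAt (toℕ i) v ≡ suc (lookup v i)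
sucAt-lookup (x ∷ v) fz = refl
sucAt-lookup (x ∷ v) (fs i) = sucAt-lookup v i

incAt-updateAt : ∀ {n} (v : Vec ℕ n) (i : Fin n) → incAt (toℕ i) v ≡ v [ i ]%= suc
incAt-updateAt (x ∷ v) fz = refl
incAt-updateAt (x ∷ v) (fs i) = cong (x ∷_) (incAt-updateAt v i)

sucAt-++ˡ : ∀ {m n} (u : Vec ℕ m) (w : Vec ℕ n) (i : Fin m) → sucAt (toℕ i) (u V.++ w) ≡ sucAt (toℕ i) u
sucAt-++ˡ (x ∷ u) w fz = refl
sucAt-++ˡ (x ∷ u) w (fs i) = sucAt-++ˡ u w i

incAt-++ˡ : ∀ {m n} (u : Vec ℕ m) (w : Vec ℕ n) (i : Fin m) → incAt (toℕ i) (u V.++ w) ≡ incAt (toℕ i) u V.++ w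
incAt-++ˡ (x ∷ u) w fz = refl
incAt-++ˡ (x ∷ u) w (fs i) = cong (x ∷_) (incAt-++ˡ u w i)

sucAt-++ʳ : ∀ {m n} (u : Vec ℕ m) (w : Vec ℕ n) t → sucAt (m + t) (u V.++ w) ≡ sucAt t w
sucAt-++ʳ [] w t = refl
sucAt-++ʳ (x ∷ u) w t = sucAt-++ʳ u w t

incAt-++ʳ : ∀ {m n} (u : Vec ℕ m) (w : Vec ℕ n) t → incAt (m + t) (u V.++ w) ≡ u V.++ incAt t w
incAt-++ʳ [] w t = refl
incAt-++ʳ (x ∷ u) w t = cong (x ∷_) (incAt-++ʳ u w t)

Πfactorial : ∀ {n} → Vec ℕ n → ℚ
Πfactorial ds = Πℚ (map (λ d → ℕ→ℚ (d !)) (V.toList ds))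

Πfactorial-updateAt : ∀ {n} (ds : Vec ℕ n) (i : Fin n) →
  Πfactorial (ds [ i ]%= suc) ≡ ℕ→ℚ (suc (lookup ds i)) *ℚ Πfactorial ds
Πfactorial-updateAt (d ∷ ds) fz =
  trans (cong (_*ℚ Πfactorial ds) (ℕ→ℚ-* (suc d) (d !))) (Q.*-assoc (ℕ→ℚ (suc d)) (ℕ→ℚ (d !)) (Πfactorial ds))
Πfactorial-updateAt (d ∷ ds) (fs i) =
  trans (cong (ℕ→ℚ (d !) *ℚ_) (Πfactorial-updateAt ds i)) (*-leftComm (ℕ→ℚ (d !)) (ℕ→ℚ (suc (lookup ds i))) (Πfactorial ds))

Σ-allFin : ∀ r (h : Fin r → ℚ) (h′ : ℕ → ℚ) → (∀ i → h i ≡ h′ (toℕ i)) → Σℚ (map h (allFin r)) ≡ Σ< r h′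
Σ-allFin r h h′ p = trans (cong Σℚ (LP.map-tabulate (λ i → i) h)) (go r h h′ p)
  where
  go : ∀ r (h : Fin r → ℚ) (h′ : ℕ → ℚ) → (∀ i → h i ≡ h′ (toℕ i)) → Σℚ (L.tabulate h) ≡ Σ< r h′
  go zero h h′ p = refl
  go (suc r) h h′ p =
    trans (cong₂ _+ℚ_ (p fz) (go r (λ i → h (fs i)) (λ t → h′ (suc t)) (λ i → p (fs i)))) (sym (Σ<-suc r h′))

-- In the generating series the exponent of X_i is k_i − 1 and Y_i^{d_i} carries 1/d_i!,
-- so ∂_{X_i} ∂_{Y_i} produces the factor k_i (d_i + 1), and d_i + 1 is absorbed by the factorials.
∂X∂Y-coefficient : ∀ {r} (F : PS (suc (r + r))) N (ks ds : Vec ℕ r) → All (1 ≤_) ks → (i : Fin r) →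
  Πfactorial ds *ℚ ∂ (1 + toℕ i) (∂ (1 + r + toℕ i) F) (N ∷ (V.map (_∸ 1) ks V.++ ds))
  ≡ ℕ→ℚ (lookup ks i) *ℚ
    (Πfactorial (ds [ i ]%= suc) *ℚ F (N ∷ (V.map (_∸ 1) (ks [ i ]%= suc) V.++ (ds [ i ]%= suc))))
∂X∂Y-coefficient {r} F N ks ds ks≥1 i = begin
  Πfactorial ds *ℚ (ℕ→ℚ (sucAt t (km V.++ ds)) *ℚ (ℕ→ℚ (sucAt (r + t) (incAt t (km V.++ ds))) *ℚ
    F (N ∷ incAt (r + t) (incAt t (km V.++ ds)))))
    ≡⟨ cong (λ w → Πfactorial ds *ℚ (ℕ→ℚ (sucAt t (km V.++ ds)) *ℚ (ℕ→ℚ (sucAt (r + t) w) *ℚ F (N ∷ incAt (r + t) w))))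
            (incAt-++ˡ km ds i) ⟩
  Πfactorial ds *ℚ (ℕ→ℚ (sucAt t (km V.++ ds)) *ℚ (ℕ→ℚ (sucAt (r + t) (incAt t km V.++ ds)) *ℚ
    F (N ∷ incAt (r + t) (incAt t km V.++ ds))))
    ≡⟨ cong₂ (λ a b → Πfactorial ds *ℚ (ℕ→ℚ a *ℚ (ℕ→ℚ b *ℚ F (N ∷ incAt (r + t) (incAt t km V.++ ds)))))
             (trans (sucAt-++ˡ km ds i) (trans (sucAt-lookup km i) (trans (cong suc (VP.lookup-map i (_∸ 1) ks)) suc-k∸1)))
             (trans (sucAt-++ʳ (incAt t km) ds t) (sucAt-lookup ds i)) ⟩
  Πfactorial ds *ℚ (ℕ→ℚ k *ℚ (ℕ→ℚ (suc (lookup ds i)) *ℚ F (N ∷ incAt (r + t) (incAt t km V.++ ds))))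
    ≡⟨ cong (λ w → Πfactorial ds *ℚ (ℕ→ℚ k *ℚ (ℕ→ℚ (suc (lookup ds i)) *ℚ F (N ∷ w))))
            (trans (incAt-++ʳ (incAt t km) ds t)
                   (cong₂ V._++_ (trans (incAt-updateAt km i) (sym (VP.map-updateAt ks i (sym suc-k∸1))))
                                 (incAt-updateAt ds i))) ⟩
  Πfactorial ds *ℚ (ℕ→ℚ k *ℚ (ℕ→ℚ (suc (lookup ds i)) *ℚ F′))
    ≡⟨ regroup (Πfactorial ds) (ℕ→ℚ k) (ℕ→ℚ (suc (lookup ds i))) F′ ⟩
  ℕ→ℚ k *ℚ ((ℕ→ℚ (suc (lookup ds i)) *ℚ Πfactorial ds) *ℚ F′)
    ≡⟨ cong (λ z → ℕ→ℚ k *ℚ (z *ℚ F′)) (Πfactorial-updateAt ds i) ⟨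
  ℕ→ℚ k *ℚ (Πfactorial (ds [ i ]%= suc) *ℚ F′) ∎
  where
  t = toℕ i
  k = lookup ks i
  km = V.map (_∸ 1) ks
  F′ = F (N ∷ (V.map (_∸ 1) (ks [ i ]%= suc) V.++ (ds [ i ]%= suc)))
  suc-k∸1 : suc (k ∸ 1) ≡ k
  suc-k∸1 with k | AllVP.lookup⁺ ks≥1 i
  ... | suc _ | _ = refl
  regroup : ∀ P a b c → P *ℚ (a *ℚ (b *ℚ c)) ≡ a *ℚ ((b *ℚ P) *ℚ c)
  regroup = solve-∀ ℚ-ring

proposition6p29 : (β : Mould) → IsFixedMould β →
  (r : ℕ) → 1 ≤ r → (ks ds : Vec ℕ r) → All (1 ≤_) ks →
  (N : ℕ) →
  qddq (G β ks ds) N ≡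
    Σℚ (map (λ (i : Fin r) → ℕ→ℚ (lookup ks i) *ℚ
               G β (ks [ i ]%= suc) (ds [ i ]%= suc) N)
            (allFin r))
proposition6p29 β _ r _ ks ds ks≥1 N = begin
  ℕ→ℚ N *ℚ (Πfactorial ds *ℚ 𝔊 β N r e)          ≡⟨ *-leftComm (ℕ→ℚ N) (Πfactorial ds) (𝔊 β N r e) ⟩
  Πfactorial ds *ℚ (ℕ→ℚ N *ℚ 𝔊 β N r e)          ≡⟨ cong (λ z → Πfactorial ds *ℚ (z *ℚ 𝔊 β N r e)) qdeg-e ⟨
  Πfactorial ds *ℚ q∂q (𝔊 β N r) e               ≡⟨ cong (Πfactorial ds *ℚ_) (𝔊-heat β N r e) ⟩
  Πfactorial ds *ℚ ΔXY r (𝔊 β N r) e             ≡⟨ Σ-*ˡ (Πfactorial ds) (upTo r) ∂X∂Y𝔊 ⟨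
  Σ< r (λ t → Πfactorial ds *ℚ ∂X∂Y𝔊 t)          ≡⟨ Σ-allFin r _ _ (λ i → sym (∂X∂Y-coefficient (𝔊 β N r) N ks ds ks≥1 i)) ⟨
  Σℚ (map (λ i → ℕ→ℚ (lookup ks i) *ℚ G β (ks [ i ]%= suc) (ds [ i ]%= suc) N) (allFin r)) ∎
  where
  e = N ∷ (V.map (_∸ 1) ks V.++ ds)
  ∂X∂Y𝔊 : ℕ → ℚ
  ∂X∂Y𝔊 t = ∂ (1 + t) (∂ (1 + r + t) (𝔊 β N r)) e
  qdeg-e : dotV qdeg e ≡ ℕ→ℚ N
  qdeg-e = trans (cong (1ℚ *ℚ ℕ→ℚ N +ℚ_) (dotV-zero (V.map (_∸ 1) ks V.++ ds)))
                 (trans (Q.+-identityʳ _) (Q.*-identityˡ _))
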